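{- Let $k\in\mathbb{N}$ and, for $i\in\{0,1,\dots,k-1\}$, let $a_{ki}\in\mathbb{Q}$ be defined by $\frac{(X-1)(X-2)\cdots(X-k+1)}{(k-1)!}=\sum_{i=0}^{k-1}a_{ki}X^i$ (equivalently $a_{ki}=s(k,i+1)/(k-1)!$, with $s(k,\cdot)$ the Stirling numbers of the first kind). Then: (i) For every $n\geq 1$, $c_k'(n)=\sum_{i=0}^{k-1}a_{ki}J_i(n)$; in particular $c_k'$ is a $\mathbb{Q}$-linear combination of Jordan totient functions. (ii) For $k\geq 2$, $c_k'(n)=\frac{1}{(k-1)!}J_{k-1}(n)+O(n^{k-2})$. (iii) For $k\geq 2$, $p_k(n)=\frac{1}{k!(k-1)!}n^{k-1}+O(n^{k-2})$ and $p_k'(n)=\frac{1}{k!(k-1)!}J_{k-1}(n)+O(n^{k-2})$. All implied constants in the Landau symbols depend on $k$.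
   Context: A $k$-composition of $n\in\mathbb{N}$ is an ordered $k$-tuple $(x_1,\dots,x_k)$ of positive integers with sum $n$; a $k$-partition is an unordered such $k$-tuple. A composition or partition is coprime if $\gcd(x_1,\dots,x_k)=1$. $c_k'(n)$ denotes the number of coprime $k$-compositions of $n$, $p_k(n)$ the number of $k$-partitions of $n$, and $p_k'(n)$ the number of coprime $k$-partitions of $n$. $J_t(n)=\sum_{d\mid n}d^t\mu(n/d)$ is the Jordan totient function of degree $t\in\mathbb{N}_0$, with $\mu$ the Möbius function. -}

module Defs where

open import Data.Bool using (Bool; true; false; _∧_; _∨_)
open import Data.Product using (Σ)
open import Data.Nat as ℕ using (ℕ; zero; suc; _∸_; _≡ᵇ_; _≤ᵇ_; _!)
open import Data.Nat.Properties using (_!≢0)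
open import Data.Nat.Divisibility using (_∣?_)
open import Data.Nat.Primality using (prime?)
open import Data.Nat.GCD using (gcd)
open import Data.Integer as ℤ using (ℤ; +_)
open import Data.Rational as ℚ using (ℚ; 0ℚ; 1ℚ)
open import Data.List using (List; []; _∷_; [_]; map; concatMap; upTo; filterᵇ; length; foldr; applyUpTo)
open import Data.Vec as Vec using (Vec; []; _∷_; toList)
open import Relation.Nullary.Decidable using (does)

tuplesBelow : (k m : ℕ) → List (Vec ℕ k)
tuplesBelow zero    m = [ [] ]
tuplesBelow (suc k) m = concatMap (λ x → map (x ∷_) (tuplesBelow k m)) (upTo m)

sumV : ∀ {k} → Vec ℕ k → ℕ
sumV = Vec.foldr _ ℕ._+_ 0

allPositive : ∀ {k} → Vec ℕ k → Bool
allPositive v = foldr (λ x b → (1 ≤ᵇ x) ∧ b) true (toList v)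

-- gcd(x₁,…,x_k)  (gcd of the empty tuple is 0)
gcdV : ∀ {k} → Vec ℕ k → ℕ
gcdV v = foldr gcd 0 (toList v)

nonIncreasing : List ℕ → Bool
nonIncreasing []           = true
nonIncreasing (x ∷ [])     = true
nonIncreasing (x ∷ y ∷ xs) = (y ≤ᵇ x) ∧ nonIncreasing (y ∷ xs)

isComposition : ∀ {k} → ℕ → Vec ℕ k → Bool
isComposition n v = allPositive v ∧ (sumV v ≡ᵇ n)

isCoprime : ∀ {k} → Vec ℕ k → Bool
isCoprime v = gcdV v ≡ᵇ 1

-- every k-composition of n has all entries in {1,…,n} ⊆ {0,…,n}
compositions : (k n : ℕ) → List (Vec ℕ k)
compositions k n = filterᵇ (isComposition n) (tuplesBelow k (suc n))

-- k-partitions of n, each listed once as its non-increasing arrangement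
partitions : (k n : ℕ) → List (Vec ℕ k)
partitions k n = filterᵇ (λ v → nonIncreasing (toList v)) (compositions k n)

c′ : ℕ → ℕ → ℕ
c′ k n = length (filterᵇ isCoprime (compositions k n))

p : ℕ → ℕ → ℕ
p k n = length (partitions k n)

p′ : ℕ → ℕ → ℕ
p′ k n = length (filterᵇ isCoprime (partitions k n))

hasSquareFactor : ℕ → Bool
hasSquareFactor n = foldr (λ j b → does (((suc (suc j)) ℕ.* (suc (suc j))) ∣? n) ∨ b) false (upTo n)

ω : ℕ → ℕ
ω n = length (filterᵇ (λ q → does (prime? q) ∧ does (q ∣? n)) (upTo (suc n)))

μ : ℕ → ℤ
μ n with hasSquareFactor n
... | true  = + 0
... | false = (ℤ.- (+ 1)) ℤ.^ ω n

J : ℕ → ℕ → ℤ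
J t n = foldr ℤ._+_ (+ 0)
  (map (λ j → if′ (does (suc j ∣? n)) (+ (suc j ℕ.^ t) ℤ.* μ (n ℕ./ suc j)) (+ 0)) (upTo n))
  where
  if′ : Bool → ℤ → ℤ → ℤ
  if′ true  a b = a
  if′ false a b = b

-- polynomials over ℚ as coefficient lists, lowest degree first
addP : List ℚ → List ℚ → List ℚ
addP []       q        = q
addP p        []       = p
addP (a ∷ p)  (b ∷ q)  = (a ℚ.+ b) ∷ addP p q

mulXminus : ℚ → List ℚ → List ℚ
mulXminus c P = addP (0ℚ ∷ P) (map (λ a → ℚ.- (c ℚ.* a)) P)

fallingPoly : ℕ → List ℚ
fallingPoly zero    = [ 1ℚ ]
fallingPoly (suc m) = mulXminus (+ suc m ℚ./ 1) (fallingPoly m)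

coeff : List ℚ → ℕ → ℚ
coeff []      i       = 0ℚ
coeff (a ∷ P) zero    = a
coeff (a ∷ P) (suc i) = coeff P i

a : ℕ → ℕ → ℚ
a k i = coeff (fallingPoly (k ∸ 1)) i ℚ.* ((+ 1) ℚ./ ((k ∸ 1) !))
  where instance _ = (k ∸ 1) !≢0

ℕtoℚ : ℕ → ℚ
ℕtoℚ n = + n ℚ./ 1

ℤtoℚ : ℤ → ℚ
ℤtoℚ z = z ℚ./ 1

Σ< : ℕ → (ℕ → ℚ) → ℚ
Σ< m f = foldr ℚ._+_ 0ℚ (map f (upTo m))

_≈_+O[n^_] : (ℕ → ℚ) → (ℕ → ℚ) → ℕ → Set
f ≈ g +O[n^ e ] = Σ ℚ λ C → ∀ n → 1 ℕ.≤ n →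
  ℚ.∣ f n ℚ.- g n ∣ ℚ.≤ C ℚ.* ℕtoℚ (n ℕ.^ e)


inv! : ℕ → ℚ
inv! m = (+ 1) ℚ./ (m !)
  where instance _ = m !≢0

{-# OPTIONS --safe #-}

-- If a weight Φ(n, v) on k-tuples v is invariant under scaling, Φ(an, av) = Φ(n, v), then grouping
-- the tuples with entries at most n by g = gcd(v₁, …, v_k, n) and dividing them by g shows that
-- ∑_v Φ(n, v) = ∑_{d ∣ n} Ψ(d), where Ψ(d) is the same sum restricted to gcd(v, d) = 1; Möbius
-- inversion gives Ψ(n) = ∑_{cd = n} μ(c) ∑_v Φ(d, v).  For Φ = [all entries < n] this is J_t(n),
-- which is therefore between 0 and n^t.  For Φ = [v is a composition of n] it is c′_k(n), and since
-- d has binom(d-1, k-1) = (d-1)⋯(d-k+1)/(k-1)! compositions, expanding this polynomial gives (i);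
-- (ii) follows because |J_i(n)| ≤ n^i.
-- For (iii), every k-partition of n with distinct parts arises from exactly k! compositions and any
-- other from at most k!, while only O(n^{k-2}) compositions have a repeated part; hence
-- k! p_k(n) = c_k(n) + O(n^{k-2}) and k! p′_k(n) = c′_k(n) + O(n^{k-2}).

module Submission where

open import Defs
open import Data.Nat using (ℕ; _≤_; _∸_; _^_)
open import Data.Rational using (ℚ; _*_)
open import Data.Product using (_×_)
open import Relation.Binary.PropositionalEquality using (_≡_)

open import Data.Bool using (Bool; true; false; _∧_; _∨_; not; if_then_else_)
import Data.Bool.Properties as BoolP
open import Data.Empty using (⊥-elim)
open import Data.Integer as ℤ using (ℤ; +_)
import Data.Integer.Properties as ℤP
open import Data.Integer.Solver renaming (module +-*-Solver to ℤ-Solver)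
open import Data.List using (List; []; _∷_; map; concatMap; upTo; filterᵇ; length; foldr; applyUpTo; _++_)
import Data.List.Properties as ListP
import Data.List.Relation.Unary.All as All
open import Data.Nat as ℕ using (zero; suc; _+_; _<_; z≤n; s≤s; NonZero; _!) renaming (_*_ to _*ₙ_)
import Data.Nat.Properties as ℕP
open import Data.Nat.Properties using (_!≢0)
open import Data.Nat.Coprimality as Coprime using (Coprime)
open import Data.Nat.Divisibility using (_∣_; _∣?_; divides)
import Data.Nat.Divisibility as ℕD
import Data.Nat.DivMod as ℕDM
open import Data.Nat.GCD using (gcd)
import Data.Nat.GCD as GCD
import Data.Nat.ListAction as ListAction
open import Data.Nat.Primality using (Prime; prime?)
import Data.Nat.Primality as Primality
import Data.Nat.Primality.Factorisation as Factorisation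
open import Data.Nat.Solver renaming (module +-*-Solver to ℕ-Solver)
open import Data.Product using (_,_; proj₁; proj₂; Σ)
open import Data.Rational as ℚ using (0ℚ; 1ℚ)
  renaming (_+_ to _+q_; _-_ to _-q_; -_ to -q_; _≤_ to _≤q_; ∣_∣ to ∣_∣q)
import Data.Rational.Properties as ℚP
open import Data.Rational.Solver renaming (module +-*-Solver to ℚ-Solver)
import Data.Rational.Unnormalised as ℚᵘ
import Data.Rational.Unnormalised.Properties as ℚᵘP
open import Data.Sum using (inj₁; inj₂; [_,_]′)
open import Data.Unit using (⊤; tt)
open import Data.Vec using (Vec; []; _∷_; toList)
open import Function using (_∘_; Equivalence)
open import Relation.Binary.PropositionalEquality
  using (refl; sym; trans; cong; cong₂; subst; subst₂; _≢_; module ≡-Reasoning)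
open import Relation.Nullary using (¬_; yes; no; does)
import Relation.Nullary.Decidable as Dec

ℤtoℚ-toℚᵘ : ∀ z → ℚᵘ._≃_ (ℚ.toℚᵘ (ℤtoℚ z)) (ℚᵘ.mkℚᵘ z 0)
ℤtoℚ-toℚᵘ z = ℚP.toℚᵘ-fromℚᵘ (ℚᵘ.mkℚᵘ z 0)

ℤtoℚ-+ : ∀ a b → ℤtoℚ (a ℤ.+ b) ≡ ℤtoℚ a +q ℤtoℚ b
ℤtoℚ-+ a b = ℚP.toℚᵘ-injective (begin
    ℚ.toℚᵘ (ℤtoℚ (a ℤ.+ b))              ≈⟨ ℤtoℚ-toℚᵘ (a ℤ.+ b) ⟩
    ℚᵘ.mkℚᵘ (a ℤ.+ b) 0                  ≈⟨ ℚᵘ.*≡* (ℤ-Solver.solve 2 (λ a b →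
                                              (a :+ b) :* con (+ 1) := (a :* con (+ 1) :+ b :* con (+ 1)) :* con (+ 1)) refl a b) ⟩
    ℚᵘ.mkℚᵘ a 0 ℚᵘ.+ ℚᵘ.mkℚᵘ b 0         ≈⟨ ℚᵘP.+-cong (ℚᵘP.≃-sym (ℤtoℚ-toℚᵘ a)) (ℚᵘP.≃-sym (ℤtoℚ-toℚᵘ b)) ⟩
    ℚ.toℚᵘ (ℤtoℚ a) ℚᵘ.+ ℚ.toℚᵘ (ℤtoℚ b) ≈⟨ ℚᵘP.≃-sym (ℚP.toℚᵘ-homo-+ (ℤtoℚ a) (ℤtoℚ b)) ⟩
    ℚ.toℚᵘ (ℤtoℚ a +q ℤtoℚ b)            ∎)
  where open ℚᵘP.≃-Reasoning
        open ℤ-Solver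

ℤtoℚ-* : ∀ a b → ℤtoℚ (a ℤ.* b) ≡ ℤtoℚ a * ℤtoℚ b
ℤtoℚ-* a b = ℚP.toℚᵘ-injective (begin
    ℚ.toℚᵘ (ℤtoℚ (a ℤ.* b))              ≈⟨ ℤtoℚ-toℚᵘ (a ℤ.* b) ⟩
    ℚᵘ.mkℚᵘ (a ℤ.* b) 0                  ≈⟨ ℚᵘP.*-cong (ℚᵘP.≃-sym (ℤtoℚ-toℚᵘ a)) (ℚᵘP.≃-sym (ℤtoℚ-toℚᵘ b)) ⟩
    ℚ.toℚᵘ (ℤtoℚ a) ℚᵘ.* ℚ.toℚᵘ (ℤtoℚ b) ≈⟨ ℚᵘP.≃-sym (ℚP.toℚᵘ-homo-* (ℤtoℚ a) (ℤtoℚ b)) ⟩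
    ℚ.toℚᵘ (ℤtoℚ a * ℤtoℚ b)             ∎)
  where open ℚᵘP.≃-Reasoning

ℤtoℚ-neg : ∀ a → ℤtoℚ (ℤ.- a) ≡ -q ℤtoℚ a
ℤtoℚ-neg a = ℚP.toℚᵘ-injective (begin
    ℚ.toℚᵘ (ℤtoℚ (ℤ.- a))        ≈⟨ ℤtoℚ-toℚᵘ (ℤ.- a) ⟩
    ℚᵘ.-_ (ℚᵘ.mkℚᵘ a 0)          ≈⟨ ℚᵘP.-‿cong (ℚᵘP.≃-sym (ℤtoℚ-toℚᵘ a)) ⟩
    ℚᵘ.-_ (ℚ.toℚᵘ (ℤtoℚ a))      ≈⟨ ℚᵘP.≃-sym (ℚP.toℚᵘ-homo‿- (ℤtoℚ a)) ⟩
    ℚ.toℚᵘ (-q ℤtoℚ a)           ∎)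
  where open ℚᵘP.≃-Reasoning

ℤtoℚ-injective : ∀ {a b} → ℤtoℚ a ≡ ℤtoℚ b → a ≡ b
ℤtoℚ-injective {a} {b} e
  with ℚᵘP.≃-trans (ℚᵘP.≃-sym (ℤtoℚ-toℚᵘ a)) (ℚᵘP.≃-trans (ℚP.toℚᵘ-cong e) (ℤtoℚ-toℚᵘ b))
... | ℚᵘ.*≡* eq = trans (sym (ℤP.*-identityʳ a)) (trans eq (ℤP.*-identityʳ b))

ℕtoℚ-+ : ∀ a b → ℕtoℚ (a + b) ≡ ℕtoℚ a +q ℕtoℚ b
ℕtoℚ-+ a b = trans (cong ℤtoℚ (ℤP.pos-+ a b)) (ℤtoℚ-+ (+ a) (+ b))

ℕtoℚ-* : ∀ a b → ℕtoℚ (a *ₙ b) ≡ ℕtoℚ a * ℕtoℚ b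
ℕtoℚ-* a b = trans (cong ℤtoℚ (ℤP.pos-* a b)) (ℤtoℚ-* (+ a) (+ b))

ℕtoℚ-suc : ∀ n → ℕtoℚ (suc n) ≡ 1ℚ +q ℕtoℚ n
ℕtoℚ-suc = ℕtoℚ-+ 1

ℕtoℚ-injective : ∀ {a b} → ℕtoℚ a ≡ ℕtoℚ b → a ≡ b
ℕtoℚ-injective = ℤP.+-injective ∘ ℤtoℚ-injective

ℕtoℚ-nonNeg : ∀ n → 0ℚ ≤q ℕtoℚ n
ℕtoℚ-nonNeg n = ℚP.nonNegative⁻¹ (ℕtoℚ n) {{ℚP.normalize-nonNeg n 1}}

ℕtoℚ-mono-≤ : ∀ {m n} → m ≤ n → ℕtoℚ m ≤q ℕtoℚ n
ℕtoℚ-mono-≤ {m} {n} m≤n = subst₂ _≤q_ (ℚP.+-identityʳ (ℕtoℚ m))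
  (trans (sym (ℕtoℚ-+ m (n ∸ m))) (cong ℕtoℚ (ℕP.m+[n∸m]≡n m≤n)))
  (ℚP.+-monoʳ-≤ (ℕtoℚ m) (ℕtoℚ-nonNeg (n ∸ m)))

1/n*n≡1 : ∀ n .{{_ : NonZero n}} → ((+ 1) ℚ./ n) * ℕtoℚ n ≡ 1ℚ
1/n*n≡1 (suc n) = ℚP.toℚᵘ-injective (begin
    ℚ.toℚᵘ (((+ 1) ℚ./ suc n) * ℕtoℚ (suc n))           ≈⟨ ℚP.toℚᵘ-homo-* ((+ 1) ℚ./ suc n) (ℕtoℚ (suc n)) ⟩
    ℚ.toℚᵘ ((+ 1) ℚ./ suc n) ℚᵘ.* ℚ.toℚᵘ (ℕtoℚ (suc n)) ≈⟨ ℚᵘP.*-cong (ℚP.toℚᵘ-fromℚᵘ (ℚᵘ.mkℚᵘ (+ 1) n)) (ℤtoℚ-toℚᵘ (+ suc n)) ⟩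
    ℚᵘ.mkℚᵘ (+ 1) n ℚᵘ.* ℚᵘ.mkℚᵘ (+ suc n) 0            ≈⟨ ℚᵘ.*≡* (cong (λ z → + suc z) (ℕ-Solver.solve 1 (λ n →
                                                              (n :+ con 0) :* con 1 := n :* con 1 :+ con 0) refl n)) ⟩
    ℚ.toℚᵘ 1ℚ                                           ∎)
  where open ℚᵘP.≃-Reasoning
        open ℕ-Solver

inv!-nonNeg : ∀ m → 0ℚ ≤q inv! m
inv!-nonNeg m = ℚP.nonNegative⁻¹ (inv! m) {{ℚP.normalize-nonNeg 1 (m !) {{m !≢0}}}}

inv!*! : ∀ m → inv! m * ℕtoℚ (m !) ≡ 1ℚ
inv!*! m = 1/n*n≡1 (m !) {{m !≢0}}

inv!-suc : ∀ m → inv! (suc m) * ℕtoℚ (suc m) ≡ inv! m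
inv!-suc m = begin
    u * k              ≡⟨ sym (ℚP.*-identityʳ (u * k)) ⟩
    (u * k) * 1ℚ       ≡⟨ cong ((u * k) *_) (sym (inv!*! m)) ⟩
    (u * k) * (w * f)  ≡⟨ solve 4 (λ u k w f → (u :* k) :* (w :* f) := w :* (u :* (k :* f))) refl u k w f ⟩
    w * (u * (k * f))  ≡⟨ cong (λ z → w * (u * z)) (sym (ℕtoℚ-* (suc m) (m !))) ⟩
    w * (u * ℕtoℚ (suc m !)) ≡⟨ cong (w *_) (inv!*! (suc m)) ⟩
    w * 1ℚ             ≡⟨ ℚP.*-identityʳ w ⟩
    w                  ∎
  where
  open ≡-Reasoning
  open ℚ-Solver
  u = inv! (suc m)
  w = inv! m
  k = ℕtoℚ (suc m)
  f = ℕtoℚ (m !)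

-- The builtin `_≡ᵇ_` has no fixity declaration.
infix 4 _≡ᵇ_
_≡ᵇ_ : ℕ → ℕ → Bool
_≡ᵇ_ = ℕ._≡ᵇ_

≡ᵇ-true : ∀ {m n} → m ≡ n → (m ≡ᵇ n) ≡ true
≡ᵇ-true {m} {n} = Equivalence.to BoolP.T-≡ ∘ ℕP.≡⇒≡ᵇ m n

≡ᵇ-sound : ∀ {m n} → (m ≡ᵇ n) ≡ true → m ≡ n
≡ᵇ-sound {m} {n} = ℕP.≡ᵇ⇒≡ m n ∘ Equivalence.from BoolP.T-≡

≡ᵇ-false : ∀ {m n} → m ≢ n → (m ≡ᵇ n) ≡ false
≡ᵇ-false m≢n = BoolP.¬-not (m≢n ∘ ≡ᵇ-sound)

≡ᵇ-sym : ∀ x y → (x ≡ᵇ y) ≡ (y ≡ᵇ x)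
≡ᵇ-sym zero    zero    = refl
≡ᵇ-sym zero    (suc y) = refl
≡ᵇ-sym (suc x) zero    = refl
≡ᵇ-sym (suc x) (suc y) = ≡ᵇ-sym x y

≡ᵇ-*-cancelˡ : ∀ a x m → 1 ≤ a → (a *ₙ x ≡ᵇ a *ₙ m) ≡ (x ≡ᵇ m)
≡ᵇ-*-cancelˡ a x m a≥1 with x ℕ.≟ m
... | yes refl = trans (≡ᵇ-true {a *ₙ x} refl) (sym (≡ᵇ-true {x} refl))
... | no  x≢m  = trans (≡ᵇ-false (x≢m ∘ ℕP.*-cancelˡ-≡ x m a {{ℕ.>-nonZero a≥1}})) (sym (≡ᵇ-false x≢m))

<ᵇ-true : ∀ {x y} → x < y → (x ℕ.<ᵇ y) ≡ true
<ᵇ-true = Equivalence.to BoolP.T-≡ ∘ ℕP.<⇒<ᵇ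

<ᵇ-false : ∀ {x y} → ¬ x < y → (x ℕ.<ᵇ y) ≡ false
<ᵇ-false {x} {y} x≮y = BoolP.¬-not (x≮y ∘ ℕP.<ᵇ⇒< x y ∘ Equivalence.from BoolP.T-≡)

<ᵇ-*-cancelˡ : ∀ a x m → 1 ≤ a → (a *ₙ x ℕ.<ᵇ a *ₙ m) ≡ (x ℕ.<ᵇ m)
<ᵇ-*-cancelˡ a x m a≥1 with x ℕ.<? m
... | yes x<m = trans (<ᵇ-true (ℕP.*-monoʳ-< a {{ℕ.>-nonZero a≥1}} x<m)) (sym (<ᵇ-true x<m))
... | no  x≮m = trans (<ᵇ-false (x≮m ∘ ℕP.*-cancelˡ-< a x m)) (sym (<ᵇ-false x≮m))

≤ᵇ-true : ∀ {x y} → x ≤ y → (x ℕ.≤ᵇ y) ≡ true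
≤ᵇ-true = Equivalence.to BoolP.T-≡ ∘ ℕP.≤⇒≤ᵇ

≤ᵇ-sound : ∀ {x y} → (x ℕ.≤ᵇ y) ≡ true → x ≤ y
≤ᵇ-sound {x} {y} = ℕP.≤ᵇ⇒≤ x y ∘ Equivalence.from BoolP.T-≡

≤ᵇ-false : ∀ {x y} → ¬ x ≤ y → (x ℕ.≤ᵇ y) ≡ false
≤ᵇ-false x≰y = BoolP.¬-not (x≰y ∘ ≤ᵇ-sound)

1≤ᵇ-*-cancelˡ : ∀ a x → 1 ≤ a → (1 ℕ.≤ᵇ a *ₙ x) ≡ (1 ℕ.≤ᵇ x)
1≤ᵇ-*-cancelˡ (suc a) zero    _ rewrite ℕP.*-zeroʳ a = refl
1≤ᵇ-*-cancelˡ (suc a) (suc x) _ = refl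

infix 4 _∣ᵇ_
_∣ᵇ_ : ℕ → ℕ → Bool
a ∣ᵇ n = does (a ∣? n)

∣ᵇ-true : ∀ {a n} → a ∣ n → (a ∣ᵇ n) ≡ true
∣ᵇ-true {a} {n} = Dec.dec-true (a ∣? n)

∣ᵇ-false : ∀ {a n} → ¬ a ∣ n → (a ∣ᵇ n) ≡ false
∣ᵇ-false {a} {n} = Dec.dec-false (a ∣? n)

∣ᵇ-sound : ∀ {a n} → (a ∣ᵇ n) ≡ true → a ∣ n
∣ᵇ-sound {a} {n} e with a ∣? n
... | yes a∣n = a∣n

∧-true-l : ∀ a {b} → (a ∧ b) ≡ true → a ≡ true
∧-true-l true _ = refl

∧-true-r : ∀ a {b} → (a ∧ b) ≡ true → b ≡ true
∧-true-r true e = e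

∨-true-l : ∀ {a} b → a ≡ true → (a ∨ b) ≡ true
∨-true-l b refl = refl

∨-true-r : ∀ a {b} → b ≡ true → (a ∨ b) ≡ true
∨-true-r true  _ = refl
∨-true-r false e = e

not-true : ∀ {a} → not a ≡ true → a ≡ false
not-true {false} _ = refl

bool-ext : ∀ (a b : Bool) → (a ≡ true → b ≡ true) → (b ≡ true → a ≡ true) → a ≡ b
bool-ext true  true  _ _ = refl
bool-ext true  false f _ = sym (f refl)
bool-ext false true  _ g = g refl
bool-ext false false _ _ = refl

⟦_⟧ : Bool → ℚ
⟦ true  ⟧ = 1ℚ
⟦ false ⟧ = 0ℚ

⟦∧⟧ : ∀ a b → ⟦ a ∧ b ⟧ ≡ ⟦ a ⟧ * ⟦ b ⟧
⟦∧⟧ true  b = sym (ℚP.*-identityˡ ⟦ b ⟧)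
⟦∧⟧ false b = sym (ℚP.*-zeroˡ ⟦ b ⟧)

⟦⟧+⟦not⟧ : ∀ b → ⟦ b ⟧ +q ⟦ not b ⟧ ≡ 1ℚ
⟦⟧+⟦not⟧ true  = refl
⟦⟧+⟦not⟧ false = refl

⟦true⟧* : ∀ {b} X → b ≡ true → ⟦ b ⟧ * X ≡ X
⟦true⟧* X refl = ℚP.*-identityˡ X

⟦false⟧* : ∀ {b} X → b ≡ false → ⟦ b ⟧ * X ≡ 0ℚ
⟦false⟧* X refl = ℚP.*-zeroˡ X

⟦⟧*-cong : ∀ b {X Y : ℚ} → (b ≡ true → X ≡ Y) → ⟦ b ⟧ * X ≡ ⟦ b ⟧ * Y
⟦⟧*-cong true  X≡Y = cong (1ℚ *_) (X≡Y refl)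
⟦⟧*-cong false {X} {Y} _ = trans (ℚP.*-zeroˡ X) (sym (ℚP.*-zeroˡ Y))

⟦⟧-nonNeg : ∀ b → 0ℚ ≤q ⟦ b ⟧
⟦⟧-nonNeg true  = ℚP.nonNegative⁻¹ 1ℚ
⟦⟧-nonNeg false = ℚP.≤-refl

⟦⟧≤1 : ∀ b → ⟦ b ⟧ ≤q 1ℚ
⟦⟧≤1 true  = ℚP.≤-refl
⟦⟧≤1 false = ℚP.nonNegative⁻¹ 1ℚ

⟦⟧*≤ : ∀ b {X} → 0ℚ ≤q X → ⟦ b ⟧ * X ≤q X
⟦⟧*≤ true  {X} _   = ℚP.≤-reflexive (ℚP.*-identityˡ X)
⟦⟧*≤ false {X} X≥0 = subst (_≤q X) (sym (ℚP.*-zeroˡ X)) X≥0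

⟦⟧-mono : ∀ a b → (a ≡ true → b ≡ true) → ⟦ a ⟧ ≤q ⟦ b ⟧
⟦⟧-mono false b _ = ⟦⟧-nonNeg b
⟦⟧-mono true  b h rewrite h refl = ℚP.≤-refl

⟦∨⟧≤ : ∀ a b → ⟦ a ∨ b ⟧ ≤q ⟦ a ⟧ +q ⟦ b ⟧
⟦∨⟧≤ true  true  = Dec.toWitness {a? = 1ℚ ℚP.≤? (1ℚ +q 1ℚ)} tt
⟦∨⟧≤ true  false = ℚP.≤-refl
⟦∨⟧≤ false b     = ℚP.≤-reflexive (sym (ℚP.+-identityˡ ⟦ b ⟧))

*-leftComm : ∀ a b c → a * (b * c) ≡ b * (a * c)
*-leftComm a b c = trans (sym (ℚP.*-assoc a b c)) (trans (cong (_* c) (ℚP.*-comm a b)) (ℚP.*-assoc b a c))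

*-monoˡ-≤-nonNeg : ∀ r {p q} → 0ℚ ≤q r → p ≤q q → r * p ≤q r * q
*-monoˡ-≤-nonNeg r r≥0 = ℚP.*-monoˡ-≤-nonNeg r {{ℚ.nonNegative r≥0}}

*-monoʳ-≤-nonNeg : ∀ r {p q} → 0ℚ ≤q r → p ≤q q → p * r ≤q q * r
*-monoʳ-≤-nonNeg r r≥0 = ℚP.*-monoʳ-≤-nonNeg r {{ℚ.nonNegative r≥0}}

*-nonNeg : ∀ {p q} → 0ℚ ≤q p → 0ℚ ≤q q → 0ℚ ≤q p * q
*-nonNeg {p} {q} p≥0 q≥0 = subst (_≤q p * q) (ℚP.*-zeroʳ p) (*-monoˡ-≤-nonNeg p p≥0 q≥0)

p≤q⇒0≤q-p : ∀ {p q} → p ≤q q → 0ℚ ≤q q -q p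
p≤q⇒0≤q-p {p} {q} p≤q = subst (_≤q q -q p) (ℚP.+-inverseʳ p) (ℚP.+-monoˡ-≤ (-q p) p≤q)

0≤p⇒q-p≤q : ∀ {p} q → 0ℚ ≤q p → q -q p ≤q q
0≤p⇒q-p≤q {p} q p≥0 = subst (q -q p ≤q_) (ℚP.+-identityʳ q) (ℚP.+-monoʳ-≤ q (ℚP.neg-antimono-≤ p≥0))

∑ : ℕ → (ℕ → ℚ) → ℚ
∑ zero    f = 0ℚ
∑ (suc n) f = f 0 +q ∑ n (f ∘ suc)

∑-cong : ∀ n {f g : ℕ → ℚ} → (∀ i → i < n → f i ≡ g i) → ∑ n f ≡ ∑ n g
∑-cong zero    f≡g = refl
∑-cong (suc n) f≡g = cong₂ _+q_ (f≡g 0 (s≤s z≤n)) (∑-cong n (λ i i<n → f≡g (suc i) (s≤s i<n)))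

∑-cong′ : ∀ n {f g : ℕ → ℚ} → (∀ i → f i ≡ g i) → ∑ n f ≡ ∑ n g
∑-cong′ n f≡g = ∑-cong n (λ i _ → f≡g i)

∑-0 : ∀ n → ∑ n (λ _ → 0ℚ) ≡ 0ℚ
∑-0 zero    = refl
∑-0 (suc n) = cong (0ℚ +q_) (∑-0 n)

∑-vanish : ∀ n {f : ℕ → ℚ} → (∀ i → i < n → f i ≡ 0ℚ) → ∑ n f ≡ 0ℚ
∑-vanish n f≡0 = trans (∑-cong n f≡0) (∑-0 n)

∑-+ : ∀ n (f g : ℕ → ℚ) → ∑ n (λ i → f i +q g i) ≡ ∑ n f +q ∑ n g
∑-+ zero    f g = refl
∑-+ (suc n) f g = trans (cong ((f 0 +q g 0) +q_) (∑-+ n _ _))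
  (solve 4 (λ a b c d → (a :+ b) :+ (c :+ d) := (a :+ c) :+ (b :+ d)) refl (f 0) (g 0) _ _)
  where open ℚ-Solver

∑-*ˡ : ∀ n c (f : ℕ → ℚ) → ∑ n (λ i → c * f i) ≡ c * ∑ n f
∑-*ˡ zero    c f = sym (ℚP.*-zeroʳ c)
∑-*ˡ (suc n) c f = trans (cong ((c * f 0) +q_) (∑-*ˡ n c _)) (sym (ℚP.*-distribˡ-+ c (f 0) _))

∑-*ʳ : ∀ n c (f : ℕ → ℚ) → ∑ n (λ i → f i * c) ≡ ∑ n f * c
∑-*ʳ n c f = trans (∑-cong′ n (λ i → ℚP.*-comm (f i) c)) (trans (∑-*ˡ n c f) (ℚP.*-comm c _))

∑-neg : ∀ n (f : ℕ → ℚ) → ∑ n (λ i → -q f i) ≡ -q ∑ n f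
∑-neg zero    f = refl
∑-neg (suc n) f = trans (cong ((-q f 0) +q_) (∑-neg n _)) (sym (ℚP.neg-distrib-+ (f 0) _))

∑-const : ∀ n c → ∑ n (λ _ → c) ≡ ℕtoℚ n * c
∑-const zero    c = sym (ℚP.*-zeroˡ c)
∑-const (suc n) c = begin
    c +q ∑ n (λ _ → c)     ≡⟨ cong₂ _+q_ (sym (ℚP.*-identityˡ c)) (∑-const n c) ⟩
    1ℚ * c +q ℕtoℚ n * c   ≡⟨ sym (ℚP.*-distribʳ-+ c 1ℚ (ℕtoℚ n)) ⟩
    (1ℚ +q ℕtoℚ n) * c     ≡⟨ cong (_* c) (sym (ℕtoℚ-suc n)) ⟩
    ℕtoℚ (suc n) * c       ∎
  where open ≡-Reasoning

∑-swap : ∀ n m (f : ℕ → ℕ → ℚ) → ∑ n (λ i → ∑ m (f i)) ≡ ∑ m (λ j → ∑ n (λ i → f i j))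
∑-swap zero    m f = sym (∑-0 m)
∑-swap (suc n) m f = trans (cong (∑ m (f 0) +q_) (∑-swap n m _)) (sym (∑-+ m _ _))

∑-split : ∀ a b (f : ℕ → ℚ) → ∑ (a + b) f ≡ ∑ a f +q ∑ b (λ i → f (a + i))
∑-split zero    b f = sym (ℚP.+-identityˡ _)
∑-split (suc a) b f = trans (cong (f 0 +q_) (∑-split a b _)) (sym (ℚP.+-assoc (f 0) _ _))

∑-last : ∀ n (f : ℕ → ℚ) → ∑ (suc n) f ≡ ∑ n f +q f n
∑-last n f = begin
    ∑ (suc n) f                ≡⟨ cong (λ k → ∑ k f) (ℕP.+-comm 1 n) ⟩
    ∑ (n + 1) f                ≡⟨ ∑-split n 1 f ⟩
    ∑ n f +q (f (n + 0) +q 0ℚ) ≡⟨ cong (∑ n f +q_) (trans (ℚP.+-identityʳ _) (cong f (ℕP.+-identityʳ n))) ⟩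
    ∑ n f +q f n               ∎
  where open ≡-Reasoning

∑-extend : ∀ n m (f : ℕ → ℚ) → n ≤ m → (∀ i → n ≤ i → i < m → f i ≡ 0ℚ) → ∑ n f ≡ ∑ m f
∑-extend n m f n≤m f≡0 = begin
    ∑ n f                              ≡⟨ sym (ℚP.+-identityʳ _) ⟩
    ∑ n f +q 0ℚ                        ≡⟨ cong (∑ n f +q_) (sym (∑-vanish (m ∸ n) tail≡0)) ⟩
    ∑ n f +q ∑ (m ∸ n) (λ i → f (n + i)) ≡⟨ sym (∑-split n (m ∸ n) f) ⟩
    ∑ (n + (m ∸ n)) f                  ≡⟨ cong (λ k → ∑ k f) (ℕP.m+[n∸m]≡n n≤m) ⟩
    ∑ m f                              ∎
  where
  open ≡-Reasoning
  tail≡0 : ∀ i → i < m ∸ n → f (n + i) ≡ 0ℚ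
  tail≡0 i i<m∸n = f≡0 (n + i) (ℕP.m≤m+n n i)
    (subst (n + i <_) (ℕP.m+[n∸m]≡n n≤m) (ℕP.+-monoʳ-< n i<m∸n))

∑-indicator : ∀ n c (f : ℕ → ℚ) → c < n → ∑ n (λ i → ⟦ i ≡ᵇ c ⟧ * f i) ≡ f c
∑-indicator (suc n) zero f _ = begin
    1ℚ * f 0 +q ∑ n (λ i → ⟦ suc i ≡ᵇ 0 ⟧ * f (suc i)) ≡⟨ cong₂ _+q_ (ℚP.*-identityˡ (f 0))
                                                          (∑-vanish n (λ i _ → ℚP.*-zeroˡ (f (suc i)))) ⟩
    f 0 +q 0ℚ                                          ≡⟨ ℚP.+-identityʳ _ ⟩
    f 0                                                ∎
  where open ≡-Reasoning
∑-indicator (suc n) (suc c) f (s≤s c<n) = begin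
    0ℚ * f 0 +q ∑ n (λ i → ⟦ suc i ≡ᵇ suc c ⟧ * f (suc i)) ≡⟨ cong₂ _+q_ (ℚP.*-zeroˡ (f 0)) (∑-indicator n c (f ∘ suc) c<n) ⟩
    0ℚ +q f (suc c)                                        ≡⟨ ℚP.+-identityˡ _ ⟩
    f (suc c)                                              ∎
  where open ≡-Reasoning

∑-indicator-out : ∀ n c (f : ℕ → ℚ) → n ≤ c → ∑ n (λ i → ⟦ i ≡ᵇ c ⟧ * f i) ≡ 0ℚ
∑-indicator-out n c f n≤c = ∑-vanish n (λ i i<n →
  ⟦false⟧* (f i) (≡ᵇ-false (λ i≡c → ℕP.<-irrefl i≡c (ℕP.<-≤-trans i<n n≤c))))

∑-indicator≤1 : ∀ n c → ∑ n (λ i → ⟦ i ≡ᵇ c ⟧) ≤q 1ℚ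
∑-indicator≤1 n c with c ℕ.<? n
... | yes c<n = ℚP.≤-reflexive (trans (∑-cong′ n (λ i → sym (ℚP.*-identityʳ _))) (∑-indicator n c (λ _ → 1ℚ) c<n))
... | no  c≮n = subst (_≤q 1ℚ) (sym (trans (∑-cong′ n (λ i → sym (ℚP.*-identityʳ _)))
                  (∑-indicator-out n c (λ _ → 1ℚ) (ℕP.≮⇒≥ c≮n)))) (ℚP.nonNegative⁻¹ 1ℚ)

∑-indicator≡1 : ∀ n x → x < n → ∑ n (λ a → ⟦ x ≡ᵇ a ⟧) ≡ 1ℚ
∑-indicator≡1 n x x<n = trans (∑-cong′ n (λ a → trans (cong ⟦_⟧ (≡ᵇ-sym x a)) (sym (ℚP.*-identityʳ ⟦ a ≡ᵇ x ⟧))))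
  (∑-indicator n x (λ _ → 1ℚ) x<n)

∑-indicator-≤ : ∀ n c (f : ℕ → ℚ) → (∀ i → 0ℚ ≤q f i) → ∑ n (λ i → ⟦ i ≡ᵇ c ⟧ * f i) ≤q f c
∑-indicator-≤ n c f f≥0 with c ℕ.<? n
... | yes c<n = ℚP.≤-reflexive (∑-indicator n c f c<n)
... | no  c≮n = subst (_≤q f c) (sym (∑-indicator-out n c f (ℕP.≮⇒≥ c≮n))) (f≥0 c)

∑-mono-≤ : ∀ n {f g : ℕ → ℚ} → (∀ i → i < n → f i ≤q g i) → ∑ n f ≤q ∑ n g
∑-mono-≤ zero    f≤g = ℚP.≤-refl
∑-mono-≤ (suc n) f≤g = ℚP.+-mono-≤ (f≤g 0 (s≤s z≤n)) (∑-mono-≤ n (λ i i<n → f≤g (suc i) (s≤s i<n)))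

∣∑∣≤∑∣∣ : ∀ n (f : ℕ → ℚ) → ∣ ∑ n f ∣q ≤q ∑ n (λ i → ∣ f i ∣q)
∣∑∣≤∑∣∣ zero    f = ℚP.≤-refl
∣∑∣≤∑∣∣ (suc n) f = ℚP.≤-trans (ℚP.∣p+q∣≤∣p∣+∣q∣ (f 0) (∑ n (f ∘ suc))) (ℚP.+-monoʳ-≤ ∣ f 0 ∣q (∣∑∣≤∑∣∣ n (f ∘ suc)))

∑ᴸ : ∀ {A : Set} → List A → (A → ℚ) → ℚ
∑ᴸ []       f = 0ℚ
∑ᴸ (x ∷ xs) f = f x +q ∑ᴸ xs f

∑ᴸ-cong : ∀ {A : Set} xs {f g : A → ℚ} → (∀ x → f x ≡ g x) → ∑ᴸ xs f ≡ ∑ᴸ xs g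
∑ᴸ-cong []       f≡g = refl
∑ᴸ-cong (x ∷ xs) f≡g = cong₂ _+q_ (f≡g x) (∑ᴸ-cong xs f≡g)

∑ᴸ-++ : ∀ {A : Set} (xs ys : List A) f → ∑ᴸ (xs ++ ys) f ≡ ∑ᴸ xs f +q ∑ᴸ ys f
∑ᴸ-++ []       ys f = sym (ℚP.+-identityˡ _)
∑ᴸ-++ (x ∷ xs) ys f = trans (cong (f x +q_) (∑ᴸ-++ xs ys f)) (sym (ℚP.+-assoc (f x) _ _))

∑ᴸ-map : ∀ {A B : Set} (g : A → B) xs f → ∑ᴸ (map g xs) f ≡ ∑ᴸ xs (f ∘ g)
∑ᴸ-map g []       f = refl
∑ᴸ-map g (x ∷ xs) f = cong (f (g x) +q_) (∑ᴸ-map g xs f)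

∑ᴸ-concatMap : ∀ {A B : Set} (g : A → List B) xs f → ∑ᴸ (concatMap g xs) f ≡ ∑ᴸ xs (λ x → ∑ᴸ (g x) f)
∑ᴸ-concatMap g []       f = refl
∑ᴸ-concatMap g (x ∷ xs) f = trans (∑ᴸ-++ (g x) (concatMap g xs) f) (cong (∑ᴸ (g x) f +q_) (∑ᴸ-concatMap g xs f))

∑ᴸ-applyUpTo : ∀ {A : Set} (g : ℕ → A) n f → ∑ᴸ (applyUpTo g n) f ≡ ∑ n (f ∘ g)
∑ᴸ-applyUpTo g zero    f = refl
∑ᴸ-applyUpTo g (suc n) f = cong (f (g 0) +q_) (∑ᴸ-applyUpTo (g ∘ suc) n f)

∑ᴸ-upTo : ∀ n f → ∑ᴸ (upTo n) f ≡ ∑ n f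
∑ᴸ-upTo = ∑ᴸ-applyUpTo (λ i → i)

∑ᴸ-filter : ∀ {A : Set} (P : A → Bool) xs f → ∑ᴸ (filterᵇ P xs) f ≡ ∑ᴸ xs (λ x → ⟦ P x ⟧ * f x)
∑ᴸ-filter P []       f = refl
∑ᴸ-filter P (x ∷ xs) f with P x
... | true  = cong₂ _+q_ (sym (ℚP.*-identityˡ (f x))) (∑ᴸ-filter P xs f)
... | false = trans (∑ᴸ-filter P xs f) (sym (trans (cong (_+q ∑ᴸ xs _) (ℚP.*-zeroˡ (f x))) (ℚP.+-identityˡ _)))

length-filter : ∀ {A : Set} (P : A → Bool) xs → ℕtoℚ (length (filterᵇ P xs)) ≡ ∑ᴸ xs (λ x → ⟦ P x ⟧)
length-filter P []       = refl
length-filter P (x ∷ xs) with P x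
... | true  = trans (ℕtoℚ-suc (length (filterᵇ P xs))) (cong (1ℚ +q_) (length-filter P xs))
... | false = trans (length-filter P xs) (sym (ℚP.+-identityˡ _))

ℤtoℚ-sum : ∀ {A : Set} (g : A → ℤ) xs → ℤtoℚ (foldr ℤ._+_ (+ 0) (map g xs)) ≡ ∑ᴸ xs (ℤtoℚ ∘ g)
ℤtoℚ-sum g []       = refl
ℤtoℚ-sum g (x ∷ xs) = trans (ℤtoℚ-+ (g x) _) (cong (ℤtoℚ (g x) +q_) (ℤtoℚ-sum g xs))

Σ<≡∑ : ∀ m f → Σ< m f ≡ ∑ m f
Σ<≡∑ m f = trans (foldr-map (upTo m)) (∑ᴸ-upTo m f)
  where
  foldr-map : ∀ xs → foldr _+q_ 0ℚ (map f xs) ≡ ∑ᴸ xs f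
  foldr-map []       = refl
  foldr-map (x ∷ xs) = cong (f x +q_) (foldr-map xs)

∑ⱽ : ∀ k → ℕ → (Vec ℕ k → ℚ) → ℚ
∑ⱽ k m F = ∑ᴸ (tuplesBelow k m) F

∑ⱽ-suc : ∀ k m F → ∑ⱽ (suc k) m F ≡ ∑ m (λ x → ∑ⱽ k m (λ v → F (x ∷ v)))
∑ⱽ-suc k m F = begin
    ∑ᴸ (concatMap (λ x → map (x ∷_) (tuplesBelow k m)) (upTo m)) F ≡⟨ ∑ᴸ-concatMap _ (upTo m) F ⟩
    ∑ᴸ (upTo m) (λ x → ∑ᴸ (map (x ∷_) (tuplesBelow k m)) F)        ≡⟨ ∑ᴸ-cong (upTo m) (λ x → ∑ᴸ-map (x ∷_) (tuplesBelow k m) F) ⟩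
    ∑ᴸ (upTo m) (λ x → ∑ⱽ k m (λ v → F (x ∷ v)))                   ≡⟨ ∑ᴸ-upTo m _ ⟩
    ∑ m (λ x → ∑ⱽ k m (λ v → F (x ∷ v)))                           ∎
  where open ≡-Reasoning

Below : ℕ → ∀ {k} → Vec ℕ k → Set
Below m []      = ⊤
Below m (x ∷ v) = x < m × Below m v

∑ⱽ-cong : ∀ k m {F G : Vec ℕ k → ℚ} → (∀ v → Below m v → F v ≡ G v) → ∑ⱽ k m F ≡ ∑ⱽ k m G
∑ⱽ-cong zero    m F≡G = cong (_+q 0ℚ) (F≡G [] tt)
∑ⱽ-cong (suc k) m {F} {G} F≡G = trans (∑ⱽ-suc k m F) (trans
  (∑-cong m (λ x x<m → ∑ⱽ-cong k m (λ v v<m → F≡G (x ∷ v) (x<m , v<m)))) (sym (∑ⱽ-suc k m G)))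

∑ⱽ-cong′ : ∀ k m {F G : Vec ℕ k → ℚ} → (∀ v → F v ≡ G v) → ∑ⱽ k m F ≡ ∑ⱽ k m G
∑ⱽ-cong′ k m F≡G = ∑ⱽ-cong k m (λ v _ → F≡G v)

∑ⱽ-vanish : ∀ k m {F : Vec ℕ k → ℚ} → (∀ v → Below m v → F v ≡ 0ℚ) → ∑ⱽ k m F ≡ 0ℚ
∑ⱽ-vanish zero    m F≡0 = cong (_+q 0ℚ) (F≡0 [] tt)
∑ⱽ-vanish (suc k) m F≡0 = trans (∑ⱽ-suc k m _)
  (∑-vanish m (λ x x<m → ∑ⱽ-vanish k m (λ v v<m → F≡0 (x ∷ v) (x<m , v<m))))

∑ⱽ-+ : ∀ k m (F G : Vec ℕ k → ℚ) → ∑ⱽ k m (λ v → F v +q G v) ≡ ∑ⱽ k m F +q ∑ⱽ k m G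
∑ⱽ-+ zero    m F G = trans (ℚP.+-identityʳ (F [] +q G []))
  (sym (cong₂ _+q_ (ℚP.+-identityʳ (F [])) (ℚP.+-identityʳ (G []))))
∑ⱽ-+ (suc k) m F G = trans (∑ⱽ-suc k m _) (trans (∑-cong′ m (λ x → ∑ⱽ-+ k m _ _))
  (trans (∑-+ m _ _) (sym (cong₂ _+q_ (∑ⱽ-suc k m F) (∑ⱽ-suc k m G)))))

∑ⱽ-*ˡ : ∀ k m c (F : Vec ℕ k → ℚ) → ∑ⱽ k m (λ v → c * F v) ≡ c * ∑ⱽ k m F
∑ⱽ-*ˡ zero    m c F = trans (ℚP.+-identityʳ (c * F [])) (cong (c *_) (sym (ℚP.+-identityʳ (F []))))
∑ⱽ-*ˡ (suc k) m c F = trans (∑ⱽ-suc k m _) (trans (∑-cong′ m (λ x → ∑ⱽ-*ˡ k m c _))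
  (trans (∑-*ˡ m c _) (cong (c *_) (sym (∑ⱽ-suc k m F)))))

∑ⱽ-neg : ∀ k m (F : Vec ℕ k → ℚ) → ∑ⱽ k m (λ v → -q F v) ≡ -q ∑ⱽ k m F
∑ⱽ-neg zero    m F = trans (ℚP.+-identityʳ (-q F [])) (cong -q_ (sym (ℚP.+-identityʳ (F []))))
∑ⱽ-neg (suc k) m F = trans (∑ⱽ-suc k m _) (trans (∑-cong′ m (λ x → ∑ⱽ-neg k m _))
  (trans (∑-neg m _) (cong -q_ (sym (∑ⱽ-suc k m F)))))

∑ⱽ-∑ : ∀ k m n (F : ℕ → Vec ℕ k → ℚ) → ∑ⱽ k m (λ v → ∑ n (λ i → F i v)) ≡ ∑ n (λ i → ∑ⱽ k m (F i))
∑ⱽ-∑ zero    m n F = trans (ℚP.+-identityʳ _) (∑-cong′ n (λ i → sym (ℚP.+-identityʳ _)))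
∑ⱽ-∑ (suc k) m n F = begin
    ∑ⱽ (suc k) m (λ v → ∑ n (λ i → F i v))            ≡⟨ ∑ⱽ-suc k m _ ⟩
    ∑ m (λ x → ∑ⱽ k m (λ v → ∑ n (λ i → F i (x ∷ v)))) ≡⟨ ∑-cong′ m (λ x → ∑ⱽ-∑ k m n _) ⟩
    ∑ m (λ x → ∑ n (λ i → ∑ⱽ k m (λ v → F i (x ∷ v)))) ≡⟨ ∑-swap m n _ ⟩
    ∑ n (λ i → ∑ m (λ x → ∑ⱽ k m (λ v → F i (x ∷ v)))) ≡⟨ ∑-cong′ n (λ i → sym (∑ⱽ-suc k m (F i))) ⟩
    ∑ n (λ i → ∑ⱽ (suc k) m (F i))                     ∎
  where open ≡-Reasoning

∑ⱽ-swap : ∀ k m j n (F : Vec ℕ k → Vec ℕ j → ℚ) →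
          ∑ⱽ k m (λ v → ∑ⱽ j n (F v)) ≡ ∑ⱽ j n (λ w → ∑ⱽ k m (λ v → F v w))
∑ⱽ-swap zero    m j n F = trans (ℚP.+-identityʳ _) (∑ⱽ-cong′ j n (λ w → sym (ℚP.+-identityʳ _)))
∑ⱽ-swap (suc k) m j n F = begin
    ∑ⱽ (suc k) m (λ v → ∑ⱽ j n (F v))                   ≡⟨ ∑ⱽ-suc k m _ ⟩
    ∑ m (λ x → ∑ⱽ k m (λ v → ∑ⱽ j n (F (x ∷ v))))       ≡⟨ ∑-cong′ m (λ x → ∑ⱽ-swap k m j n _) ⟩
    ∑ m (λ x → ∑ⱽ j n (λ w → ∑ⱽ k m (λ v → F (x ∷ v) w))) ≡⟨ sym (∑ⱽ-∑ j n m _) ⟩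
    ∑ⱽ j n (λ w → ∑ m (λ x → ∑ⱽ k m (λ v → F (x ∷ v) w))) ≡⟨ ∑ⱽ-cong′ j n (λ w → sym (∑ⱽ-suc k m _)) ⟩
    ∑ⱽ j n (λ w → ∑ⱽ (suc k) m (λ v → F v w))           ∎
  where open ≡-Reasoning

∑ⱽ-extend : ∀ k m m′ (F : Vec ℕ k → ℚ) → m ≤ m′ → (∀ v → Below m′ v → ¬ Below m v → F v ≡ 0ℚ) →
            ∑ⱽ k m F ≡ ∑ⱽ k m′ F
∑ⱽ-extend zero    m m′ F m≤m′ F≡0 = refl
∑ⱽ-extend (suc k) m m′ F m≤m′ F≡0 = begin
    ∑ⱽ (suc k) m F                      ≡⟨ ∑ⱽ-suc k m F ⟩
    ∑ m (λ x → ∑ⱽ k m (λ v → F (x ∷ v)))  ≡⟨ ∑-cong m (λ x x<m → ∑ⱽ-extend k m m′ _ m≤m′ (λ v v<m′ v≮m →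
                                               F≡0 (x ∷ v) (ℕP.<-≤-trans x<m m≤m′ , v<m′) (v≮m ∘ proj₂))) ⟩
    ∑ m (λ x → ∑ⱽ k m′ (λ v → F (x ∷ v))) ≡⟨ ∑-extend m m′ _ m≤m′ (λ x m≤x x<m′ → ∑ⱽ-vanish k m′ (λ v v<m′ →
                                               F≡0 (x ∷ v) (x<m′ , v<m′) (λ (x<m , _) → ℕP.<⇒≱ x<m m≤x))) ⟩
    ∑ m′ (λ x → ∑ⱽ k m′ (λ v → F (x ∷ v))) ≡⟨ sym (∑ⱽ-suc k m′ F) ⟩
    ∑ⱽ (suc k) m′ F                     ∎
  where open ≡-Reasoning

∑ⱽ-1 : ∀ k m → ∑ⱽ k m (λ _ → 1ℚ) ≡ ℕtoℚ (m ^ k)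
∑ⱽ-1 zero    m = refl
∑ⱽ-1 (suc k) m = trans (∑ⱽ-suc k m (λ _ → 1ℚ)) (trans (∑-cong′ m (λ _ → ∑ⱽ-1 k m))
  (trans (∑-const m _) (sym (ℕtoℚ-* m (m ^ k)))))

∑ⱽ-mono-≤ : ∀ k m {F G : Vec ℕ k → ℚ} → (∀ v → Below m v → F v ≤q G v) → ∑ⱽ k m F ≤q ∑ⱽ k m G
∑ⱽ-mono-≤ zero    m F≤G = ℚP.+-mono-≤ (F≤G [] tt) ℚP.≤-refl
∑ⱽ-mono-≤ (suc k) m {F} {G} F≤G = subst₂ _≤q_ (sym (∑ⱽ-suc k m F)) (sym (∑ⱽ-suc k m G))
  (∑-mono-≤ m (λ x x<m → ∑ⱽ-mono-≤ k m (λ v v<m → F≤G (x ∷ v) (x<m , v<m))))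

∑ⱽ-mono-≤′ : ∀ k m {F G : Vec ℕ k → ℚ} → (∀ v → F v ≤q G v) → ∑ⱽ k m F ≤q ∑ⱽ k m G
∑ⱽ-mono-≤′ k m F≤G = ∑ⱽ-mono-≤ k m (λ v _ → F≤G v)

∑ⱽ-nonNeg : ∀ k m {F : Vec ℕ k → ℚ} → (∀ v → 0ℚ ≤q F v) → 0ℚ ≤q ∑ⱽ k m F
∑ⱽ-nonNeg k m {F} F≥0 = subst (_≤q ∑ⱽ k m F) (∑ⱽ-vanish k m (λ _ _ → refl)) (∑ⱽ-mono-≤′ k m F≥0)

∑ⱽ-+-≤ : ∀ k m {F G H : Vec ℕ k → ℚ} → (∀ v → F v ≤q G v +q H v) → ∑ⱽ k m F ≤q ∑ⱽ k m G +q ∑ⱽ k m H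
∑ⱽ-+-≤ k m {F} {G} {H} F≤G+H = subst (∑ⱽ k m F ≤q_) (∑ⱽ-+ k m G H) (∑ⱽ-mono-≤′ k m F≤G+H)

∣∑ⱽ∣≤∑ⱽ∣∣ : ∀ k m (F : Vec ℕ k → ℚ) → ∣ ∑ⱽ k m F ∣q ≤q ∑ⱽ k m (λ v → ∣ F v ∣q)
∣∑ⱽ∣≤∑ⱽ∣∣ zero    m F = ℚP.∣p+q∣≤∣p∣+∣q∣ (F []) 0ℚ
∣∑ⱽ∣≤∑ⱽ∣∣ (suc k) m F = subst₂ _≤q_ (cong ∣_∣q (sym (∑ⱽ-suc k m F))) (sym (∑ⱽ-suc k m (λ v → ∣ F v ∣q)))
  (ℚP.≤-trans (∣∑∣≤∑∣∣ m (λ x → ∑ⱽ k m (λ v → F (x ∷ v)))) (∑-mono-≤ m (λ x _ → ∣∑ⱽ∣≤∑ⱽ∣∣ k m (λ v → F (x ∷ v)))))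

eqV : ∀ {k} → Vec ℕ k → Vec ℕ k → Bool
eqV []      []      = true
eqV (x ∷ v) (y ∷ u) = (x ≡ᵇ y) ∧ eqV v u

eqV-sound : ∀ {k} (v w : Vec ℕ k) → eqV v w ≡ true → v ≡ w
eqV-sound []      []      _ = refl
eqV-sound (x ∷ v) (y ∷ w) e = cong₂ _∷_ (≡ᵇ-sound (∧-true-l (x ≡ᵇ y) e)) (eqV-sound v w (∧-true-r (x ≡ᵇ y) e))

eqV-refl : ∀ {k} (v : Vec ℕ k) → eqV v v ≡ true
eqV-refl []      = refl
eqV-refl (x ∷ v) = cong₂ _∧_ (≡ᵇ-true {x} refl) (eqV-refl v)

∑ⱽ-indicator : ∀ k m (u : Vec ℕ k) (F : Vec ℕ k → ℚ) → Below m u → ∑ⱽ k m (λ v → ⟦ eqV v u ⟧ * F v) ≡ F u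
∑ⱽ-indicator zero    m [] F _ = trans (ℚP.+-identityʳ (1ℚ * F [])) (ℚP.*-identityˡ (F []))
∑ⱽ-indicator (suc k) m (y ∷ u) F (y<m , u<m) = begin
    ∑ⱽ (suc k) m (λ v → ⟦ eqV v (y ∷ u) ⟧ * F v)                   ≡⟨ ∑ⱽ-suc k m _ ⟩
    ∑ m (λ x → ∑ⱽ k m (λ v → ⟦ (x ≡ᵇ y) ∧ eqV v u ⟧ * F (x ∷ v)))   ≡⟨ ∑-cong′ m (λ x → ∑ⱽ-cong′ k m (λ v →
                                                                        trans (cong (_* F (x ∷ v)) (⟦∧⟧ (x ≡ᵇ y) (eqV v u)))
                                                                              (ℚP.*-assoc ⟦ x ≡ᵇ y ⟧ _ _))) ⟩
    ∑ m (λ x → ∑ⱽ k m (λ v → ⟦ x ≡ᵇ y ⟧ * (⟦ eqV v u ⟧ * F (x ∷ v)))) ≡⟨ ∑-cong′ m (λ x → ∑ⱽ-*ˡ k m ⟦ x ≡ᵇ y ⟧ _) ⟩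
    ∑ m (λ x → ⟦ x ≡ᵇ y ⟧ * ∑ⱽ k m (λ v → ⟦ eqV v u ⟧ * F (x ∷ v))) ≡⟨ ∑-indicator m y _ y<m ⟩
    ∑ⱽ k m (λ v → ⟦ eqV v u ⟧ * F (y ∷ v))                          ≡⟨ ∑ⱽ-indicator k m u (λ v → F (y ∷ v)) u<m ⟩
    F (y ∷ u)                                                       ∎
  where open ≡-Reasoning

-- Divisors, multiples and the Möbius function

prime≥1 : ∀ {p} → Prime p → 1 ≤ p
prime≥1 {p} pp = ℕ.>-nonZero⁻¹ p {{Primality.prime⇒nonZero pp}}

prime≥2 : ∀ {p} → Prime p → 2 ≤ p
prime≥2 {p} pp = ℕ.nonTrivial⇒n>1 p {{Primality.prime⇒nonTrivial pp}}

prime⇒coprime : ∀ {p a} → Prime p → ¬ p ∣ a → Coprime p a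
prime⇒coprime pp p∤a (i∣p , i∣a) with Primality.prime⇒irreducible pp i∣p
... | inj₁ i≡1 = i≡1
... | inj₂ refl = ⊥-elim (p∤a i∣a)

*≥1 : ∀ {a b} → 1 ≤ a → 1 ≤ b → 1 ≤ a *ₙ b
*≥1 {suc a} {suc b} _ _ = s≤s z≤n

∣⇒≥1 : ∀ {d n} → 1 ≤ n → d ∣ n → 1 ≤ d
∣⇒≥1 {zero}  n≥1 0∣n = ⊥-elim (ℕP.<-irrefl (sym (ℕD.0∣⇒≡0 0∣n)) n≥1)
∣⇒≥1 {suc d} _   _   = s≤s z≤n

factors≥1 : ∀ a b {n} → 1 ≤ n → a *ₙ b ≡ n → 1 ≤ a × 1 ≤ b
factors≥1 a b n≥1 ab≡n = ∣⇒≥1 n≥1 (divides b (trans (sym ab≡n) (ℕP.*-comm a b))) , ∣⇒≥1 n≥1 (divides a (sym ab≡n))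

factors≤ : ∀ a b {n} → 1 ≤ n → a *ₙ b ≡ n → a ≤ n × b ≤ n
factors≤ a b n≥1 ab≡n with factors≥1 a b n≥1 ab≡n
... | a≥1 , b≥1 = subst (a ≤_) ab≡n (ℕP.m≤m*n a b {{ℕ.>-nonZero b≥1}})
                , subst (b ≤_) ab≡n (ℕP.m≤n*m b a {{ℕ.>-nonZero a≥1}})

∣ᵇ-within-block : ∀ g m i → 1 ≤ g → i < g → (g ∣ᵇ g *ₙ m + suc i) ≡ (i ≡ᵇ g ∸ 1)
∣ᵇ-within-block g m i g≥1 i<g with i ℕ.≟ g ∸ 1
... | yes refl = trans (∣ᵇ-true (subst (g ∣_) g[m+1]≡gm+g (ℕD.∣m⇒∣m*n (suc m) ℕD.∣-refl))) (sym (≡ᵇ-true {g ∸ 1} refl))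
  where
  g[m+1]≡gm+g : g *ₙ suc m ≡ g *ₙ m + suc (g ∸ 1)
  g[m+1]≡gm+g = trans (ℕP.*-suc g m) (trans (ℕP.+-comm g (g *ₙ m)) (cong (λ z → g *ₙ m + z) (sym (ℕP.m+[n∸m]≡n g≥1))))
... | no i≢g-1 = trans (∣ᵇ-false g∤) (sym (≡ᵇ-false i≢g-1))
  where
  g∤ : ¬ g ∣ g *ₙ m + suc i
  g∤ g∣ = i≢g-1 (ℕP.≤-antisym (ℕP.≤-pred (subst (suc i ≤_) (sym (ℕP.m+[n∸m]≡n g≥1)) i<g))
    (ℕP.≤-pred (subst (_≤ suc i) (sym (ℕP.m+[n∸m]≡n g≥1))
      (ℕD.∣⇒≤ (ℕD.∣m+n∣m⇒∣n g∣ (ℕD.∣m⇒∣m*n m (ℕD.∣-refl {g})))))))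

∑-multiples : ∀ g m (h : ℕ → ℚ) → 1 ≤ g →
              ∑ (suc (g *ₙ m)) (λ x → ⟦ g ∣ᵇ x ⟧ * h x) ≡ ∑ (suc m) (λ y → h (g *ₙ y))
∑-multiples g zero h g≥1 = begin
    ⟦ g ∣ᵇ 0 ⟧ * h 0 +q ∑ (g *ₙ 0) (λ i → ⟦ g ∣ᵇ suc i ⟧ * h (suc i)) ≡⟨ cong₂ _+q_ (⟦true⟧* (h 0) (∣ᵇ-true (g ℕD.∣0)))
                                                                        (cong (λ k → ∑ k (λ i → ⟦ g ∣ᵇ suc i ⟧ * h (suc i))) (ℕP.*-zeroʳ g)) ⟩
    h 0 +q 0ℚ                                                          ≡⟨ cong (λ z → h z +q 0ℚ) (sym (ℕP.*-zeroʳ g)) ⟩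
    h (g *ₙ 0) +q 0ℚ                                                   ∎
  where open ≡-Reasoning
∑-multiples g (suc m) h g≥1 = begin
    ∑ (suc (g *ₙ suc m)) f                                ≡⟨ cong (λ k → ∑ k f) (cong suc (trans (ℕP.*-suc g m) (ℕP.+-comm g (g *ₙ m)))) ⟩
    ∑ (suc (g *ₙ m) + g) f                                ≡⟨ ∑-split (suc (g *ₙ m)) g f ⟩
    ∑ (suc (g *ₙ m)) f +q ∑ g (λ i → f (suc (g *ₙ m) + i)) ≡⟨ cong₂ _+q_ (∑-multiples g m h g≥1) last-block ⟩
    ∑ (suc m) (λ y → h (g *ₙ y)) +q h (g *ₙ suc m)         ≡⟨ sym (∑-last (suc m) (λ y → h (g *ₙ y))) ⟩
    ∑ (suc (suc m)) (λ y → h (g *ₙ y))                     ∎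
  where
  open ≡-Reasoning
  f = λ x → ⟦ g ∣ᵇ x ⟧ * h x
  last-block : ∑ g (λ i → f (suc (g *ₙ m) + i)) ≡ h (g *ₙ suc m)
  last-block = begin
      ∑ g (λ i → f (suc (g *ₙ m) + i))                 ≡⟨ ∑-cong g (λ i i<g → trans (cong f (sym (ℕP.+-suc (g *ₙ m) i)))
                                                            (cong (λ b → ⟦ b ⟧ * h (g *ₙ m + suc i)) (∣ᵇ-within-block g m i g≥1 i<g))) ⟩
      ∑ g (λ i → ⟦ i ≡ᵇ g ∸ 1 ⟧ * h (g *ₙ m + suc i)) ≡⟨ ∑-indicator g (g ∸ 1) _ (subst (g ∸ 1 <_) (ℕP.m+[n∸m]≡n g≥1) (ℕP.n<1+n _)) ⟩
      h (g *ₙ m + suc (g ∸ 1))                        ≡⟨ cong (λ z → h (g *ₙ m + z)) (ℕP.m+[n∸m]≡n g≥1) ⟩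
      h (g *ₙ m + g)                                  ≡⟨ cong h (trans (ℕP.+-comm (g *ₙ m) g) (sym (ℕP.*-suc g m))) ⟩
      h (g *ₙ suc m)                                  ∎

divisorSum : ℕ → (ℕ → ℚ) → ℚ
divisorSum n f = ∑ (suc n) (λ d → ⟦ d ∣ᵇ n ⟧ * f d)

factorSumBelow : ℕ → ℕ → (ℕ → ℕ → ℚ) → ℚ
factorSumBelow N n h = ∑ N (λ a → ∑ N (λ b → ⟦ a *ₙ b ≡ᵇ n ⟧ * h a b))

factorSum : ℕ → (ℕ → ℕ → ℚ) → ℚ
factorSum n = factorSumBelow (suc n) n

factorSum-cong : ∀ n {h h′ : ℕ → ℕ → ℚ} → (∀ a b → a *ₙ b ≡ n → h a b ≡ h′ a b) → factorSum n h ≡ factorSum n h′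
factorSum-cong n h≡h′ = ∑-cong′ (suc n) (λ a → ∑-cong′ (suc n) (λ b →
  ⟦⟧*-cong (a *ₙ b ≡ᵇ n) (λ ab≡n → h≡h′ a b (≡ᵇ-sound ab≡n))))

factorSum-cong′ : ∀ n {h h′ : ℕ → ℕ → ℚ} → (∀ a b → h a b ≡ h′ a b) → factorSum n h ≡ factorSum n h′
factorSum-cong′ n h≡h′ = factorSum-cong n (λ a b _ → h≡h′ a b)

factorSum-comm : ∀ n h → factorSum n h ≡ factorSum n (λ a b → h b a)
factorSum-comm n h = trans (∑-swap (suc n) (suc n) (λ a b → ⟦ a *ₙ b ≡ᵇ n ⟧ * h a b))
  (∑-cong′ (suc n) (λ b → ∑-cong′ (suc n) (λ a → cong (λ z → ⟦ z ≡ᵇ n ⟧ * h a b) (ℕP.*-comm a b))))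

factorSum-*ˡ : ∀ n c h → factorSum n (λ a b → c * h a b) ≡ c * factorSum n h
factorSum-*ˡ n c h = begin
    ∑ (suc n) (λ a → ∑ (suc n) (λ b → ⟦ a *ₙ b ≡ᵇ n ⟧ * (c * h a b))) ≡⟨ ∑-cong′ (suc n) (λ a → ∑-cong′ (suc n) (λ b →
                                                                          *-leftComm ⟦ a *ₙ b ≡ᵇ n ⟧ c (h a b))) ⟩
    ∑ (suc n) (λ a → ∑ (suc n) (λ b → c * (⟦ a *ₙ b ≡ᵇ n ⟧ * h a b))) ≡⟨ ∑-cong′ (suc n) (λ a → ∑-*ˡ (suc n) c (λ b → ⟦ a *ₙ b ≡ᵇ n ⟧ * h a b)) ⟩
    ∑ (suc n) (λ a → c * ∑ (suc n) (λ b → ⟦ a *ₙ b ≡ᵇ n ⟧ * h a b))   ≡⟨ ∑-*ˡ (suc n) c (λ a → ∑ (suc n) (λ b → ⟦ a *ₙ b ≡ᵇ n ⟧ * h a b)) ⟩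
    c * factorSum n h                                                 ∎
  where open ≡-Reasoning

∑-factorSum : ∀ L n (h : ℕ → ℕ → ℕ → ℚ) → ∑ L (λ i → factorSum n (h i)) ≡ factorSum n (λ a b → ∑ L (λ i → h i a b))
∑-factorSum L n h = begin
    ∑ L (λ i → ∑ (suc n) (λ a → ∑ (suc n) (λ b → ⟦ a *ₙ b ≡ᵇ n ⟧ * h i a b))) ≡⟨ ∑-swap L (suc n) (λ i a → ∑ (suc n) (λ b → ⟦ a *ₙ b ≡ᵇ n ⟧ * h i a b)) ⟩
    ∑ (suc n) (λ a → ∑ L (λ i → ∑ (suc n) (λ b → ⟦ a *ₙ b ≡ᵇ n ⟧ * h i a b))) ≡⟨ ∑-cong′ (suc n) (λ a → ∑-swap L (suc n) (λ i b → ⟦ a *ₙ b ≡ᵇ n ⟧ * h i a b)) ⟩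
    ∑ (suc n) (λ a → ∑ (suc n) (λ b → ∑ L (λ i → ⟦ a *ₙ b ≡ᵇ n ⟧ * h i a b))) ≡⟨ ∑-cong′ (suc n) (λ a → ∑-cong′ (suc n) (λ b →
                                                                                  ∑-*ˡ L ⟦ a *ₙ b ≡ᵇ n ⟧ (λ i → h i a b))) ⟩
    factorSum n (λ a b → ∑ L (λ i → h i a b))                               ∎
  where open ≡-Reasoning

factorSum-extend : ∀ N n h → 1 ≤ n → suc n ≤ N → factorSum n h ≡ factorSumBelow N n h
factorSum-extend N n h n≥1 n<N = begin
    ∑ (suc n) (λ a → ∑ (suc n) (λ b → ⟦ a *ₙ b ≡ᵇ n ⟧ * h a b)) ≡⟨ ∑-cong′ (suc n) (λ a → ∑-extend (suc n) N _ n<N (λ b n<b _ →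
                                                                    ⟦false⟧* (h a b) (≡ᵇ-false (λ ab≡n → ℕP.<⇒≱ n<b (proj₂ (factors≤ a b n≥1 ab≡n)))))) ⟩
    ∑ (suc n) (λ a → ∑ N (λ b → ⟦ a *ₙ b ≡ᵇ n ⟧ * h a b))       ≡⟨ ∑-extend (suc n) N _ n<N (λ a n<a _ → ∑-vanish N (λ b _ →
                                                                    ⟦false⟧* (h a b) (≡ᵇ-false (λ ab≡n → ℕP.<⇒≱ n<a (proj₁ (factors≤ a b n≥1 ab≡n)))))) ⟩
    ∑ N (λ a → ∑ N (λ b → ⟦ a *ₙ b ≡ᵇ n ⟧ * h a b))             ∎
  where open ≡-Reasoning

-- Division without a `NonZero` instance; the junk value `n div 0 = 0` only occurs under ⟦ 0 ∣ᵇ n ⟧ = 0.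
_div_ : ℕ → ℕ → ℕ
n div zero  = 0
n div suc a = n ℕ./ suc a

∑-cofactor : ∀ n a (g : ℕ → ℚ) → 1 ≤ n → ∑ (suc n) (λ b → ⟦ a *ₙ b ≡ᵇ n ⟧ * g b) ≡ ⟦ a ∣ᵇ n ⟧ * g (n div a)
∑-cofactor n a g n≥1 with a ∣? n
... | no a∤n = trans (∑-vanish (suc n) (λ b _ → ⟦false⟧* (g b) (≡ᵇ-false (λ ab≡n →
                 a∤n (divides b (trans (sym ab≡n) (ℕP.*-comm a b)))))))
                 (sym (ℚP.*-zeroˡ (g (n div a))))
∑-cofactor n zero g n≥1 | yes 0∣n = ⊥-elim (ℕP.<-irrefl (sym (ℕD.0∣⇒≡0 0∣n)) n≥1)
∑-cofactor n (suc a) g n≥1 | yes (divides q n≡qa) = begin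
    ∑ (suc n) (λ b → ⟦ suc a *ₙ b ≡ᵇ n ⟧ * g b) ≡⟨ ∑-cong′ (suc n) (λ b → cong (λ z → ⟦ z ⟧ * g b) (test b)) ⟩
    ∑ (suc n) (λ b → ⟦ b ≡ᵇ q ⟧ * g b)          ≡⟨ ∑-indicator (suc n) q g (s≤s (proj₂ (factors≤ (suc a) q n≥1 (sym n≡aq)))) ⟩
    g q                                         ≡⟨ cong g (sym (trans (cong (ℕ._/ suc a) n≡qa) (ℕDM.m*n/n≡m q (suc a)))) ⟩
    g (n div suc a)                             ≡⟨ sym (ℚP.*-identityˡ _) ⟩
    1ℚ * g (n div suc a)                        ∎
  where
  open ≡-Reasoning
  n≡aq : n ≡ suc a *ₙ q
  n≡aq = trans n≡qa (ℕP.*-comm q (suc a))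
  test : ∀ b → (suc a *ₙ b ≡ᵇ n) ≡ (b ≡ᵇ q)
  test b = trans (cong (suc a *ₙ b ≡ᵇ_) n≡aq) (≡ᵇ-*-cancelˡ (suc a) b q (s≤s z≤n))

factorSum≡divisorSum : ∀ n h → 1 ≤ n → factorSum n h ≡ divisorSum n (λ a → h a (n div a))
factorSum≡divisorSum n h n≥1 = ∑-cong′ (suc n) (λ a → ∑-cofactor n a (h a) n≥1)

foldr-∨-sound : ∀ (P : ℕ → Bool) (g : ℕ → ℕ) n → foldr (λ j b → P j ∨ b) false (applyUpTo g n) ≡ true →
                Σ ℕ λ j → j < n × P (g j) ≡ true
foldr-∨-sound P g (suc n) e with P (g 0) in eq
... | true  = 0 , s≤s z≤n , eq
... | false = let (j , j<n , Pj) = foldr-∨-sound P (g ∘ suc) n e in suc j , s≤s j<n , Pj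

foldr-∨-complete : ∀ (P : ℕ → Bool) (g : ℕ → ℕ) n j → j < n → P (g j) ≡ true →
                   foldr (λ j b → P j ∨ b) false (applyUpTo g n) ≡ true
foldr-∨-complete P g (suc n) zero    _         Pj rewrite Pj = refl
foldr-∨-complete P g (suc n) (suc j) (s≤s j<n) Pj with P (g 0)
... | true  = refl
... | false = foldr-∨-complete P (g ∘ suc) n j j<n Pj

hasSquareFactor-sound : ∀ n → hasSquareFactor n ≡ true → Σ ℕ λ j → 2 ≤ j × j *ₙ j ∣ n
hasSquareFactor-sound n e with foldr-∨-sound (λ j → (suc (suc j) *ₙ suc (suc j)) ∣ᵇ n) (λ i → i) n e
... | j , _ , jj∣n = suc (suc j) , s≤s (s≤s z≤n) , ∣ᵇ-sound jj∣n

hasSquareFactor-complete : ∀ n j → 1 ≤ n → 2 ≤ j → j *ₙ j ∣ n → hasSquareFactor n ≡ true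
hasSquareFactor-complete n (suc (suc j)) n≥1 (s≤s (s≤s _)) jj∣n =
  foldr-∨-complete (λ j → (suc (suc j) *ₙ suc (suc j)) ∣ᵇ n) (λ i → i) n j j<n (∣ᵇ-true jj∣n)
  where
  j<n : j < n
  j<n = ℕP.<-≤-trans (ℕP.<-trans (ℕP.n<1+n j) (ℕP.n<1+n (suc j)))
          (ℕP.≤-trans (ℕP.m≤m*n (suc (suc j)) (suc (suc j))) (ℕD.∣⇒≤ {{ℕ.>-nonZero n≥1}} jj∣n))

hasSquareFactor-p*d : ∀ {p d} → Prime p → ¬ p ∣ d → 1 ≤ d → hasSquareFactor (p *ₙ d) ≡ hasSquareFactor d
hasSquareFactor-p*d {p} {d} pp p∤d d≥1 = bool-ext _ _ ⇒d d⇒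
  where
  instance _ = Primality.prime⇒nonZero pp
  d⇒ : hasSquareFactor d ≡ true → hasSquareFactor (p *ₙ d) ≡ true
  d⇒ e with hasSquareFactor-sound d e
  ... | j , j≥2 , jj∣d = hasSquareFactor-complete (p *ₙ d) j (*≥1 (prime≥1 pp) d≥1) j≥2 (ℕD.∣n⇒∣m*n p jj∣d)
  ⇒d : hasSquareFactor (p *ₙ d) ≡ true → hasSquareFactor d ≡ true
  ⇒d e with hasSquareFactor-sound (p *ₙ d) e
  ... | j , j≥2 , jj∣pd = hasSquareFactor-complete d j d≥1 j≥2 (Coprime.coprime-divisor (Coprime.sym (prime⇒coprime pp p∤jj)) jj∣pd)
    where
    p∤jj : ¬ p ∣ j *ₙ j
    p∤jj p∣jj with Primality.euclidsLemma j j pp p∣jj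
    ... | inj₁ p∣j = p∤d (ℕD.*-cancelˡ-∣ p (ℕD.∣-trans (ℕD.*-pres-∣ p∣j p∣j) jj∣pd))
    ... | inj₂ p∣j = p∤d (ℕD.*-cancelˡ-∣ p (ℕD.∣-trans (ℕD.*-pres-∣ p∣j p∣j) jj∣pd))

μ-squareful : ∀ n → hasSquareFactor n ≡ true → μ n ≡ + 0
μ-squareful n e with hasSquareFactor n
μ-squareful n refl | true = refl

μ-squarefree : ∀ n → hasSquareFactor n ≡ false → μ n ≡ (ℤ.- (+ 1)) ℤ.^ ω n
μ-squarefree n e with hasSquareFactor n
μ-squarefree n refl | false = refl

ω-as-∑ : ∀ n → ℕtoℚ (ω n) ≡ ∑ (suc n) (λ q → ⟦ does (prime? q) ∧ (q ∣ᵇ n) ⟧)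
ω-as-∑ n = trans (length-filter isPrimeFactor (upTo (suc n))) (∑ᴸ-upTo (suc n) (λ q → ⟦ isPrimeFactor q ⟧))
  where
  isPrimeFactor : ℕ → Bool
  isPrimeFactor q = does (prime? q) ∧ (q ∣ᵇ n)

isPrimeFactor-p*d : ∀ {p d} q → Prime p → ¬ p ∣ d →
                    ⟦ does (prime? q) ∧ (q ∣ᵇ p *ₙ d) ⟧ ≡ ⟦ does (prime? q) ∧ (q ∣ᵇ d) ⟧ +q ⟦ q ≡ᵇ p ⟧
isPrimeFactor-p*d {p} {d} q pp p∤d with prime? q
... | no ¬pq = cong (λ b → 0ℚ +q ⟦ b ⟧) (sym (≡ᵇ-false {q} {p} (λ { refl → ¬pq pp })))
... | yes pq with q ℕ.≟ p
...   | yes refl = begin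
  ⟦ q ∣ᵇ q *ₙ d ⟧               ≡⟨ cong ⟦_⟧ (∣ᵇ-true (ℕD.∣m⇒∣m*n d (ℕD.∣-refl {q}))) ⟩
  1ℚ                            ≡⟨ sym (ℚP.+-identityˡ 1ℚ) ⟩
  0ℚ +q 1ℚ                      ≡⟨ cong₂ (λ a b → ⟦ a ⟧ +q ⟦ b ⟧) (sym (∣ᵇ-false p∤d)) (sym (≡ᵇ-true {q} refl)) ⟩
  ⟦ q ∣ᵇ d ⟧ +q ⟦ q ≡ᵇ q ⟧      ∎
  where open ≡-Reasoning
...   | no q≢p = trans (cong ⟦_⟧ q∣pd≡q∣d) (trans (sym (ℚP.+-identityʳ ⟦ q ∣ᵇ d ⟧)) (cong (λ b → ⟦ q ∣ᵇ d ⟧ +q ⟦ b ⟧) (sym (≡ᵇ-false {q} {p} q≢p))))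
  where
  q∤p : ¬ q ∣ p
  q∤p q∣p with Primality.prime⇒irreducible pp q∣p
  ... | inj₁ refl = Primality.¬prime[1] pq
  ... | inj₂ q≡p  = q≢p q≡p
  q∣pd≡q∣d : (q ∣ᵇ p *ₙ d) ≡ (q ∣ᵇ d)
  q∣pd≡q∣d with q ∣? d
  ... | yes q∣d = ∣ᵇ-true (ℕD.∣n⇒∣m*n p q∣d)
  ... | no  q∤d = ∣ᵇ-false (λ q∣pd → [ q∤p , q∤d ]′ (Primality.euclidsLemma p d pq q∣pd))

ω-p*d : ∀ {p d} → Prime p → ¬ p ∣ d → 1 ≤ d → ω (p *ₙ d) ≡ suc (ω d)
ω-p*d {p} {d} pp p∤d d≥1 = ℕtoℚ-injective (begin
    ℕtoℚ (ω (p *ₙ d))                                          ≡⟨ ω-as-∑ (p *ₙ d) ⟩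
    ∑ (suc (p *ₙ d)) (λ q → ⟦ does (prime? q) ∧ (q ∣ᵇ p *ₙ d) ⟧) ≡⟨ ∑-cong′ (suc (p *ₙ d)) (λ q → isPrimeFactor-p*d q pp p∤d) ⟩
    ∑ (suc (p *ₙ d)) (λ q → ⟦ does (prime? q) ∧ (q ∣ᵇ d) ⟧ +q ⟦ q ≡ᵇ p ⟧) ≡⟨ ∑-+ (suc (p *ₙ d)) (λ q → ⟦ does (prime? q) ∧ (q ∣ᵇ d) ⟧) (λ q → ⟦ q ≡ᵇ p ⟧) ⟩
    ∑ (suc (p *ₙ d)) (λ q → ⟦ does (prime? q) ∧ (q ∣ᵇ d) ⟧) +q ∑ (suc (p *ₙ d)) (λ q → ⟦ q ≡ᵇ p ⟧)
                                                               ≡⟨ cong₂ _+q_ (sym (∑-extend (suc d) (suc (p *ₙ d)) _ (s≤s d≤pd) beyond-d)) one ⟩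
    ∑ (suc d) (λ q → ⟦ does (prime? q) ∧ (q ∣ᵇ d) ⟧) +q 1ℚ      ≡⟨ cong (_+q 1ℚ) (sym (ω-as-∑ d)) ⟩
    ℕtoℚ (ω d) +q 1ℚ                                            ≡⟨ ℚP.+-comm (ℕtoℚ (ω d)) 1ℚ ⟩
    1ℚ +q ℕtoℚ (ω d)                                            ≡⟨ sym (ℕtoℚ-suc (ω d)) ⟩
    ℕtoℚ (suc (ω d))                                            ∎)
  where
  open ≡-Reasoning
  instance _ = ℕ.>-nonZero d≥1
  instance _ = Primality.prime⇒nonZero pp
  d≤pd : d ≤ p *ₙ d
  d≤pd = ℕP.m≤n*m d p
  beyond-d : ∀ q → suc d ≤ q → q < suc (p *ₙ d) → ⟦ does (prime? q) ∧ (q ∣ᵇ d) ⟧ ≡ 0ℚ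
  beyond-d q d<q _ with q ∣? d
  ... | yes q∣d = ⊥-elim (ℕP.<⇒≱ d<q (ℕD.∣⇒≤ q∣d))
  ... | no  _   = cong ⟦_⟧ (BoolP.∧-zeroʳ (does (prime? q)))
  one : ∑ (suc (p *ₙ d)) (λ q → ⟦ q ≡ᵇ p ⟧) ≡ 1ℚ
  one = trans (∑-cong′ (suc (p *ₙ d)) (λ q → sym (ℚP.*-identityʳ ⟦ q ≡ᵇ p ⟧)))
              (∑-indicator (suc (p *ₙ d)) p (λ _ → 1ℚ) (s≤s (ℕP.m≤m*n p d)))

μ-p*d : ∀ {p d} → Prime p → ¬ p ∣ d → 1 ≤ d → μ (p *ₙ d) ≡ ℤ.- μ d
μ-p*d {p} {d} pp p∤d d≥1 = by-squarefreeness (hasSquareFactor d) refl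
  where
  open ≡-Reasoning
  by-squarefreeness : ∀ b → hasSquareFactor d ≡ b → μ (p *ₙ d) ≡ ℤ.- μ d
  by-squarefreeness true e = trans (μ-squareful (p *ₙ d) (trans (hasSquareFactor-p*d pp p∤d d≥1) e))
                                   (cong ℤ.-_ (sym (μ-squareful d e)))
  by-squarefreeness false e = begin
    μ (p *ₙ d)                                ≡⟨ μ-squarefree (p *ₙ d) (trans (hasSquareFactor-p*d pp p∤d d≥1) e) ⟩
    (ℤ.- (+ 1)) ℤ.^ ω (p *ₙ d)                ≡⟨ cong ((ℤ.- (+ 1)) ℤ.^_) (ω-p*d pp p∤d d≥1) ⟩
    (ℤ.- (+ 1)) ℤ.* ((ℤ.- (+ 1)) ℤ.^ ω d)     ≡⟨ ℤP.-1*i≡-i _ ⟩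
    ℤ.- ((ℤ.- (+ 1)) ℤ.^ ω d)                 ≡⟨ cong ℤ.-_ (sym (μ-squarefree d e)) ⟩
    ℤ.- μ d                                   ∎

μ-p*d-p∣d : ∀ {p d} → Prime p → p ∣ d → 1 ≤ d → μ (p *ₙ d) ≡ + 0
μ-p*d-p∣d {p} {d} pp p∣d d≥1 = μ-squareful (p *ₙ d)
  (hasSquareFactor-complete (p *ₙ d) p (*≥1 (prime≥1 pp) d≥1) (prime≥2 pp) (ℕD.*-monoʳ-∣ p p∣d))

μq : ℕ → ℚ
μq = ℤtoℚ ∘ μ

μq-p*d : ∀ {p d} → Prime p → 1 ≤ d → μq (p *ₙ d) ≡ ⟦ not (p ∣ᵇ d) ⟧ * -q μq d
μq-p*d {p} {d} pp d≥1 with p ∣? d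
... | yes p∣d = trans (cong ℤtoℚ (μ-p*d-p∣d pp p∣d d≥1)) (sym (ℚP.*-zeroˡ (-q μq d)))
... | no  p∤d = trans (cong ℤtoℚ (μ-p*d pp p∤d d≥1)) (trans (ℤtoℚ-neg (μ d)) (sym (ℚP.*-identityˡ (-q μq d))))

prime-factor : ∀ n → 2 ≤ n → Σ ℕ λ p → Prime p × Σ ℕ λ m → n ≡ p *ₙ m × 1 ≤ m
prime-factor n n≥2 with Factorisation.factorise n {{ℕ.>-nonZero (ℕP.<-trans (s≤s z≤n) n≥2)}}
... | record { factors = [] ; isFactorisation = n≡1 } = ⊥-elim (ℕP.<-irrefl (sym n≡1) n≥2)
... | record { factors = p ∷ ps ; isFactorisation = n≡p*ps ; factorsPrime = pp All.∷ _ } =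
  p , pp , ListAction.product ps , n≡p*ps , proj₂ (factors≥1 p _ (ℕP.<-trans (s≤s z≤n) n≥2) (sym n≡p*ps))

∣ᵇ-*-cancelˡ : ∀ p y m .{{_ : NonZero p}} → (p *ₙ y ∣ᵇ p *ₙ m) ≡ (y ∣ᵇ m)
∣ᵇ-*-cancelˡ p y m with y ∣? m
... | yes y∣m = ∣ᵇ-true (ℕD.*-monoʳ-∣ p y∣m)
... | no  y∤m = ∣ᵇ-false (y∤m ∘ ℕD.*-cancelˡ-∣ p)

∣ᵇ-p*m : ∀ {p a} m → Prime p → ¬ p ∣ a → (a ∣ᵇ p *ₙ m) ≡ (a ∣ᵇ m)
∣ᵇ-p*m {p} {a} m pp p∤a with a ∣? m
... | yes a∣m = ∣ᵇ-true (ℕD.∣n⇒∣m*n p a∣m)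
... | no  a∤m = ∣ᵇ-false (a∤m ∘ Coprime.coprime-divisor (Coprime.sym (prime⇒coprime pp p∤a)))

∑-split-by : ∀ N (P : ℕ → Bool) (h : ℕ → ℚ) → ∑ N h ≡ ∑ N (λ a → ⟦ P a ⟧ * h a) +q ∑ N (λ a → ⟦ not (P a) ⟧ * h a)
∑-split-by N P h = trans (∑-cong′ N (λ a → trans (sym (ℚP.*-identityˡ (h a)))
  (trans (cong (_* h a) (sym (⟦⟧+⟦not⟧ (P a)))) (ℚP.*-distribʳ-+ (h a) ⟦ P a ⟧ ⟦ not (P a) ⟧))))
  (∑-+ N (λ a → ⟦ P a ⟧ * h a) (λ a → ⟦ not (P a) ⟧ * h a))

divisorSum-μ-p*m : ∀ {p m} → Prime p → 1 ≤ m → divisorSum (p *ₙ m) μq ≡ 0ℚ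
divisorSum-μ-p*m {p} {m} pp m≥1 = begin
    divisorSum (p *ₙ m) μq                                             ≡⟨ ∑-split-by N (p ∣ᵇ_) h ⟩
    ∑ N (λ a → ⟦ p ∣ᵇ a ⟧ * h a) +q ∑ N (λ a → ⟦ not (p ∣ᵇ a) ⟧ * h a) ≡⟨ cong₂ _+q_ multiples-of-p non-multiples-of-p ⟩
    ∑ M (λ y → g y (-q μq y)) +q ∑ M (λ y → g y (μq y))                 ≡⟨ sym (∑-+ M (λ y → g y (-q μq y)) (λ y → g y (μq y))) ⟩
    ∑ M (λ y → g y (-q μq y) +q g y (μq y))                            ≡⟨ ∑-vanish M (λ y _ → cancel ⟦ y ∣ᵇ m ⟧ ⟦ not (p ∣ᵇ y) ⟧ (μq y)) ⟩
    0ℚ                                                                 ∎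
  where
  open ≡-Reasoning
  instance _ = Primality.prime⇒nonZero pp
  N = suc (p *ₙ m)
  M = suc m
  h : ℕ → ℚ
  h a = ⟦ a ∣ᵇ p *ₙ m ⟧ * μq a
  g : ℕ → ℚ → ℚ
  g y x = ⟦ y ∣ᵇ m ⟧ * (⟦ not (p ∣ᵇ y) ⟧ * x)
  cancel : ∀ a b c → a * (b * -q c) +q a * (b * c) ≡ 0ℚ
  cancel = solve 3 (λ a b c → a :* (b :* (:- c)) :+ a :* (b :* c) := con 0ℚ) refl
    where open ℚ-Solver
  multiples-of-p : ∑ N (λ a → ⟦ p ∣ᵇ a ⟧ * h a) ≡ ∑ M (λ y → g y (-q μq y))
  multiples-of-p = trans (∑-multiples p m h (prime≥1 pp)) (∑-cong′ M h[py])
    where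
    h[py] : ∀ y → h (p *ₙ y) ≡ g y (-q μq y)
    h[py] y with y ∣? m
    ... | no  y∤m = trans (⟦false⟧* (μq (p *ₙ y)) (trans (∣ᵇ-*-cancelˡ p y m) (∣ᵇ-false y∤m)))
                          (sym (ℚP.*-zeroˡ (⟦ not (p ∣ᵇ y) ⟧ * -q μq y)))
    ... | yes y∣m = trans (⟦true⟧* (μq (p *ₙ y)) (trans (∣ᵇ-*-cancelˡ p y m) (∣ᵇ-true y∣m)))
                          (trans (μq-p*d pp (∣⇒≥1 m≥1 y∣m)) (sym (ℚP.*-identityˡ (⟦ not (p ∣ᵇ y) ⟧ * -q μq y))))
  non-multiples-of-p : ∑ N (λ a → ⟦ not (p ∣ᵇ a) ⟧ * h a) ≡ ∑ M (λ y → g y (μq y))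
  non-multiples-of-p = trans (∑-cong′ N pt) (sym (∑-extend M N (λ y → g y (μq y)) (s≤s (ℕP.m≤n*m m p)) beyond-m))
    where
    pt : ∀ a → ⟦ not (p ∣ᵇ a) ⟧ * h a ≡ g a (μq a)
    pt a with p ∣? a
    ... | yes _   = trans (ℚP.*-zeroˡ (h a)) (sym (trans (cong (⟦ a ∣ᵇ m ⟧ *_) (ℚP.*-zeroˡ (μq a))) (ℚP.*-zeroʳ ⟦ a ∣ᵇ m ⟧)))
    ... | no  p∤a = trans (ℚP.*-identityˡ (h a))
                    (trans (cong (λ b → ⟦ b ⟧ * μq a) (∣ᵇ-p*m m pp p∤a)) (cong (⟦ a ∣ᵇ m ⟧ *_) (sym (ℚP.*-identityˡ (μq a)))))
    beyond-m : ∀ i → M ≤ i → i < N → g i (μq i) ≡ 0ℚ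
    beyond-m i m<i _ = ⟦false⟧* _ (∣ᵇ-false (λ i∣m → ℕP.<⇒≱ m<i (ℕD.∣⇒≤ {{ℕ.>-nonZero m≥1}} i∣m)))

divisorSum-μ : ∀ n → 1 ≤ n → divisorSum n μq ≡ ⟦ n ≡ᵇ 1 ⟧
divisorSum-μ (suc zero)    _ = refl
divisorSum-μ (suc (suc n)) _ with prime-factor (suc (suc n)) (s≤s (s≤s z≤n))
... | p , pp , m , n≡pm , m≥1 = trans (cong (λ k → divisorSum k μq) n≡pm) (divisorSum-μ-p*m pp m≥1)

-- Möbius inversion

∑∑-μ-multiple : ∀ n b → 1 ≤ n → ∑ (suc n) (λ c → ∑ (suc n) (λ a → ⟦ c *ₙ (a *ₙ b) ≡ᵇ n ⟧ * μq c)) ≡ ⟦ b ≡ᵇ n ⟧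
∑∑-μ-multiple n b n≥1 with b ∣? n
... | no b∤n = trans (∑-vanish (suc n) (λ c _ → ∑-vanish (suc n) (λ a _ → ⟦false⟧* (μq c) (≡ᵇ-false (λ cab≡n →
                 b∤n (divides (c *ₙ a) (trans (sym cab≡n) (sym (ℕP.*-assoc c a b)))))))))
                 (cong ⟦_⟧ (sym (≡ᵇ-false {b} {n} (λ { refl → b∤n ℕD.∣-refl }))))
... | yes (divides q n≡qb) = begin
    ∑ (suc n) (λ c → ∑ (suc n) (λ a → ⟦ c *ₙ (a *ₙ b) ≡ᵇ n ⟧ * μq c)) ≡⟨ ∑-cong′ (suc n) (λ c → ∑-cong′ (suc n) (λ a →
                                                                          cong (λ z → ⟦ z ⟧ * μq c) (test c a))) ⟩
    factorSumBelow (suc n) q (λ c a → μq c)                            ≡⟨ sym (factorSum-extend (suc n) q (λ c a → μq c) q≥1 (s≤s q≤n)) ⟩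
    factorSum q (λ c a → μq c)                                         ≡⟨ factorSum≡divisorSum q (λ c a → μq c) q≥1 ⟩
    divisorSum q μq                                                    ≡⟨ divisorSum-μ q q≥1 ⟩
    ⟦ q ≡ᵇ 1 ⟧                                                         ≡⟨ cong ⟦_⟧ q≡1≡b≡n ⟩
    ⟦ b ≡ᵇ n ⟧                                                         ∎
  where
  open ≡-Reasoning
  q≥1 = proj₁ (factors≥1 q b n≥1 (sym n≡qb))
  b≥1 = proj₂ (factors≥1 q b n≥1 (sym n≡qb))
  q≤n = proj₁ (factors≤ q b n≥1 (sym n≡qb))
  instance _ = ℕ.>-nonZero b≥1
  test : ∀ c a → (c *ₙ (a *ₙ b) ≡ᵇ n) ≡ (c *ₙ a ≡ᵇ q)
  test c a with c *ₙ a ℕ.≟ q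
  ... | yes ca≡q = trans (≡ᵇ-true (trans (sym (ℕP.*-assoc c a b)) (trans (cong (ℕ._* b) ca≡q) (sym n≡qb))))
                         (sym (≡ᵇ-true ca≡q))
  ... | no  ca≢q = trans (≡ᵇ-false (λ cab≡n → ca≢q (ℕP.*-cancelʳ-≡ (c *ₙ a) q b (trans (ℕP.*-assoc c a b) (trans cab≡n n≡qb)))))
                         (sym (≡ᵇ-false ca≢q))
  q≡1≡b≡n : (q ≡ᵇ 1) ≡ (b ≡ᵇ n)
  q≡1≡b≡n with q ℕ.≟ 1
  ... | yes refl = trans (≡ᵇ-true {1} refl) (sym (≡ᵇ-true (trans (sym (ℕP.*-identityˡ b)) (sym n≡qb))))
  ... | no  q≢1  = trans (≡ᵇ-false q≢1) (sym (≡ᵇ-false (λ b≡n →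
                     q≢1 (ℕP.*-cancelʳ-≡ q 1 b (trans (sym n≡qb) (trans (sym b≡n) (sym (ℕP.*-identityˡ b))))))))

∑∑-μ-multiple-* : ∀ n b X → 1 ≤ n →
  ∑ (suc n) (λ c → ∑ (suc n) (λ a → ⟦ c *ₙ (a *ₙ b) ≡ᵇ n ⟧ * (μq c * X))) ≡ ⟦ b ≡ᵇ n ⟧ * X
∑∑-μ-multiple-* n b X n≥1 = begin
    ∑ N (λ c → ∑ N (λ a → ⟦ c *ₙ (a *ₙ b) ≡ᵇ n ⟧ * (μq c * X)))   ≡⟨ ∑-cong′ N (λ c → ∑-cong′ N (λ a →
                                                                     sym (ℚP.*-assoc ⟦ c *ₙ (a *ₙ b) ≡ᵇ n ⟧ (μq c) X))) ⟩
    ∑ N (λ c → ∑ N (λ a → (⟦ c *ₙ (a *ₙ b) ≡ᵇ n ⟧ * μq c) * X))   ≡⟨ ∑-cong′ N (λ c → ∑-*ʳ N X (λ a → ⟦ c *ₙ (a *ₙ b) ≡ᵇ n ⟧ * μq c)) ⟩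
    ∑ N (λ c → ∑ N (λ a → ⟦ c *ₙ (a *ₙ b) ≡ᵇ n ⟧ * μq c) * X)     ≡⟨ ∑-*ʳ N X (λ c → ∑ N (λ a → ⟦ c *ₙ (a *ₙ b) ≡ᵇ n ⟧ * μq c)) ⟩
    ∑ N (λ c → ∑ N (λ a → ⟦ c *ₙ (a *ₙ b) ≡ᵇ n ⟧ * μq c)) * X     ≡⟨ cong (_* X) (∑∑-μ-multiple n b n≥1) ⟩
    ⟦ b ≡ᵇ n ⟧ * X                                              ∎
  where
  open ≡-Reasoning
  N = suc n

∑-collapse : ∀ n c a b X → 1 ≤ n →
             ∑ (suc n) (λ d → ⟦ c *ₙ d ≡ᵇ n ⟧ * (⟦ a *ₙ b ≡ᵇ d ⟧ * X)) ≡ ⟦ c *ₙ (a *ₙ b) ≡ᵇ n ⟧ * X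
∑-collapse n c a b X n≥1 = trans (∑-cong′ (suc n) pt) at-ab
  where
  pt : ∀ d → ⟦ c *ₙ d ≡ᵇ n ⟧ * (⟦ a *ₙ b ≡ᵇ d ⟧ * X) ≡ ⟦ d ≡ᵇ a *ₙ b ⟧ * (⟦ c *ₙ d ≡ᵇ n ⟧ * X)
  pt d = trans (*-leftComm ⟦ c *ₙ d ≡ᵇ n ⟧ ⟦ a *ₙ b ≡ᵇ d ⟧ X) (cong (λ z → ⟦ z ⟧ * (⟦ c *ₙ d ≡ᵇ n ⟧ * X)) (≡ᵇ-sym (a *ₙ b) d))
  at-ab : ∑ (suc n) (λ d → ⟦ d ≡ᵇ a *ₙ b ⟧ * (⟦ c *ₙ d ≡ᵇ n ⟧ * X)) ≡ ⟦ c *ₙ (a *ₙ b) ≡ᵇ n ⟧ * X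
  at-ab with a *ₙ b ℕ.<? suc n
  ... | yes ab<N = ∑-indicator (suc n) (a *ₙ b) (λ d → ⟦ c *ₙ d ≡ᵇ n ⟧ * X) ab<N
  ... | no  ab≮N = trans (∑-indicator-out (suc n) (a *ₙ b) (λ d → ⟦ c *ₙ d ≡ᵇ n ⟧ * X) (ℕP.≮⇒≥ ab≮N))
                     (sym (⟦false⟧* X (≡ᵇ-false (λ cab≡n → ab≮N (s≤s (proj₂ (factors≤ c (a *ₙ b) n≥1 cab≡n)))))))

möbius-inversion : (f F : ℕ → ℚ) → (∀ d → 1 ≤ d → F d ≡ factorSum d (λ a b → f b)) →
                   ∀ n → 1 ≤ n → factorSum n (λ c d → μq c * F d) ≡ f n
möbius-inversion f F F≡∑f n n≥1 = begin
    ∑ N (λ c → ∑ N (λ d → ⟦ c *ₙ d ≡ᵇ n ⟧ * (μq c * F d)))          ≡⟨ ∑-cong′ N (λ c → ∑-cong′ N (λ d → expand-F c d)) ⟩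
    ∑ N (λ c → ∑ N (λ d → ∑ N (λ a → ∑ N (λ b → T c d a b))))       ≡⟨ ∑-cong′ N (λ c → trans (∑-swap N N (λ d a → ∑ N (T c d a)))
                                                                        (∑-cong′ N (λ a → ∑-swap N N (λ d b → T c d a b)))) ⟩
    ∑ N (λ c → ∑ N (λ a → ∑ N (λ b → ∑ N (λ d → T c d a b))))       ≡⟨ ∑-cong′ N (λ c → ∑-cong′ N (λ a → ∑-cong′ N (λ b →
                                                                        ∑-collapse n c a b (μq c * f b) n≥1))) ⟩
    ∑ N (λ c → ∑ N (λ a → ∑ N (λ b → U c a b)))                     ≡⟨ trans (∑-cong′ N (λ c → ∑-swap N N (U c)))
                                                                        (∑-swap N N (λ c b → ∑ N (λ a → U c a b))) ⟩
    ∑ N (λ b → ∑ N (λ c → ∑ N (λ a → U c a b)))                     ≡⟨ ∑-cong′ N (λ b → ∑∑-μ-multiple-* n b (f b) n≥1) ⟩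
    ∑ N (λ b → ⟦ b ≡ᵇ n ⟧ * f b)                                   ≡⟨ ∑-indicator N n f (ℕP.n<1+n n) ⟩
    f n                                                            ∎
  where
  open ≡-Reasoning
  N = suc n
  T : ℕ → ℕ → ℕ → ℕ → ℚ
  T c d a b = ⟦ c *ₙ d ≡ᵇ n ⟧ * (⟦ a *ₙ b ≡ᵇ d ⟧ * (μq c * f b))
  U : ℕ → ℕ → ℕ → ℚ
  U c a b = ⟦ c *ₙ (a *ₙ b) ≡ᵇ n ⟧ * (μq c * f b)
  expand-F : ∀ c d → ⟦ c *ₙ d ≡ᵇ n ⟧ * (μq c * F d) ≡ ∑ N (λ a → ∑ N (λ b → T c d a b))
  expand-F c d = begin
      ⟦ c *ₙ d ≡ᵇ n ⟧ * (μq c * F d)                                ≡⟨ ⟦⟧*-cong (c *ₙ d ≡ᵇ n) (λ cd≡n → cong (μq c *_)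
                                                                         (F≡∑f′ (≡ᵇ-sound cd≡n))) ⟩
      ⟦ c *ₙ d ≡ᵇ n ⟧ * (μq c * factorSumBelow N d (λ a b → f b))   ≡⟨ sym (ℚP.*-assoc ⟦ c *ₙ d ≡ᵇ n ⟧ (μq c) _) ⟩
      w * factorSumBelow N d (λ a b → f b)                          ≡⟨ sym (∑-*ˡ N w (λ a → ∑ N (λ b → ⟦ a *ₙ b ≡ᵇ d ⟧ * f b))) ⟩
      ∑ N (λ a → w * ∑ N (λ b → ⟦ a *ₙ b ≡ᵇ d ⟧ * f b))             ≡⟨ ∑-cong′ N (λ a → sym (∑-*ˡ N w (λ b → ⟦ a *ₙ b ≡ᵇ d ⟧ * f b))) ⟩
      ∑ N (λ a → ∑ N (λ b → w * (⟦ a *ₙ b ≡ᵇ d ⟧ * f b)))           ≡⟨ ∑-cong′ N (λ a → ∑-cong′ N (λ b →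
                                                                         rearrange ⟦ c *ₙ d ≡ᵇ n ⟧ (μq c) ⟦ a *ₙ b ≡ᵇ d ⟧ (f b))) ⟩
      ∑ N (λ a → ∑ N (λ b → T c d a b))                             ∎
    where
    w = ⟦ c *ₙ d ≡ᵇ n ⟧ * μq c
    F≡∑f′ : c *ₙ d ≡ n → F d ≡ factorSumBelow N d (λ a b → f b)
    F≡∑f′ cd≡n = trans (F≡∑f d d≥1) (factorSum-extend N d (λ a b → f b) d≥1 (s≤s (proj₂ (factors≤ c d n≥1 cd≡n))))
      where d≥1 = proj₂ (factors≥1 c d n≥1 cd≡n)
    rearrange : ∀ x y z w → (x * y) * (z * w) ≡ x * (z * (y * w))
    rearrange = solve 4 (λ x y z w → (x :* y) :* (z :* w) := x :* (z :* (y :* w))) refl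
      where open ℚ-Solver

-- The summand of J is local to its definition; this names it.
J-unfold : ∀ t n → Σ (ℕ → ℤ) λ φ → J t n ≡ foldr ℤ._+_ (+ 0) (map φ (upTo n))
J-unfold t n = _ , refl

-- The summand branches on `does (suc j ∣? n)`, which computes to `n % suc j ≡ᵇ 0`.
J-summand : ∀ t n j → ℤtoℚ (proj₁ (J-unfold t n) j) ≡ ⟦ suc j ∣ᵇ n ⟧ * (ℕtoℚ (suc j ^ t) * μq (n ℕ./ suc j))
J-summand t n j with n ℕ.% suc j ℕ.≡ᵇ 0
... | true  = trans (ℤtoℚ-* (+ (suc j ^ t)) (μ (n ℕ./ suc j))) (sym (ℚP.*-identityˡ _))
... | false = sym (ℚP.*-zeroˡ (ℕtoℚ (suc j ^ t) * μq (n ℕ./ suc j)))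

J-as-factorSum : ∀ t n → 1 ≤ n → ℤtoℚ (J t n) ≡ factorSum n (λ c d → μq c * ℕtoℚ (d ^ t))
J-as-factorSum t n n≥1 = begin
    ℤtoℚ (J t n)                                ≡⟨ cong ℤtoℚ (proj₂ (J-unfold t n)) ⟩
    ℤtoℚ (foldr ℤ._+_ (+ 0) (map φ (upTo n)))    ≡⟨ ℤtoℚ-sum φ (upTo n) ⟩
    ∑ᴸ (upTo n) (ℤtoℚ ∘ φ)                      ≡⟨ ∑ᴸ-upTo n (ℤtoℚ ∘ φ) ⟩
    ∑ n (ℤtoℚ ∘ φ)                              ≡⟨ ∑-cong′ n (J-summand t n) ⟩
    ∑ n (g ∘ suc)                               ≡⟨ sym (ℚP.+-identityˡ _) ⟩
    0ℚ +q ∑ n (g ∘ suc)                         ≡⟨ cong (_+q ∑ n (g ∘ suc)) (sym (⟦false⟧* (h 0) (∣ᵇ-false (λ 0∣n →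
                                                     ℕP.<-irrefl (sym (ℕD.0∣⇒≡0 0∣n)) n≥1)))) ⟩
    divisorSum n (λ d → ℕtoℚ (d ^ t) * μq (n div d)) ≡⟨ sym (factorSum≡divisorSum n (λ d c → ℕtoℚ (d ^ t) * μq c) n≥1) ⟩
    factorSum n (λ d c → ℕtoℚ (d ^ t) * μq c)    ≡⟨ factorSum-comm n (λ d c → ℕtoℚ (d ^ t) * μq c) ⟩
    factorSum n (λ c d → ℕtoℚ (d ^ t) * μq c)    ≡⟨ factorSum-cong′ n (λ c d → ℚP.*-comm (ℕtoℚ (d ^ t)) (μq c)) ⟩
    factorSum n (λ c d → μq c * ℕtoℚ (d ^ t))    ∎
  where
  open ≡-Reasoning
  φ = proj₁ (J-unfold t n)
  h : ℕ → ℚ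
  h d = ℕtoℚ (d ^ t) * μq (n div d)
  g : ℕ → ℚ
  g d = ⟦ d ∣ᵇ n ⟧ * h d

-- Grouping tuples by their gcd

scaleV : ∀ {k} → ℕ → Vec ℕ k → Vec ℕ k
scaleV a []      = []
scaleV a (x ∷ v) = a *ₙ x ∷ scaleV a v

allDivisibleBy : ∀ {k} → ℕ → Vec ℕ k → Bool
allDivisibleBy a []      = true
allDivisibleBy a (x ∷ v) = (a ∣ᵇ x) ∧ allDivisibleBy a v

∑ⱽ-multiples : ∀ k a b (F : Vec ℕ k → ℚ) → 1 ≤ a →
               ∑ⱽ k (suc (a *ₙ b)) (λ v → ⟦ allDivisibleBy a v ⟧ * F v) ≡ ∑ⱽ k (suc b) (F ∘ scaleV a)
∑ⱽ-multiples zero    a b F a≥1 = cong (_+q 0ℚ) (ℚP.*-identityˡ (F []))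
∑ⱽ-multiples (suc k) a b F a≥1 = begin
    ∑ⱽ (suc k) R (λ v → ⟦ allDivisibleBy a v ⟧ * F v)                           ≡⟨ ∑ⱽ-suc k R _ ⟩
    ∑ R (λ x → ∑ⱽ k R (λ v → ⟦ (a ∣ᵇ x) ∧ allDivisibleBy a v ⟧ * F (x ∷ v)))     ≡⟨ ∑-cong′ R (λ x → ∑ⱽ-cong′ k R (λ v →
                                                                                  trans (cong (_* F (x ∷ v)) (⟦∧⟧ (a ∣ᵇ x) (allDivisibleBy a v)))
                                                                                        (ℚP.*-assoc ⟦ a ∣ᵇ x ⟧ ⟦ allDivisibleBy a v ⟧ (F (x ∷ v))))) ⟩
    ∑ R (λ x → ∑ⱽ k R (λ v → ⟦ a ∣ᵇ x ⟧ * (⟦ allDivisibleBy a v ⟧ * F (x ∷ v)))) ≡⟨ ∑-cong′ R (λ x → ∑ⱽ-*ˡ k R ⟦ a ∣ᵇ x ⟧ (G x)) ⟩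
    ∑ R (λ x → ⟦ a ∣ᵇ x ⟧ * ∑ⱽ k R (λ v → ⟦ allDivisibleBy a v ⟧ * F (x ∷ v)))   ≡⟨ ∑-cong′ R (λ x → cong (⟦ a ∣ᵇ x ⟧ *_)
                                                                                  (∑ⱽ-multiples k a b (λ v → F (x ∷ v)) a≥1)) ⟩
    ∑ R (λ x → ⟦ a ∣ᵇ x ⟧ * ∑ⱽ k (suc b) (λ y → F (x ∷ scaleV a y)))            ≡⟨ ∑-multiples a b (λ x → ∑ⱽ k (suc b) (λ y → F (x ∷ scaleV a y))) a≥1 ⟩
    ∑ (suc b) (λ z → ∑ⱽ k (suc b) (λ y → F (a *ₙ z ∷ scaleV a y)))              ≡⟨ sym (∑ⱽ-suc k (suc b) (F ∘ scaleV a)) ⟩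
    ∑ⱽ (suc k) (suc b) (F ∘ scaleV a)                                           ∎
  where
  open ≡-Reasoning
  R = suc (a *ₙ b)
  G : ℕ → Vec ℕ k → ℚ
  G x v = ⟦ allDivisibleBy a v ⟧ * F (x ∷ v)

gcdV-scaleV : ∀ {k} a (v : Vec ℕ k) → gcdV (scaleV a v) ≡ a *ₙ gcdV v
gcdV-scaleV a []      = sym (ℕP.*-zeroʳ a)
gcdV-scaleV a (x ∷ v) = trans (cong (gcd (a *ₙ x)) (gcdV-scaleV a v)) (sym (GCD.c*gcd[m,n]≡gcd[cm,cn] a x (gcdV v)))

∣gcdV⇒allDivisibleBy : ∀ {k} a (v : Vec ℕ k) → a ∣ gcdV v → allDivisibleBy a v ≡ true
∣gcdV⇒allDivisibleBy a []      _   = refl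
∣gcdV⇒allDivisibleBy a (x ∷ v) a∣g = cong₂ _∧_ (∣ᵇ-true (ℕD.∣-trans a∣g (GCD.gcd[m,n]∣m x (gcdV v))))
  (∣gcdV⇒allDivisibleBy a v (ℕD.∣-trans a∣g (GCD.gcd[m,n]∣n x (gcdV v))))

gcdV∣sumV : ∀ {k} (v : Vec ℕ k) → gcdV v ∣ sumV v
gcdV∣sumV []      = ℕD.∣-refl
gcdV∣sumV (x ∷ v) = ℕD.∣m∣n⇒∣m+n (GCD.gcd[m,n]∣m x (gcdV v)) (ℕD.∣-trans (GCD.gcd[m,n]∣n x (gcdV v)) (gcdV∣sumV v))

gcdWith : ∀ {k} → ℕ → Vec ℕ k → ℕ
gcdWith n v = gcd (gcdV v) n

ScaleInvariant : ∀ k → (ℕ → Vec ℕ k → ℚ) → Set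
ScaleInvariant k Φ = ∀ a m y → 1 ≤ a → Φ (a *ₙ m) (scaleV a y) ≡ Φ m y

coprimeSum : ∀ k → (ℕ → Vec ℕ k → ℚ) → ℕ → ℚ
coprimeSum k Φ n = ∑ⱽ k (suc n) (λ y → ⟦ gcdWith n y ≡ᵇ 1 ⟧ * Φ n y)

∑ⱽ-gcdWith≡ : ∀ k (Φ : ℕ → Vec ℕ k → ℚ) → ScaleInvariant k Φ → ∀ n a → 1 ≤ n →
              ∑ⱽ k (suc n) (λ v → ⟦ gcdWith n v ≡ᵇ a ⟧ * Φ n v) ≡ ⟦ a ∣ᵇ n ⟧ * coprimeSum k Φ (n div a)
∑ⱽ-gcdWith≡ k Φ Φ-inv n a n≥1 with a ∣? n
... | no a∤n = trans (∑ⱽ-vanish k (suc n) (λ v _ → ⟦false⟧* (Φ n v) (≡ᵇ-false (λ g≡a →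
                 a∤n (subst (_∣ n) g≡a (GCD.gcd[m,n]∣n (gcdV v) n))))))
                 (sym (ℚP.*-zeroˡ (coprimeSum k Φ (n div a))))
∑ⱽ-gcdWith≡ k Φ Φ-inv n zero    n≥1 | yes 0∣n = ⊥-elim (ℕP.<-irrefl (sym (ℕD.0∣⇒≡0 0∣n)) n≥1)
∑ⱽ-gcdWith≡ k Φ Φ-inv n (suc a) n≥1 | yes (divides q n≡qa) =
  trans (at-multiple n (trans n≡qa (ℕP.*-comm q (suc a)))) (sym (ℚP.*-identityˡ _))
  where
  at-multiple : ∀ n → n ≡ suc a *ₙ q → ∑ⱽ k (suc n) (λ v → ⟦ gcdWith n v ≡ᵇ suc a ⟧ * Φ n v) ≡ coprimeSum k Φ (n div suc a)
  at-multiple .(suc a *ₙ q) refl = begin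
      ∑ⱽ k (suc N) (λ v → ⟦ gcdWith N v ≡ᵇ suc a ⟧ * Φ N v)                         ≡⟨ ∑ⱽ-cong′ k (suc N) only-multiples ⟩
      ∑ⱽ k (suc N) (λ v → ⟦ allDivisibleBy (suc a) v ⟧ * (⟦ gcdWith N v ≡ᵇ suc a ⟧ * Φ N v))
                                                                                 ≡⟨ ∑ⱽ-multiples k (suc a) q _ (s≤s z≤n) ⟩
      ∑ⱽ k (suc q) (λ y → ⟦ gcdWith N (scaleV (suc a) y) ≡ᵇ suc a ⟧ * Φ N (scaleV (suc a) y))
                                                                                 ≡⟨ ∑ⱽ-cong′ k (suc q) descale ⟩
      coprimeSum k Φ q                                                           ≡⟨ cong (coprimeSum k Φ) (sym N/a≡q) ⟩
      coprimeSum k Φ (N div suc a)                                               ∎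
    where
    open ≡-Reasoning
    N = suc a *ₙ q
    N/a≡q : N div suc a ≡ q
    N/a≡q = trans (cong (ℕ._/ suc a) (ℕP.*-comm (suc a) q)) (ℕDM.m*n/n≡m q (suc a))
    only-multiples : ∀ v → ⟦ gcdWith N v ≡ᵇ suc a ⟧ * Φ N v ≡ ⟦ allDivisibleBy (suc a) v ⟧ * (⟦ gcdWith N v ≡ᵇ suc a ⟧ * Φ N v)
    only-multiples v = sym (trans (sym (ℚP.*-assoc ⟦ allDivisibleBy (suc a) v ⟧ _ (Φ N v)))
      (trans (cong (_* Φ N v) (sym (⟦∧⟧ (allDivisibleBy (suc a) v) _))) (cong (λ z → ⟦ z ⟧ * Φ N v) (absorb _ refl))))
      where
      absorb : ∀ b → (gcdWith N v ≡ᵇ suc a) ≡ b → (allDivisibleBy (suc a) v ∧ b) ≡ b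
      absorb false _ = BoolP.∧-zeroʳ _
      absorb true  e = cong (_∧ true) (∣gcdV⇒allDivisibleBy (suc a) v
                         (subst (_∣ gcdV v) (≡ᵇ-sound e) (GCD.gcd[m,n]∣m (gcdV v) N)))
    descale : ∀ y → ⟦ gcdWith N (scaleV (suc a) y) ≡ᵇ suc a ⟧ * Φ N (scaleV (suc a) y) ≡ ⟦ gcdWith q y ≡ᵇ 1 ⟧ * Φ q y
    descale y = cong₂ _*_ (cong ⟦_⟧ test) (Φ-inv (suc a) q y (s≤s z≤n))
      where
      gcd-scaled : gcdWith N (scaleV (suc a) y) ≡ suc a *ₙ gcdWith q y
      gcd-scaled = trans (cong (λ z → gcd z N) (gcdV-scaleV (suc a) y)) (sym (GCD.c*gcd[m,n]≡gcd[cm,cn] (suc a) (gcdV y) q))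
      test : (gcdWith N (scaleV (suc a) y) ≡ᵇ suc a) ≡ (gcdWith q y ≡ᵇ 1)
      test = trans (cong (_≡ᵇ suc a) gcd-scaled) (trans (cong (suc a *ₙ gcdWith q y ≡ᵇ_) (sym (ℕP.*-identityʳ (suc a))))
               (≡ᵇ-*-cancelˡ (suc a) (gcdWith q y) 1 (s≤s z≤n)))

∑ⱽ≡factorSum-coprimeSum : ∀ k (Φ : ℕ → Vec ℕ k → ℚ) → ScaleInvariant k Φ →
                          ∀ n → 1 ≤ n → ∑ⱽ k (suc n) (Φ n) ≡ factorSum n (λ a b → coprimeSum k Φ b)
∑ⱽ≡factorSum-coprimeSum k Φ Φ-inv n n≥1 = begin
    ∑ⱽ k N (Φ n)                                                  ≡⟨ ∑ⱽ-cong′ k N (λ v → sym (trans (cong (_* Φ n v)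
                                                                       (∑-indicator≡1 N (gcdWith n v) (s≤s (GCD.gcd[m,n]≤n (gcdV v) n {{ℕ.>-nonZero n≥1}}))))
                                                                       (ℚP.*-identityˡ (Φ n v)))) ⟩
    ∑ⱽ k N (λ v → ∑ N (λ a → ⟦ gcdWith n v ≡ᵇ a ⟧) * Φ n v)       ≡⟨ ∑ⱽ-cong′ k N (λ v → sym (∑-*ʳ N (Φ n v) (λ a → ⟦ gcdWith n v ≡ᵇ a ⟧))) ⟩
    ∑ⱽ k N (λ v → ∑ N (λ a → ⟦ gcdWith n v ≡ᵇ a ⟧ * Φ n v))       ≡⟨ ∑ⱽ-∑ k N N (λ a v → ⟦ gcdWith n v ≡ᵇ a ⟧ * Φ n v) ⟩
    ∑ N (λ a → ∑ⱽ k N (λ v → ⟦ gcdWith n v ≡ᵇ a ⟧ * Φ n v))       ≡⟨ ∑-cong′ N (λ a → ∑ⱽ-gcdWith≡ k Φ Φ-inv n a n≥1) ⟩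
    divisorSum n (λ a → coprimeSum k Φ (n div a))                 ≡⟨ sym (factorSum≡divisorSum n (λ a b → coprimeSum k Φ b) n≥1) ⟩
    factorSum n (λ a b → coprimeSum k Φ b)                        ∎
  where
  open ≡-Reasoning
  N = suc n

coprimeSum-möbius : ∀ k (Φ : ℕ → Vec ℕ k → ℚ) → ScaleInvariant k Φ →
                    ∀ n → 1 ≤ n → coprimeSum k Φ n ≡ factorSum n (λ c d → μq c * ∑ⱽ k (suc d) (Φ d))
coprimeSum-möbius k Φ Φ-inv n n≥1 =
  sym (möbius-inversion (coprimeSum k Φ) (λ d → ∑ⱽ k (suc d) (Φ d)) (∑ⱽ≡factorSum-coprimeSum k Φ Φ-inv) n n≥1)

allBelow : ∀ {k} → ℕ → Vec ℕ k → Bool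
allBelow n []      = true
allBelow n (x ∷ v) = (x ℕ.<ᵇ n) ∧ allBelow n v

allBelow-scaleV : ∀ {k} a m (y : Vec ℕ k) → 1 ≤ a → allBelow (a *ₙ m) (scaleV a y) ≡ allBelow m y
allBelow-scaleV a m []      _   = refl
allBelow-scaleV a m (x ∷ y) a≥1 = cong₂ _∧_ (<ᵇ-*-cancelˡ a x m a≥1) (allBelow-scaleV a m y a≥1)

allBelow-complete : ∀ {k} n (v : Vec ℕ k) → Below n v → allBelow n v ≡ true
allBelow-complete n []      _           = refl
allBelow-complete n (x ∷ v) (x<n , v<n) = cong₂ _∧_ (<ᵇ-true x<n) (allBelow-complete n v v<n)

allBelow-sound : ∀ {k} n (v : Vec ℕ k) → ¬ Below n v → allBelow n v ≡ false
allBelow-sound n []      v≮n = ⊥-elim (v≮n tt)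
allBelow-sound n (x ∷ v) v≮n with x ℕ.<? n
... | no  x≮n = cong (_∧ allBelow n v) (<ᵇ-false x≮n)
... | yes x<n = trans (cong (_∧ allBelow n v) (<ᵇ-true x<n)) (allBelow-sound n v (λ v<n → v≮n (x<n , v<n)))

∑ⱽ-allBelow : ∀ k n → ∑ⱽ k (suc n) (λ v → ⟦ allBelow n v ⟧) ≡ ℕtoℚ (n ^ k)
∑ⱽ-allBelow k n = begin
    ∑ⱽ k (suc n) (λ v → ⟦ allBelow n v ⟧) ≡⟨ sym (∑ⱽ-extend k n (suc n) _ (ℕP.n≤1+n n) (λ v _ v≮n → cong ⟦_⟧ (allBelow-sound n v v≮n))) ⟩
    ∑ⱽ k n (λ v → ⟦ allBelow n v ⟧)       ≡⟨ ∑ⱽ-cong k n (λ v v<n → cong ⟦_⟧ (allBelow-complete n v v<n)) ⟩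
    ∑ⱽ k n (λ _ → 1ℚ)                     ≡⟨ ∑ⱽ-1 k n ⟩
    ℕtoℚ (n ^ k)                          ∎
  where open ≡-Reasoning

J-as-coprimeSum : ∀ t n → 1 ≤ n → ℤtoℚ (J t n) ≡ coprimeSum t (λ n v → ⟦ allBelow n v ⟧) n
J-as-coprimeSum t n n≥1 = begin
    ℤtoℚ (J t n)                                               ≡⟨ J-as-factorSum t n n≥1 ⟩
    factorSum n (λ c d → μq c * ℕtoℚ (d ^ t))                   ≡⟨ factorSum-cong′ n (λ c d → cong (μq c *_) (sym (∑ⱽ-allBelow t d))) ⟩
    factorSum n (λ c d → μq c * ∑ⱽ t (suc d) (λ v → ⟦ allBelow d v ⟧)) ≡⟨ sym (coprimeSum-möbius t _ allBelow-invariant n n≥1) ⟩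
    coprimeSum t (λ n v → ⟦ allBelow n v ⟧) n                   ∎
  where
  open ≡-Reasoning
  allBelow-invariant : ScaleInvariant t (λ n v → ⟦ allBelow n v ⟧)
  allBelow-invariant a m y a≥1 = cong ⟦_⟧ (allBelow-scaleV a m y a≥1)

J-nonNeg : ∀ t n → 1 ≤ n → 0ℚ ≤q ℤtoℚ (J t n)
J-nonNeg t n n≥1 = subst (0ℚ ≤q_) (sym (J-as-coprimeSum t n n≥1))
  (∑ⱽ-nonNeg t (suc n) (λ y → *-nonNeg (⟦⟧-nonNeg (gcdWith n y ≡ᵇ 1)) (⟦⟧-nonNeg (allBelow n y))))

J≤n^t : ∀ t n → 1 ≤ n → ℤtoℚ (J t n) ≤q ℕtoℚ (n ^ t)
J≤n^t t n n≥1 = subst₂ _≤q_ (sym (J-as-coprimeSum t n n≥1)) (∑ⱽ-allBelow t n)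
  (∑ⱽ-mono-≤′ t (suc n) (λ y → ⟦⟧*≤ (gcdWith n y ≡ᵇ 1) (⟦⟧-nonNeg (allBelow n y))))

∣J∣≤n^t : ∀ t n → 1 ≤ n → ∣ ℤtoℚ (J t n) ∣q ≤q ℕtoℚ (n ^ t)
∣J∣≤n^t t n n≥1 = subst (_≤q ℕtoℚ (n ^ t)) (sym (ℚP.0≤p⇒∣p∣≡p (J-nonNeg t n n≥1))) (J≤n^t t n n≥1)

allPositive-scaleV : ∀ {k} a (y : Vec ℕ k) → 1 ≤ a → allPositive (scaleV a y) ≡ allPositive y
allPositive-scaleV a []      _   = refl
allPositive-scaleV a (x ∷ y) a≥1 = cong₂ _∧_ (1≤ᵇ-*-cancelˡ a x a≥1) (allPositive-scaleV a y a≥1)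

sumV-scaleV : ∀ {k} a (y : Vec ℕ k) → sumV (scaleV a y) ≡ a *ₙ sumV y
sumV-scaleV a []      = sym (ℕP.*-zeroʳ a)
sumV-scaleV a (x ∷ y) = trans (cong (λ z → a *ₙ x + z) (sumV-scaleV a y)) (sym (ℕP.*-distribˡ-+ a x (sumV y)))

isComposition-invariant : ∀ k → ScaleInvariant k (λ n v → ⟦ isComposition n v ⟧)
isComposition-invariant k a m y a≥1 = cong ⟦_⟧ (cong₂ _∧_ (allPositive-scaleV a y a≥1)
  (trans (cong (ℕ._≡ᵇ a *ₙ m) (sumV-scaleV a y)) (≡ᵇ-*-cancelˡ a (sumV y) m a≥1)))

compositionCount : ℕ → ℕ → ℚ
compositionCount k d = ∑ⱽ k (suc d) (λ v → ⟦ isComposition d v ⟧)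

c′-as-∑ⱽ : ∀ k n → ℕtoℚ (c′ k n) ≡ ∑ⱽ k (suc n) (λ v → ⟦ isComposition n v ⟧ * ⟦ isCoprime v ⟧)
c′-as-∑ⱽ k n = trans (length-filter isCoprime (compositions k n)) (∑ᴸ-filter (isComposition n) (tuplesBelow k (suc n)) _)

c′-as-coprimeSum : ∀ k n → ℕtoℚ (c′ k n) ≡ coprimeSum k (λ n v → ⟦ isComposition n v ⟧) n
c′-as-coprimeSum k n = trans (c′-as-∑ⱽ k n) (∑ⱽ-cong′ k (suc n) swap-tests)
  where
  swap-tests : ∀ v → ⟦ isComposition n v ⟧ * ⟦ isCoprime v ⟧ ≡ ⟦ gcdWith n v ≡ᵇ 1 ⟧ * ⟦ isComposition n v ⟧
  swap-tests v with isComposition n v in e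
  ... | false = trans (ℚP.*-zeroˡ ⟦ isCoprime v ⟧) (sym (ℚP.*-zeroʳ ⟦ gcdWith n v ≡ᵇ 1 ⟧))
  ... | true  = trans (ℚP.*-comm 1ℚ ⟦ isCoprime v ⟧) (cong (λ z → ⟦ z ≡ᵇ 1 ⟧ * 1ℚ) (sym gcd≡gcdV))
    where
    gcdV∣n : gcdV v ∣ n
    gcdV∣n = subst (gcdV v ∣_) (≡ᵇ-sound (∧-true-r (allPositive v) e)) (gcdV∣sumV v)
    gcd≡gcdV : gcdWith n v ≡ gcdV v
    gcd≡gcdV = ℕD.∣-antisym (GCD.gcd[m,n]∣m (gcdV v) n) (GCD.gcd-greatest ℕD.∣-refl gcdV∣n)

c′-as-factorSum : ∀ k n → 1 ≤ n → ℕtoℚ (c′ k n) ≡ factorSum n (λ c d → μq c * compositionCount k d)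
c′-as-factorSum k n n≥1 = trans (c′-as-coprimeSum k n) (coprimeSum-möbius k _ (isComposition-invariant k) n n≥1)

-- The number of compositions is a polynomial in n

eval : List ℚ → ℚ → ℚ
eval []      x = 0ℚ
eval (c ∷ P) x = c +q x * eval P x

eval-addP : ∀ P Q x → eval (addP P Q) x ≡ eval P x +q eval Q x
eval-addP []      Q       x = sym (ℚP.+-identityˡ (eval Q x))
eval-addP (a ∷ P) []      x = sym (ℚP.+-identityʳ (a +q x * eval P x))
eval-addP (a ∷ P) (b ∷ Q) x = trans (cong (λ z → (a +q b) +q x * z) (eval-addP P Q x))
  (solve 5 (λ a b x u v → (a :+ b) :+ x :* (u :+ v) := (a :+ x :* u) :+ (b :+ x :* v)) refl a b x (eval P x) (eval Q x))
  where open ℚ-Solver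

eval-scale : ∀ c P x → eval (map (λ a → -q (c * a)) P) x ≡ -q (c * eval P x)
eval-scale c []      x = cong -q_ (sym (ℚP.*-zeroʳ c))
eval-scale c (a ∷ P) x = trans (cong (λ z → -q (c * a) +q x * z) (eval-scale c P x))
  (solve 4 (λ c a x u → (:- (c :* a)) :+ x :* (:- (c :* u)) := :- (c :* (a :+ x :* u))) refl c a x (eval P x))
  where open ℚ-Solver

eval-mulXminus : ∀ c P x → eval (mulXminus c P) x ≡ (x -q c) * eval P x
eval-mulXminus c P x = trans (eval-addP (0ℚ ∷ P) (map (λ a → -q (c * a)) P) x)
  (trans (cong ((0ℚ +q x * eval P x) +q_) (eval-scale c P x))
  (solve 3 (λ c x u → (con 0ℚ :+ x :* u) :+ (:- (c :* u)) := (x :- c) :* u) refl c x (eval P x)))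
  where open ℚ-Solver

falling : ℕ → ℚ → ℚ
falling m = eval (fallingPoly m)

falling-zero : ∀ x → falling 0 x ≡ 1ℚ
falling-zero x = trans (cong (1ℚ +q_) (ℚP.*-zeroʳ x)) (ℚP.+-identityʳ 1ℚ)

falling-suc : ∀ m x → falling (suc m) x ≡ (x -q ℕtoℚ (suc m)) * falling m x
falling-suc m = eval-mulXminus (ℕtoℚ (suc m)) (fallingPoly m)

falling-shift : ∀ m x → falling (suc m) (x +q 1ℚ) ≡ x * falling m x
falling-shift zero x = begin
    falling 1 (x +q 1ℚ)                  ≡⟨ falling-suc 0 (x +q 1ℚ) ⟩
    (x +q 1ℚ -q 1ℚ) * falling 0 (x +q 1ℚ) ≡⟨ cong₂ _*_ (solve 1 (λ x → x :+ con 1ℚ :- con 1ℚ := x) refl x)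
                                             (trans (falling-zero (x +q 1ℚ)) (sym (falling-zero x))) ⟩
    x * falling 0 x                      ∎
  where
  open ≡-Reasoning
  open ℚ-Solver
falling-shift (suc m) x = begin
    falling (suc (suc m)) (x +q 1ℚ)                                  ≡⟨ falling-suc (suc m) (x +q 1ℚ) ⟩
    (x +q 1ℚ -q ℕtoℚ (suc (suc m))) * falling (suc m) (x +q 1ℚ)      ≡⟨ cong₂ (λ c z → (x +q 1ℚ -q c) * z) (ℕtoℚ-suc (suc m)) (falling-shift m x) ⟩
    (x +q 1ℚ -q (1ℚ +q ℕtoℚ (suc m))) * (x * falling m x)           ≡⟨ solve 3 (λ x c u → (x :+ con 1ℚ :- (con 1ℚ :+ c)) :* (x :* u)
                                                                         := x :* ((x :- c) :* u)) refl x (ℕtoℚ (suc m)) (falling m x) ⟩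
    x * ((x -q ℕtoℚ (suc m)) * falling m x)                         ≡⟨ cong (x *_) (sym (falling-suc m x)) ⟩
    x * falling (suc m) x                                           ∎
  where
  open ≡-Reasoning
  open ℚ-Solver

falling-difference : ∀ m x → falling (suc m) (x +q 1ℚ) ≡ falling (suc m) x +q ℕtoℚ (suc m) * falling m x
falling-difference m x = begin
    falling (suc m) (x +q 1ℚ)                                        ≡⟨ falling-shift m x ⟩
    x * falling m x                                                  ≡⟨ solve 3 (λ x c u → x :* u := (x :- c) :* u :+ c :* u)
                                                                          refl x (ℕtoℚ (suc m)) (falling m x) ⟩
    (x -q ℕtoℚ (suc m)) * falling m x +q ℕtoℚ (suc m) * falling m x ≡⟨ cong (_+q ℕtoℚ (suc m) * falling m x) (sym (falling-suc m x)) ⟩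
    falling (suc m) x +q ℕtoℚ (suc m) * falling m x                 ∎
  where
  open ≡-Reasoning
  open ℚ-Solver

falling-one : ∀ m → falling (suc m) 1ℚ ≡ 0ℚ
falling-one m = trans (cong (falling (suc m)) (sym (ℚP.+-identityˡ 1ℚ))) (trans (falling-shift m 0ℚ) (ℚP.*-zeroˡ (falling m 0ℚ)))

Below-sumV : ∀ {k} (v : Vec ℕ k) → Below (suc (sumV v)) v
Below-sumV []      = tt
Below-sumV (x ∷ v) = s≤s (ℕP.m≤m+n x (sumV v)) , Below-mono (Below-sumV v)
  where
  Below-mono : ∀ {j} {w : Vec ℕ j} → Below (suc (sumV v)) w → Below (suc (x + sumV v)) w
  Below-mono {w = []}    _           = tt
  Below-mono {w = y ∷ w} (y< , w<) = ℕP.<-≤-trans y< (s≤s (ℕP.m≤n+m (sumV v) x)) , Below-mono w<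

isComposition-Below : ∀ {k} n (v : Vec ℕ k) → ¬ Below (suc n) v → isComposition n v ≡ false
isComposition-Below n v v≮ with isComposition n v in e
... | false = refl
... | true  = ⊥-elim (v≮ (subst (λ z → Below (suc z) v) (≡ᵇ-sound (∧-true-r (allPositive v) e)) (Below-sumV v)))

compositionCount-extend : ∀ k m M → m ≤ M → compositionCount k m ≡ ∑ⱽ k (suc M) (λ v → ⟦ isComposition m v ⟧)
compositionCount-extend k m M m≤M =
  ∑ⱽ-extend k (suc m) (suc M) _ (s≤s m≤M) (λ v _ v≮ → cong ⟦_⟧ (isComposition-Below m v v≮))

+≡ᵇ⇔≡ᵇ∸ : ∀ x s d → x ≤ d → (x + s ≡ᵇ d) ≡ (s ≡ᵇ d ∸ x)
+≡ᵇ⇔≡ᵇ∸ x s d x≤d with s ℕ.≟ d ∸ x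
... | yes s≡d-x = trans (≡ᵇ-true (trans (cong (λ z → x + z) s≡d-x) (ℕP.m+[n∸m]≡n x≤d))) (sym (≡ᵇ-true s≡d-x))
... | no  s≢d-x = trans (≡ᵇ-false (λ x+s≡d → s≢d-x (trans (sym (ℕP.m+n∸m≡n x s)) (cong (_∸ x) x+s≡d)))) (sym (≡ᵇ-false s≢d-x))

compositionCount-first : ∀ k d x → x ≤ d →
  ∑ⱽ k (suc d) (λ v → ⟦ isComposition d (x ∷ v) ⟧) ≡ ⟦ 1 ℕ.≤ᵇ x ⟧ * compositionCount k (d ∸ x)
compositionCount-first k d x x≤d = begin
    ∑ⱽ k (suc d) (λ v → ⟦ isComposition d (x ∷ v) ⟧)                   ≡⟨ ∑ⱽ-cong′ k (suc d) split-first ⟩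
    ∑ⱽ k (suc d) (λ v → ⟦ 1 ℕ.≤ᵇ x ⟧ * ⟦ isComposition (d ∸ x) v ⟧)   ≡⟨ ∑ⱽ-*ˡ k (suc d) ⟦ 1 ℕ.≤ᵇ x ⟧ _ ⟩
    ⟦ 1 ℕ.≤ᵇ x ⟧ * ∑ⱽ k (suc d) (λ v → ⟦ isComposition (d ∸ x) v ⟧)   ≡⟨ cong (⟦ 1 ℕ.≤ᵇ x ⟧ *_)
                                                                         (sym (compositionCount-extend k (d ∸ x) d (ℕP.m∸n≤m d x))) ⟩
    ⟦ 1 ℕ.≤ᵇ x ⟧ * compositionCount k (d ∸ x)                        ∎
  where
  open ≡-Reasoning
  split-first : ∀ v → ⟦ isComposition d (x ∷ v) ⟧ ≡ ⟦ 1 ℕ.≤ᵇ x ⟧ * ⟦ isComposition (d ∸ x) v ⟧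
  split-first v = trans (cong ⟦_⟧ (trans (BoolP.∧-assoc (1 ℕ.≤ᵇ x) (allPositive v) _)
    (cong (λ z → (1 ℕ.≤ᵇ x) ∧ (allPositive v ∧ z)) (+≡ᵇ⇔≡ᵇ∸ x (sumV v) d x≤d)))) (⟦∧⟧ (1 ℕ.≤ᵇ x) _)

compositionCount-suc : ∀ k d → compositionCount (suc k) d ≡ ∑ d (λ x → compositionCount k (d ∸ suc x))
compositionCount-suc k d = begin
    compositionCount (suc k) d                                         ≡⟨ ∑ⱽ-suc k (suc d) _ ⟩
    ∑ (suc d) (λ x → ∑ⱽ k (suc d) (λ v → ⟦ isComposition d (x ∷ v) ⟧)) ≡⟨ ∑-cong (suc d) (λ x x≤d →
                                                                          compositionCount-first k d x (ℕP.≤-pred x≤d)) ⟩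
    ⟦ false ⟧ * compositionCount k d +q ∑ d (λ x → 1ℚ * compositionCount k (d ∸ suc x))
                                                                       ≡⟨ cong₂ _+q_ (ℚP.*-zeroˡ (compositionCount k d))
                                                                          (∑-cong′ d (λ x → ℚP.*-identityˡ _)) ⟩
    0ℚ +q ∑ d (λ x → compositionCount k (d ∸ suc x))                   ≡⟨ ℚP.+-identityˡ _ ⟩
    ∑ d (λ x → compositionCount k (d ∸ suc x))                         ∎
  where open ≡-Reasoning

compositionCount-pascal : ∀ k d → compositionCount (suc k) (suc d) ≡ compositionCount k d +q compositionCount (suc k) d
compositionCount-pascal k d = trans (compositionCount-suc k (suc d)) (cong (compositionCount k d +q_) (sym (compositionCount-suc k d)))

compositionCount-1 : ∀ d → 1 ≤ d → compositionCount 1 d ≡ 1ℚ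
compositionCount-1 (suc zero)    _ = refl
compositionCount-1 (suc (suc d)) _ = trans (compositionCount-pascal 0 (suc d))
  (trans (cong (0ℚ +q_) (compositionCount-1 (suc d) (s≤s z≤n))) (ℚP.+-identityˡ 1ℚ))

compositionCount≡falling : ∀ m d → 1 ≤ d → compositionCount (suc m) d ≡ inv! m * falling m (ℕtoℚ d)
compositionCount≡falling zero d d≥1 = trans (compositionCount-1 d d≥1) (sym (trans (ℚP.*-identityˡ _) (falling-zero (ℕtoℚ d))))
compositionCount≡falling (suc m) (suc zero) _ = begin
    compositionCount (suc (suc m)) 1                       ≡⟨ compositionCount-pascal (suc m) 0 ⟩
    compositionCount (suc m) 0 +q compositionCount (suc (suc m)) 0 ≡⟨ cong₂ _+q_ (compositionCount-suc m 0) (compositionCount-suc (suc m) 0) ⟩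
    0ℚ                                                     ≡⟨ sym (ℚP.*-zeroʳ (inv! (suc m))) ⟩
    inv! (suc m) * 0ℚ                                      ≡⟨ cong (inv! (suc m) *_) (sym (falling-one m)) ⟩
    inv! (suc m) * falling (suc m) 1ℚ                      ∎
  where open ≡-Reasoning
compositionCount≡falling (suc m) (suc (suc d)) _ = begin
    compositionCount (suc (suc m)) (suc (suc d))                       ≡⟨ compositionCount-pascal (suc m) (suc d) ⟩
    compositionCount (suc m) (suc d) +q compositionCount (suc (suc m)) (suc d)
                                                                       ≡⟨ cong₂ _+q_ (compositionCount≡falling m (suc d) (s≤s z≤n))
                                                                          (compositionCount≡falling (suc m) (suc d) (s≤s z≤n)) ⟩
    inv! m * falling m x +q inv! (suc m) * falling (suc m) x           ≡⟨ cong (λ z → z * falling m x +q inv! (suc m) * falling (suc m) x)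
                                                                          (sym (inv!-suc m)) ⟩
    (inv! (suc m) * ℕtoℚ (suc m)) * falling m x +q inv! (suc m) * falling (suc m) x
                                                                       ≡⟨ solve 4 (λ u k a b → (u :* k) :* a :+ u :* b := u :* (b :+ k :* a))
                                                                          refl (inv! (suc m)) (ℕtoℚ (suc m)) (falling m x) (falling (suc m) x) ⟩
    inv! (suc m) * (falling (suc m) x +q ℕtoℚ (suc m) * falling m x)   ≡⟨ cong (inv! (suc m) *_) (sym (falling-difference m x)) ⟩
    inv! (suc m) * falling (suc m) (x +q 1ℚ)                           ≡⟨ cong (λ z → inv! (suc m) * falling (suc m) z)
                                                                          (trans (ℚP.+-comm x 1ℚ) (sym (ℕtoℚ-suc (suc d)))) ⟩
    inv! (suc m) * falling (suc m) (ℕtoℚ (suc (suc d)))                ∎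
  where
  open ≡-Reasoning
  open ℚ-Solver
  x = ℕtoℚ (suc d)

length-addP : ∀ P Q → length Q ≤ length P → length (addP P Q) ≡ length P
length-addP []      []      _         = refl
length-addP (a ∷ P) []      _         = refl
length-addP (a ∷ P) (b ∷ Q) (s≤s Q≤P) = cong suc (length-addP P Q Q≤P)

length-fallingPoly : ∀ m → length (fallingPoly m) ≡ suc m
length-fallingPoly zero    = refl
length-fallingPoly (suc m) = trans
  (length-addP (0ℚ ∷ fallingPoly m) (map (λ a → -q (ℕtoℚ (suc m) * a)) (fallingPoly m))
    (subst (_≤ suc (length (fallingPoly m))) (sym (ListP.length-map _ (fallingPoly m))) (ℕP.n≤1+n _)))
  (cong suc (length-fallingPoly m))

coeff-addP : ∀ P Q i → coeff (addP P Q) i ≡ coeff P i +q coeff Q i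
coeff-addP []      Q       i       = sym (ℚP.+-identityˡ _)
coeff-addP (a ∷ P) []      zero    = sym (ℚP.+-identityʳ _)
coeff-addP (a ∷ P) []      (suc i) = sym (ℚP.+-identityʳ _)
coeff-addP (a ∷ P) (b ∷ Q) zero    = refl
coeff-addP (a ∷ P) (b ∷ Q) (suc i) = coeff-addP P Q i

coeff-map : ∀ (f : ℚ → ℚ) → f 0ℚ ≡ 0ℚ → ∀ P i → coeff (map f P) i ≡ f (coeff P i)
coeff-map f f0≡0 []      i       = sym f0≡0
coeff-map f f0≡0 (a ∷ P) zero    = refl
coeff-map f f0≡0 (a ∷ P) (suc i) = coeff-map f f0≡0 P i

coeff-beyond : ∀ P i → length P ≤ i → coeff P i ≡ 0ℚ
coeff-beyond []      i       _         = refl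
coeff-beyond (a ∷ P) (suc i) (s≤s P≤i) = coeff-beyond P i P≤i

∑-coeff≡eval : ∀ P L d → length P ≤ L → ∑ L (λ i → coeff P i * ℕtoℚ (d ^ i)) ≡ eval P (ℕtoℚ d)
∑-coeff≡eval []      L       d _         = ∑-vanish L (λ i _ → ℚP.*-zeroˡ (ℕtoℚ (d ^ i)))
∑-coeff≡eval (c ∷ P) (suc L) d (s≤s P≤L) = begin
    c * ℕtoℚ 1 +q ∑ L (λ i → coeff P i * ℕtoℚ (d ^ suc i))          ≡⟨ cong₂ _+q_ (ℚP.*-identityʳ c) (∑-cong′ L (λ i →
                                                                        trans (cong (coeff P i *_) (ℕtoℚ-* d (d ^ i)))
                                                                              (*-leftComm (coeff P i) (ℕtoℚ d) _))) ⟩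
    c +q ∑ L (λ i → ℕtoℚ d * (coeff P i * ℕtoℚ (d ^ i)))            ≡⟨ cong (c +q_) (∑-*ˡ L (ℕtoℚ d) _) ⟩
    c +q ℕtoℚ d * ∑ L (λ i → coeff P i * ℕtoℚ (d ^ i))              ≡⟨ cong (λ z → c +q ℕtoℚ d * z) (∑-coeff≡eval P L d P≤L) ⟩
    c +q ℕtoℚ d * eval P (ℕtoℚ d)                                   ∎
  where open ≡-Reasoning

coeff-fallingPoly-lead : ∀ m → coeff (fallingPoly m) m ≡ 1ℚ
coeff-fallingPoly-lead zero    = refl
coeff-fallingPoly-lead (suc m) = begin
    coeff (mulXminus c (fallingPoly m)) (suc m)                    ≡⟨ coeff-addP (0ℚ ∷ fallingPoly m) (map (λ a → -q (c * a)) (fallingPoly m)) (suc m) ⟩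
    coeff (fallingPoly m) m +q coeff (map (λ a → -q (c * a)) (fallingPoly m)) (suc m)
                                                                   ≡⟨ cong₂ _+q_ (coeff-fallingPoly-lead m)
                                                                      (coeff-map (λ a → -q (c * a)) (cong -q_ (ℚP.*-zeroʳ c)) (fallingPoly m) (suc m)) ⟩
    1ℚ +q -q (c * coeff (fallingPoly m) (suc m))                  ≡⟨ cong (λ z → 1ℚ +q -q (c * z))
                                                                      (coeff-beyond (fallingPoly m) (suc m) (ℕP.≤-reflexive (length-fallingPoly m))) ⟩
    1ℚ +q -q (c * 0ℚ)                                              ≡⟨ cong (λ z → 1ℚ +q -q z) (ℚP.*-zeroʳ c) ⟩
    1ℚ                                                             ∎
  where
  open ≡-Reasoning
  c = ℕtoℚ (suc m)

a-lead : ∀ m → a (suc m) m ≡ inv! m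
a-lead m = trans (cong (_* inv! m) (coeff-fallingPoly-lead m)) (ℚP.*-identityˡ (inv! m))

compositionCount≡∑a : ∀ m d → 1 ≤ d → compositionCount (suc m) d ≡ ∑ (suc m) (λ i → a (suc m) i * ℕtoℚ (d ^ i))
compositionCount≡∑a m d d≥1 = begin
    compositionCount (suc m) d                               ≡⟨ compositionCount≡falling m d d≥1 ⟩
    inv! m * falling m (ℕtoℚ d)                              ≡⟨ cong (inv! m *_) (sym (∑-coeff≡eval (fallingPoly m) (suc m) d
                                                                 (ℕP.≤-reflexive (length-fallingPoly m)))) ⟩
    inv! m * ∑ (suc m) (λ i → A i * ℕtoℚ (d ^ i))            ≡⟨ sym (∑-*ˡ (suc m) (inv! m) (λ i → A i * ℕtoℚ (d ^ i))) ⟩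
    ∑ (suc m) (λ i → inv! m * (A i * ℕtoℚ (d ^ i)))          ≡⟨ ∑-cong′ (suc m) (λ i → trans (*-leftComm (inv! m) (A i) (ℕtoℚ (d ^ i)))
                                                                 (sym (ℚP.*-assoc (A i) (inv! m) (ℕtoℚ (d ^ i))))) ⟩
    ∑ (suc m) (λ i → a (suc m) i * ℕtoℚ (d ^ i))             ∎
  where
  open ≡-Reasoning
  A : ℕ → ℚ
  A i = coeff (fallingPoly m) i

c′≡∑aJ : ∀ k → 1 ≤ k → ∀ n → 1 ≤ n → ℕtoℚ (c′ k n) ≡ Σ< k (λ i → a k i * ℤtoℚ (J i n))
c′≡∑aJ (suc m) _ n n≥1 = begin
    ℕtoℚ (c′ (suc m) n)                                                     ≡⟨ c′-as-factorSum (suc m) n n≥1 ⟩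
    factorSum n (λ c d → μq c * compositionCount (suc m) d)                 ≡⟨ factorSum-cong n (λ c d cd≡n → cong (μq c *_)
                                                                                (compositionCount≡∑a m d (proj₂ (factors≥1 c d n≥1 cd≡n)))) ⟩
    factorSum n (λ c d → μq c * ∑ (suc m) (λ i → A i * ℕtoℚ (d ^ i)))       ≡⟨ factorSum-cong′ n (λ c d → trans
                                                                                (sym (∑-*ˡ (suc m) (μq c) (λ i → A i * ℕtoℚ (d ^ i))))
                                                                                (∑-cong′ (suc m) (λ i → *-leftComm (μq c) (A i) (ℕtoℚ (d ^ i))))) ⟩
    factorSum n (λ c d → ∑ (suc m) (λ i → A i * (μq c * ℕtoℚ (d ^ i))))     ≡⟨ sym (∑-factorSum (suc m) n (λ i c d → A i * (μq c * ℕtoℚ (d ^ i)))) ⟩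
    ∑ (suc m) (λ i → factorSum n (λ c d → A i * (μq c * ℕtoℚ (d ^ i))))     ≡⟨ ∑-cong′ (suc m) (λ i → factorSum-*ˡ n (A i) (λ c d → μq c * ℕtoℚ (d ^ i))) ⟩
    ∑ (suc m) (λ i → A i * factorSum n (λ c d → μq c * ℕtoℚ (d ^ i)))       ≡⟨ ∑-cong′ (suc m) (λ i → cong (A i *_) (sym (J-as-factorSum i n n≥1))) ⟩
    ∑ (suc m) (λ i → A i * ℤtoℚ (J i n))                                    ≡⟨ sym (Σ<≡∑ (suc m) (λ i → A i * ℤtoℚ (J i n))) ⟩
    Σ< (suc m) (λ i → A i * ℤtoℚ (J i n))                                   ∎
  where
  open ≡-Reasoning
  A = a (suc m)

lowerOrderConstant : ℕ → ℚ
lowerOrderConstant m = ∑ m (λ i → ∣ a (suc m) i ∣q)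

∣∑A*X∣≤ : ∀ m (A X : ℕ → ℚ) n → 1 ≤ n → (∀ i → ∣ X i ∣q ≤q ℕtoℚ (n ^ i)) →
          ∣ ∑ m (λ i → A i * X i) ∣q ≤q ∑ m (λ i → ∣ A i ∣q) * ℕtoℚ (n ^ (m ∸ 1))
∣∑A*X∣≤ m A X n n≥1 ∣X∣≤ = ℚP.≤-trans (∣∑∣≤∑∣∣ m (λ i → A i * X i))
  (ℚP.≤-trans (∑-mono-≤ m term≤) (ℚP.≤-reflexive (∑-*ʳ m (ℕtoℚ (n ^ (m ∸ 1))) (λ i → ∣ A i ∣q))))
  where
  term≤ : ∀ i → i < m → ∣ A i * X i ∣q ≤q ∣ A i ∣q * ℕtoℚ (n ^ (m ∸ 1))
  term≤ i i<m = subst (_≤q ∣ A i ∣q * ℕtoℚ (n ^ (m ∸ 1))) (sym (ℚP.∣p*q∣≡∣p∣*∣q∣ (A i) (X i)))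
    (*-monoˡ-≤-nonNeg ∣ A i ∣q (ℚP.0≤∣p∣ (A i)) (ℚP.≤-trans (∣X∣≤ i)
      (ℕtoℚ-mono-≤ (ℕP.^-monoʳ-≤ n {{ℕ.>-nonZero n≥1}} (ℕP.≤-pred (subst (suc i ≤_)
        (sym (ℕP.m+[n∸m]≡n {1} {m} (ℕP.<-≤-trans (s≤s z≤n) i<m))) i<m))))))

∑a*X-lead : ∀ m (X : ℕ → ℚ) → ∑ (suc m) (λ i → a (suc m) i * X i) -q inv! m * X m ≡ ∑ m (λ i → a (suc m) i * X i)
∑a*X-lead m X = begin
    ∑ (suc m) (λ i → a (suc m) i * X i) -q inv! m * X m                   ≡⟨ cong (_-q inv! m * X m) (∑-last m (λ i → a (suc m) i * X i)) ⟩
    (∑ m (λ i → a (suc m) i * X i) +q a (suc m) m * X m) -q inv! m * X m  ≡⟨ cong (λ z → (∑ m (λ i → a (suc m) i * X i) +q z * X m) -q inv! m * X m)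
                                                                             (a-lead m) ⟩
    (∑ m (λ i → a (suc m) i * X i) +q inv! m * X m) -q inv! m * X m       ≡⟨ solve 2 (λ s t → (s :+ t) :- t := s) refl
                                                                             (∑ m (λ i → a (suc m) i * X i)) (inv! m * X m) ⟩
    ∑ m (λ i → a (suc m) i * X i)                                        ∎
  where
  open ≡-Reasoning
  open ℚ-Solver

∑a*X-lowerOrder : ∀ m (X : ℕ → ℚ) n → 1 ≤ n → (∀ i → ∣ X i ∣q ≤q ℕtoℚ (n ^ i)) →
                  ∣ ∑ (suc m) (λ i → a (suc m) i * X i) -q inv! m * X m ∣q ≤q lowerOrderConstant m * ℕtoℚ (n ^ (m ∸ 1))
∑a*X-lowerOrder m X n n≥1 ∣X∣≤ = subst (λ z → ∣ z ∣q ≤q lowerOrderConstant m * ℕtoℚ (n ^ (m ∸ 1)))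
  (sym (∑a*X-lead m X)) (∣∑A*X∣≤ m (a (suc m)) X n n≥1 ∣X∣≤)

c′≈J : ∀ k → 2 ≤ k → (λ n → ℕtoℚ (c′ k n)) ≈ (λ n → inv! (k ∸ 1) * ℤtoℚ (J (k ∸ 1) n)) +O[n^ k ∸ 2 ]
c′≈J (suc zero) (s≤s ())
c′≈J (suc (suc m′)) _ = lowerOrderConstant m , λ n n≥1 →
  subst (λ z → ∣ z -q inv! m * ℤtoℚ (J m n) ∣q ≤q lowerOrderConstant m * ℕtoℚ (n ^ m′))
    (sym (trans (c′≡∑aJ (suc m) (s≤s z≤n) n n≥1) (Σ<≡∑ (suc m) (λ i → a (suc m) i * ℤtoℚ (J i n)))))
    (∑a*X-lowerOrder m (λ i → ℤtoℚ (J i n)) n n≥1 (λ i → ∣J∣≤n^t i n n≥1))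
  where m = suc m′

compositionCount≈n^ : ∀ m n → 1 ≤ n →
  ∣ compositionCount (suc m) n -q inv! m * ℕtoℚ (n ^ m) ∣q ≤q lowerOrderConstant m * ℕtoℚ (n ^ (m ∸ 1))
compositionCount≈n^ m n n≥1 = subst (λ z → ∣ z -q inv! m * ℕtoℚ (n ^ m) ∣q ≤q lowerOrderConstant m * ℕtoℚ (n ^ (m ∸ 1)))
  (sym (compositionCount≡∑a m n n≥1))
  (∑a*X-lowerOrder m (λ i → ℕtoℚ (n ^ i)) n n≥1 (λ i → ℚP.≤-reflexive (ℚP.0≤p⇒∣p∣≡p (ℕtoℚ-nonNeg (n ^ i)))))

-- Sorting tuples and counting arrangements

insert : ∀ {k} → ℕ → Vec ℕ k → Vec ℕ (suc k)
insert x []      = x ∷ []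
insert x (y ∷ v) = if y ℕ.≤ᵇ x then x ∷ y ∷ v else y ∷ insert x v

sortV : ∀ {k} → Vec ℕ k → Vec ℕ k
sortV []      = []
sortV (x ∷ v) = insert x (sortV v)

sorted : ∀ {k} → Vec ℕ k → Bool
sorted v = nonIncreasing (toList v)

headAtMost : ∀ {k} → ℕ → Vec ℕ k → Bool
headAtMost y []      = true
headAtMost y (z ∷ u) = z ℕ.≤ᵇ y

sorted-∷ : ∀ {k} y (u : Vec ℕ k) → sorted (y ∷ u) ≡ (headAtMost y u ∧ sorted u)
sorted-∷ y []      = refl
sorted-∷ y (z ∷ u) = refl

sorted-tail : ∀ {k} y (w : Vec ℕ k) → sorted (y ∷ w) ≡ true → sorted w ≡ true
sorted-tail y w s = ∧-true-r (headAtMost y w) (trans (sym (sorted-∷ y w)) s)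

sorted-head : ∀ {k} y (w : Vec ℕ k) → sorted (y ∷ w) ≡ true → headAtMost y w ≡ true
sorted-head y w s = ∧-true-l (headAtMost y w) (trans (sym (sorted-∷ y w)) s)

insert-≤ : ∀ {k} x y (v : Vec ℕ k) → y ≤ x → insert x (y ∷ v) ≡ x ∷ y ∷ v
insert-≤ x y v y≤x rewrite ≤ᵇ-true y≤x = refl

insert-≰ : ∀ {k} x y (v : Vec ℕ k) → ¬ y ≤ x → insert x (y ∷ v) ≡ y ∷ insert x v
insert-≰ x y v y≰x rewrite ≤ᵇ-false y≰x = refl

insert-headAtMost : ∀ {k} x (u : Vec ℕ k) → headAtMost x u ≡ true → insert x u ≡ x ∷ u
insert-headAtMost x []      _ = refl
insert-headAtMost x (z ∷ u) h = insert-≤ x z u (≤ᵇ-sound h)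

headAtMost-insert : ∀ {k} y x (v : Vec ℕ k) → headAtMost y v ≡ true → x ≤ y → headAtMost y (insert x v) ≡ true
headAtMost-insert y x []      _ x≤y = ≤ᵇ-true x≤y
headAtMost-insert y x (z ∷ v) h x≤y with z ℕ.≤? x
... | yes z≤x rewrite insert-≤ x z v z≤x = ≤ᵇ-true x≤y
... | no  z≰x rewrite insert-≰ x z v z≰x = h

insert-sorted : ∀ {k} x (v : Vec ℕ k) → sorted v ≡ true → sorted (insert x v) ≡ true
insert-sorted x []      _ = refl
insert-sorted x (y ∷ v) s with y ℕ.≤? x
... | yes y≤x rewrite insert-≤ x y v y≤x = trans (sorted-∷ x (y ∷ v)) (cong₂ _∧_ (≤ᵇ-true y≤x) s)
... | no  y≰x rewrite insert-≰ x y v y≰x = trans (sorted-∷ y (insert x v))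
  (cong₂ _∧_ (headAtMost-insert y x v (sorted-head y v s) (ℕP.<⇒≤ (ℕP.≰⇒> y≰x))) (insert-sorted x v (sorted-tail y v s)))

sortV-sorted : ∀ {k} (v : Vec ℕ k) → sorted (sortV v) ≡ true
sortV-sorted []      = refl
sortV-sorted (x ∷ v) = insert-sorted x (sortV v) (sortV-sorted v)

Below-insert : ∀ {k} R x (v : Vec ℕ k) → x < R → Below R v → Below R (insert x v)
Below-insert R x []      x<R _           = x<R , tt
Below-insert R x (y ∷ v) x<R (y<R , v<R) with y ℕ.≤? x
... | yes y≤x rewrite insert-≤ x y v y≤x = x<R , y<R , v<R
... | no  y≰x rewrite insert-≰ x y v y≰x = y<R , Below-insert R x v x<R v<R

Below-sortV : ∀ {k} R (v : Vec ℕ k) → Below R v → Below R (sortV v)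
Below-sortV R []      _           = tt
Below-sortV R (x ∷ v) (x<R , v<R) = Below-insert R x (sortV v) x<R (Below-sortV R v v<R)

module _ {A : Set} (_⊕_ : ℕ → A → A) (e : A) (⊕-leftComm : ∀ x y b → x ⊕ (y ⊕ b) ≡ y ⊕ (x ⊕ b)) where

  foldr-insert : ∀ {k} x (v : Vec ℕ k) → foldr _⊕_ e (toList (insert x v)) ≡ x ⊕ foldr _⊕_ e (toList v)
  foldr-insert x []      = refl
  foldr-insert x (y ∷ v) with y ℕ.≤? x
  ... | yes y≤x rewrite insert-≤ x y v y≤x = refl
  ... | no  y≰x rewrite insert-≰ x y v y≰x = trans (cong (y ⊕_) (foldr-insert x v)) (⊕-leftComm y x _)

  foldr-sortV : ∀ {k} (v : Vec ℕ k) → foldr _⊕_ e (toList (sortV v)) ≡ foldr _⊕_ e (toList v)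
  foldr-sortV []      = refl
  foldr-sortV (x ∷ v) = trans (foldr-insert x (sortV v)) (cong (x ⊕_) (foldr-sortV v))

sumV-toList : ∀ {k} (v : Vec ℕ k) → sumV v ≡ foldr _+_ 0 (toList v)
sumV-toList []      = refl
sumV-toList (x ∷ v) = cong (λ z → x + z) (sumV-toList v)

isComposition-sortV : ∀ {k} n (v : Vec ℕ k) → isComposition n (sortV v) ≡ isComposition n v
isComposition-sortV n v = cong₂ _∧_ (foldr-sortV (λ x b → (1 ℕ.≤ᵇ x) ∧ b) true ∧-leftComm v)
  (cong (ℕ._≡ᵇ n) (trans (sumV-toList (sortV v)) (trans (foldr-sortV _+_ 0 +-leftComm v) (sym (sumV-toList v)))))
  where
  ∧-leftComm : ∀ x y b → ((1 ℕ.≤ᵇ x) ∧ ((1 ℕ.≤ᵇ y) ∧ b)) ≡ ((1 ℕ.≤ᵇ y) ∧ ((1 ℕ.≤ᵇ x) ∧ b))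
  ∧-leftComm x y b = trans (sym (BoolP.∧-assoc (1 ℕ.≤ᵇ x) _ b))
    (trans (cong (_∧ b) (BoolP.∧-comm (1 ℕ.≤ᵇ x) _)) (BoolP.∧-assoc (1 ℕ.≤ᵇ y) _ b))
  +-leftComm : ∀ x y b → x + (y + b) ≡ y + (x + b)
  +-leftComm x y b = trans (sym (ℕP.+-assoc x y b)) (trans (cong (_+ b) (ℕP.+-comm x y)) (ℕP.+-assoc y x b))

isCoprime-sortV : ∀ {k} (v : Vec ℕ k) → isCoprime (sortV v) ≡ isCoprime v
isCoprime-sortV v = cong (ℕ._≡ᵇ 1) (foldr-sortV gcd 0 gcd-leftComm v)
  where
  gcd-leftComm : ∀ x y b → gcd x (gcd y b) ≡ gcd y (gcd x b)
  gcd-leftComm x y b = trans (sym (GCD.gcd-assoc x y b)) (trans (cong (λ z → gcd z b) (GCD.gcd-comm x y)) (GCD.gcd-assoc y x b))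

elem : ∀ {k} → ℕ → Vec ℕ k → Bool
elem x []      = false
elem x (y ∷ v) = (x ≡ᵇ y) ∨ elem x v

remove : ∀ {k} → ℕ → Vec ℕ (suc k) → Vec ℕ k
remove {zero}  x (y ∷ w) = w
remove {suc k} x (y ∷ w) = if x ≡ᵇ y then w else y ∷ remove x w

distinct : ∀ {k} → Vec ℕ k → Bool
distinct []      = true
distinct (x ∷ v) = not (elem x v) ∧ distinct v

elem-insert : ∀ {k} x (u : Vec ℕ k) → elem x (insert x u) ≡ true
elem-insert x []      = ∨-true-l false (≡ᵇ-true {x} refl)
elem-insert x (y ∷ u) with y ℕ.≤? x
... | yes y≤x rewrite insert-≤ x y u y≤x = ∨-true-l _ (≡ᵇ-true {x} refl)
... | no  y≰x rewrite insert-≰ x y u y≰x = ∨-true-r (x ≡ᵇ y) (elem-insert x u)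

remove-insert : ∀ {k} x (u : Vec ℕ k) → remove x (insert x u) ≡ u
remove-insert x []      = refl
remove-insert {suc k} x (y ∷ u) with y ℕ.≤? x
... | yes y≤x rewrite insert-≤ x y u y≤x | ≡ᵇ-true {x} {x} refl = refl
... | no  y≰x rewrite insert-≰ x y u y≰x | ≡ᵇ-false {x} {y} (λ x≡y → y≰x (ℕP.≤-reflexive (sym x≡y))) =
  cong (y ∷_) (remove-insert x u)

elem-sorted-≤ : ∀ {k} x y (w : Vec ℕ k) → sorted (y ∷ w) ≡ true → elem x w ≡ true → x ≤ y
elem-sorted-≤ x y (z ∷ w) s x∈ with x ℕ.≟ z
... | yes refl = ≤ᵇ-sound (∧-true-l (z ℕ.≤ᵇ y) s)
... | no  x≢z rewrite ≡ᵇ-false x≢z =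
  ℕP.≤-trans (elem-sorted-≤ x z w (∧-true-r (z ℕ.≤ᵇ y) s) x∈) (≤ᵇ-sound (∧-true-l (z ℕ.≤ᵇ y) s))

insert-remove : ∀ {k} x (w : Vec ℕ (suc k)) → sorted w ≡ true → elem x w ≡ true → insert x (remove x w) ≡ w
insert-remove {zero} x (y ∷ []) s x∈ with x ℕ.≟ y
... | yes refl = refl
... | no  x≢y rewrite ≡ᵇ-false x≢y with x∈
... | ()
insert-remove {suc k} x (y ∷ w) s x∈ with x ℕ.≟ y
... | yes refl rewrite ≡ᵇ-true {x} {x} refl = insert-headAtMost x w (sorted-head x w s)
... | no  x≢y rewrite ≡ᵇ-false x≢y =
  trans (insert-≰ x y (remove x w) y≰x) (cong (y ∷_) (insert-remove x w (sorted-tail y w s) x∈))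
  where
  y≰x : ¬ y ≤ x
  y≰x y≤x = x≢y (ℕP.≤-antisym (elem-sorted-≤ x y w s x∈) y≤x)

eqV-insert : ∀ {k} x (u : Vec ℕ k) (w : Vec ℕ (suc k)) → sorted w ≡ true →
             eqV (insert x u) w ≡ (elem x w ∧ eqV u (remove x w))
eqV-insert x u w s = bool-ext _ _ ⇒ ⇐
  where
  ⇒ : eqV (insert x u) w ≡ true → (elem x w ∧ eqV u (remove x w)) ≡ true
  ⇒ e with eqV-sound (insert x u) w e
  ... | refl = cong₂ _∧_ (elem-insert x u) (trans (cong (eqV u) (remove-insert x u)) (eqV-refl u))
  ⇐ : (elem x w ∧ eqV u (remove x w)) ≡ true → eqV (insert x u) w ≡ true
  ⇐ e = subst (λ z → eqV (insert x z) w ≡ true) (sym (eqV-sound u (remove x w) (∧-true-r (elem x w) e)))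
          (trans (cong (λ z → eqV z w) (insert-remove x w s (∧-true-l (elem x w) e))) (eqV-refl w))

elem-remove : ∀ {k} z x (w : Vec ℕ (suc k)) → elem z (remove x w) ≡ true → elem z w ≡ true
elem-remove {zero}  z x (y ∷ []) ()
elem-remove {suc k} z x (y ∷ w) z∈ with x ≡ᵇ y
... | true  = ∨-true-r (z ≡ᵇ y) z∈
... | false with z ≡ᵇ y
...   | true  = refl
...   | false = elem-remove z x w z∈

remove-sorted : ∀ {k} x (w : Vec ℕ (suc k)) → sorted w ≡ true → sorted (remove x w) ≡ true
remove-sorted {zero}  x (y ∷ []) s = refl
remove-sorted {suc k} x (y ∷ w) s with x ≡ᵇ y
... | true  = sorted-tail y w s
... | false = trans (sorted-∷ y (remove x w))
  (cong₂ _∧_ (headAtMost-elem (remove x w) (λ z z∈ → elem-sorted-≤ z y w s (elem-remove z x w z∈)))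
             (remove-sorted x w (sorted-tail y w s)))
  where
  headAtMost-elem : ∀ {j} (u : Vec ℕ j) → (∀ z → elem z u ≡ true → z ≤ y) → headAtMost y u ≡ true
  headAtMost-elem []      _ = refl
  headAtMost-elem (z ∷ u) h = ≤ᵇ-true (h z (∨-true-l (elem z u) (≡ᵇ-true {z} refl)))

remove-distinct : ∀ {k} x (w : Vec ℕ (suc k)) → distinct w ≡ true → distinct (remove x w) ≡ true
remove-distinct {zero}  x (y ∷ []) d = refl
remove-distinct {suc k} x (y ∷ w) d with x ≡ᵇ y
... | true  = ∧-true-r (not (elem y w)) d
... | false = cong₂ _∧_ y∉ (remove-distinct x w (∧-true-r (not (elem y w)) d))
  where
  y∉ : not (elem y (remove x w)) ≡ true
  y∉ with elem y (remove x w) in e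
  ... | false = refl
  ... | true  with trans (sym (elem-remove y x w e)) (not-true (∧-true-l (not (elem y w)) d))
  ...   | ()

Below-remove : ∀ {k} R x (w : Vec ℕ (suc k)) → Below R w → Below R (remove x w)
Below-remove {zero}  R x (y ∷ []) _           = tt
Below-remove {suc k} R x (y ∷ w) (y<R , w<R) with x ≡ᵇ y
... | true  = w<R
... | false = y<R , Below-remove R x w w<R

arrangements : ∀ k → ℕ → Vec ℕ k → ℚ
arrangements k R w = ∑ⱽ k R (λ v → ⟦ eqV (sortV v) w ⟧)

arrangements-suc : ∀ k R (w : Vec ℕ (suc k)) → sorted w ≡ true →
                   arrangements (suc k) R w ≡ ∑ R (λ x → ⟦ elem x w ⟧ * arrangements k R (remove x w))
arrangements-suc k R w s = trans (∑ⱽ-suc k R _) (∑-cong′ R (λ x → trans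
  (∑ⱽ-cong′ k R (λ v → trans (cong ⟦_⟧ (eqV-insert x (sortV v) w s)) (⟦∧⟧ (elem x w) _)))
  (∑ⱽ-*ˡ k R ⟦ elem x w ⟧ _)))

∑-elem≤length : ∀ {k} R (w : Vec ℕ k) → ∑ R (λ x → ⟦ elem x w ⟧) ≤q ℕtoℚ k
∑-elem≤length R []      = ℚP.≤-reflexive (∑-0 R)
∑-elem≤length {suc k} R (y ∷ w) = begin
    ∑ R (λ x → ⟦ (x ≡ᵇ y) ∨ elem x w ⟧)                  ≤⟨ ∑-mono-≤ R (λ x _ → ⟦∨⟧≤ (x ≡ᵇ y) (elem x w)) ⟩
    ∑ R (λ x → ⟦ x ≡ᵇ y ⟧ +q ⟦ elem x w ⟧)               ≡⟨ ∑-+ R _ _ ⟩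
    ∑ R (λ x → ⟦ x ≡ᵇ y ⟧) +q ∑ R (λ x → ⟦ elem x w ⟧)  ≤⟨ ℚP.+-mono-≤ (∑-indicator≤1 R y) (∑-elem≤length R w) ⟩
    1ℚ +q ℕtoℚ k                                        ≡⟨ sym (ℕtoℚ-suc k) ⟩
    ℕtoℚ (suc k)                                        ∎
  where open ℚP.≤-Reasoning

∑-elem-distinct : ∀ {k} R (w : Vec ℕ k) → Below R w → distinct w ≡ true → ∑ R (λ x → ⟦ elem x w ⟧) ≡ ℕtoℚ k
∑-elem-distinct R []      _ _ = ∑-0 R
∑-elem-distinct {suc k} R (y ∷ w) (y<R , w<R) d = begin
    ∑ R (λ x → ⟦ (x ≡ᵇ y) ∨ elem x w ⟧)                  ≡⟨ ∑-cong′ R ⟦∨⟧-disjoint ⟩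
    ∑ R (λ x → ⟦ x ≡ᵇ y ⟧ +q ⟦ elem x w ⟧)               ≡⟨ ∑-+ R _ _ ⟩
    ∑ R (λ x → ⟦ x ≡ᵇ y ⟧) +q ∑ R (λ x → ⟦ elem x w ⟧)  ≡⟨ cong₂ _+q_ (trans (∑-cong′ R (λ x → sym (ℚP.*-identityʳ ⟦ x ≡ᵇ y ⟧)))
                                                              (∑-indicator R y (λ _ → 1ℚ) y<R))
                                                              (∑-elem-distinct R w w<R (∧-true-r (not (elem y w)) d)) ⟩
    1ℚ +q ℕtoℚ k                                        ≡⟨ sym (ℕtoℚ-suc k) ⟩
    ℕtoℚ (suc k)                                        ∎
  where
  open ≡-Reasoning
  y∉w : elem y w ≡ false
  y∉w = not-true (∧-true-l (not (elem y w)) d)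
  ⟦∨⟧-disjoint : ∀ x → ⟦ (x ≡ᵇ y) ∨ elem x w ⟧ ≡ ⟦ x ≡ᵇ y ⟧ +q ⟦ elem x w ⟧
  ⟦∨⟧-disjoint x with x ℕ.≟ y
  ... | yes refl rewrite ≡ᵇ-true {x} refl | y∉w = refl
  ... | no  x≢y  rewrite ≡ᵇ-false x≢y = sym (ℚP.+-identityˡ _)

arrangements-nonNeg : ∀ k R w → 0ℚ ≤q arrangements k R w
arrangements-nonNeg k R w = ∑ⱽ-nonNeg k R (λ v → ⟦⟧-nonNeg (eqV (sortV v) w))

arrangements≤k! : ∀ k R (w : Vec ℕ k) → sorted w ≡ true → arrangements k R w ≤q ℕtoℚ (k !)
arrangements≤k! zero    R [] _ = ℚP.≤-refl
arrangements≤k! (suc k) R w  s = begin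
    arrangements (suc k) R w                                    ≡⟨ arrangements-suc k R w s ⟩
    ∑ R (λ x → ⟦ elem x w ⟧ * arrangements k R (remove x w))    ≤⟨ ∑-mono-≤ R (λ x _ → *-monoˡ-≤-nonNeg ⟦ elem x w ⟧ (⟦⟧-nonNeg (elem x w))
                                                                     (arrangements≤k! k R (remove x w) (remove-sorted x w s))) ⟩
    ∑ R (λ x → ⟦ elem x w ⟧ * ℕtoℚ (k !))                       ≡⟨ ∑-*ʳ R (ℕtoℚ (k !)) _ ⟩
    ∑ R (λ x → ⟦ elem x w ⟧) * ℕtoℚ (k !)                       ≤⟨ *-monoʳ-≤-nonNeg (ℕtoℚ (k !)) (ℕtoℚ-nonNeg (k !)) (∑-elem≤length R w) ⟩
    ℕtoℚ (suc k) * ℕtoℚ (k !)                                   ≡⟨ sym (ℕtoℚ-* (suc k) (k !)) ⟩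
    ℕtoℚ (suc k !)                                              ∎
  where open ℚP.≤-Reasoning

arrangements-distinct : ∀ k R (w : Vec ℕ k) → sorted w ≡ true → distinct w ≡ true → Below R w → arrangements k R w ≡ ℕtoℚ (k !)
arrangements-distinct zero    R [] _ _ _   = refl
arrangements-distinct (suc k) R w  s d w<R = begin
    arrangements (suc k) R w                                    ≡⟨ arrangements-suc k R w s ⟩
    ∑ R (λ x → ⟦ elem x w ⟧ * arrangements k R (remove x w))    ≡⟨ ∑-cong′ R (λ x → ⟦⟧*-cong (elem x w) (λ _ →
                                                                     arrangements-distinct k R (remove x w) (remove-sorted x w s)
                                                                       (remove-distinct x w d) (Below-remove R x w w<R))) ⟩
    ∑ R (λ x → ⟦ elem x w ⟧ * ℕtoℚ (k !))                       ≡⟨ ∑-*ʳ R (ℕtoℚ (k !)) _ ⟩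
    ∑ R (λ x → ⟦ elem x w ⟧) * ℕtoℚ (k !)                       ≡⟨ cong (_* ℕtoℚ (k !)) (∑-elem-distinct R w w<R d) ⟩
    ℕtoℚ (suc k) * ℕtoℚ (k !)                                   ≡⟨ sym (ℕtoℚ-* (suc k) (k !)) ⟩
    ℕtoℚ (suc k !)                                              ∎
  where open ≡-Reasoning

∑ⱽ-via-sorted : ∀ k R (Φ : Vec ℕ k → ℚ) → (∀ v → Φ (sortV v) ≡ Φ v) →
                ∑ⱽ k R Φ ≡ ∑ⱽ k R (λ w → ⟦ sorted w ⟧ * (Φ w * arrangements k R w))
∑ⱽ-via-sorted k R Φ Φ-sym = begin
    ∑ⱽ k R Φ                                                       ≡⟨ ∑ⱽ-cong k R (λ v v<R → sym (trans (cong (Φ v *_)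
                                                                        (∑ⱽ-indicator k R (sortV v) (λ _ → 1ℚ) (Below-sortV R v v<R)))
                                                                        (ℚP.*-identityʳ (Φ v)))) ⟩
    ∑ⱽ k R (λ v → Φ v * ∑ⱽ k R (λ w → ⟦ eqV w (sortV v) ⟧ * 1ℚ))   ≡⟨ ∑ⱽ-cong′ k R (λ v → sym (∑ⱽ-*ˡ k R (Φ v) _)) ⟩
    ∑ⱽ k R (λ v → ∑ⱽ k R (λ w → Φ v * (⟦ eqV w (sortV v) ⟧ * 1ℚ))) ≡⟨ ∑ⱽ-swap k R k R _ ⟩
    ∑ⱽ k R (λ w → ∑ⱽ k R (λ v → Φ v * (⟦ eqV w (sortV v) ⟧ * 1ℚ))) ≡⟨ ∑ⱽ-cong′ k R (λ w → ∑ⱽ-cong′ k R (λ v → at-sorted w v)) ⟩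
    ∑ⱽ k R (λ w → ∑ⱽ k R (λ v → ⟦ sorted w ⟧ * (Φ w * ⟦ eqV (sortV v) w ⟧)))
                                                                   ≡⟨ ∑ⱽ-cong′ k R (λ w → trans (∑ⱽ-*ˡ k R ⟦ sorted w ⟧ _)
                                                                        (cong (⟦ sorted w ⟧ *_) (∑ⱽ-*ˡ k R (Φ w) _))) ⟩
    ∑ⱽ k R (λ w → ⟦ sorted w ⟧ * (Φ w * arrangements k R w))       ∎
  where
  open ≡-Reasoning
  at-sorted : ∀ w v → Φ v * (⟦ eqV w (sortV v) ⟧ * 1ℚ) ≡ ⟦ sorted w ⟧ * (Φ w * ⟦ eqV (sortV v) w ⟧)
  at-sorted w v with eqV w (sortV v) in e
  ... | true with eqV-sound w (sortV v) e
  ...   | refl rewrite sortV-sorted v | eqV-refl (sortV v) =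
    trans (cong (Φ v *_) (ℚP.*-identityˡ 1ℚ)) (trans (ℚP.*-identityʳ (Φ v))
      (sym (trans (ℚP.*-identityˡ _) (trans (ℚP.*-identityʳ _) (Φ-sym v)))))
  at-sorted w v | false with eqV (sortV v) w in e′
  ...   | true with trans (sym e) (subst (λ z → eqV z (sortV v) ≡ true) (eqV-sound (sortV v) w e′) (eqV-refl (sortV v)))
  ...     | ()
  at-sorted w v | false | false = trans (cong (Φ v *_) (ℚP.*-zeroˡ 1ℚ)) (trans (ℚP.*-zeroʳ (Φ v))
    (sym (trans (cong (⟦ sorted w ⟧ *_) (ℚP.*-zeroʳ (Φ w))) (ℚP.*-zeroʳ ⟦ sorted w ⟧))))

repeatedCompositions : ∀ k → ℕ → ℚ
repeatedCompositions k n = ∑ⱽ k (suc n) (λ w → ⟦ isComposition n w ⟧ * ⟦ not (distinct w) ⟧)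

-- A sorted tuple with distinct entries has exactly k! arrangements, any other sorted tuple at most k!.
sortingDefect≤ : ∀ k n (Φ : Vec ℕ k → ℚ) → (∀ v → 0ℚ ≤q Φ v) → (∀ v → Φ v ≤q ⟦ isComposition n v ⟧) →
                 ∀ w → Below (suc n) w →
                 ∣ ⟦ sorted w ⟧ * (Φ w * (ℕtoℚ (k !) -q arrangements k (suc n) w)) ∣q
                   ≤q ℕtoℚ (k !) * (⟦ isComposition n w ⟧ * ⟦ not (distinct w) ⟧)
sortingDefect≤ k n Φ Φ≥0 Φ≤ w w<R with sorted w in s
... | false = subst (_≤q K * _) (sym (cong ∣_∣q (ℚP.*-zeroˡ (Φ w * (K -q N)))))
                (*-nonNeg K≥0 (*-nonNeg (⟦⟧-nonNeg (isComposition n w)) (⟦⟧-nonNeg (not (distinct w)))))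
  where
  K = ℕtoℚ (k !)
  K≥0 = ℕtoℚ-nonNeg (k !)
  N = arrangements k (suc n) w
... | true with distinct w in d
...   | true = subst (_≤q K * (⟦ isComposition n w ⟧ * 0ℚ)) (sym (cong ∣_∣q (begin
    1ℚ * (Φ w * (K -q N))   ≡⟨ ℚP.*-identityˡ _ ⟩
    Φ w * (K -q N)          ≡⟨ cong (λ z → Φ w * (K -q z)) (arrangements-distinct k (suc n) w s d w<R) ⟩
    Φ w * (K -q K)          ≡⟨ cong (Φ w *_) (ℚP.+-inverseʳ K) ⟩
    Φ w * 0ℚ                ≡⟨ ℚP.*-zeroʳ (Φ w) ⟩
    0ℚ                      ∎)))
    (*-nonNeg (ℕtoℚ-nonNeg (k !)) (*-nonNeg (⟦⟧-nonNeg (isComposition n w)) ℚP.≤-refl))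
  where
  open ≡-Reasoning
  K = ℕtoℚ (k !)
  N = arrangements k (suc n) w
...   | false = begin
    ∣ 1ℚ * (Φ w * (K -q N)) ∣q             ≡⟨ cong ∣_∣q (ℚP.*-identityˡ _) ⟩
    ∣ Φ w * (K -q N) ∣q                    ≡⟨ ℚP.∣p*q∣≡∣p∣*∣q∣ (Φ w) _ ⟩
    ∣ Φ w ∣q * ∣ K -q N ∣q                 ≡⟨ cong₂ _*_ (ℚP.0≤p⇒∣p∣≡p (Φ≥0 w)) (ℚP.0≤p⇒∣p∣≡p K-N≥0) ⟩
    Φ w * (K -q N)                         ≤⟨ *-monoʳ-≤-nonNeg (K -q N) K-N≥0 (Φ≤ w) ⟩
    ⟦ isComposition n w ⟧ * (K -q N)       ≤⟨ *-monoˡ-≤-nonNeg ⟦ isComposition n w ⟧ (⟦⟧-nonNeg (isComposition n w))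
                                                (0≤p⇒q-p≤q K (arrangements-nonNeg k (suc n) w)) ⟩
    ⟦ isComposition n w ⟧ * K              ≡⟨ ℚP.*-comm _ K ⟩
    K * ⟦ isComposition n w ⟧              ≡⟨ cong (K *_) (sym (ℚP.*-identityʳ _)) ⟩
    K * (⟦ isComposition n w ⟧ * 1ℚ)       ∎
  where
  open ℚP.≤-Reasoning
  K = ℕtoℚ (k !)
  N = arrangements k (suc n) w
  K-N≥0 : 0ℚ ≤q K -q N
  K-N≥0 = p≤q⇒0≤q-p (arrangements≤k! k (suc n) w s)

k!*∑sorted≈∑ : ∀ k n (Φ : Vec ℕ k → ℚ) → (∀ v → Φ (sortV v) ≡ Φ v) → (∀ v → 0ℚ ≤q Φ v) → (∀ v → Φ v ≤q ⟦ isComposition n v ⟧) →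
  ∣ ℕtoℚ (k !) * ∑ⱽ k (suc n) (λ w → ⟦ sorted w ⟧ * Φ w) -q ∑ⱽ k (suc n) Φ ∣q ≤q ℕtoℚ (k !) * repeatedCompositions k n
k!*∑sorted≈∑ k n Φ Φ-sym Φ≥0 Φ≤ = subst (λ z → ∣ z ∣q ≤q K * repeatedCompositions k n) (sym difference)
  (ℚP.≤-trans (∣∑ⱽ∣≤∑ⱽ∣∣ k R D) (subst (∑ⱽ k R (λ w → ∣ D w ∣q) ≤q_) (∑ⱽ-*ˡ k R K _)
    (∑ⱽ-mono-≤ k R (sortingDefect≤ k n Φ Φ≥0 Φ≤))))
  where
  R = suc n
  K = ℕtoℚ (k !)
  D : Vec ℕ k → ℚ
  D w = ⟦ sorted w ⟧ * (Φ w * (K -q arrangements k R w))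
  difference : K * ∑ⱽ k R (λ w → ⟦ sorted w ⟧ * Φ w) -q ∑ⱽ k R Φ ≡ ∑ⱽ k R D
  difference = begin
      K * ∑ⱽ k R (λ w → ⟦ sorted w ⟧ * Φ w) -q ∑ⱽ k R Φ
          ≡⟨ cong₂ _-q_ (sym (∑ⱽ-*ˡ k R K _)) (∑ⱽ-via-sorted k R Φ Φ-sym) ⟩
      ∑ⱽ k R (λ w → K * (⟦ sorted w ⟧ * Φ w)) -q ∑ⱽ k R (λ w → ⟦ sorted w ⟧ * (Φ w * arrangements k R w))
          ≡⟨ cong (∑ⱽ k R (λ w → K * (⟦ sorted w ⟧ * Φ w)) +q_) (sym (∑ⱽ-neg k R _)) ⟩
      ∑ⱽ k R (λ w → K * (⟦ sorted w ⟧ * Φ w)) +q ∑ⱽ k R (λ w → -q (⟦ sorted w ⟧ * (Φ w * arrangements k R w)))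
          ≡⟨ sym (∑ⱽ-+ k R _ _) ⟩
      ∑ⱽ k R (λ w → K * (⟦ sorted w ⟧ * Φ w) +q -q (⟦ sorted w ⟧ * (Φ w * arrangements k R w)))
          ≡⟨ ∑ⱽ-cong′ k R (λ w → factor K ⟦ sorted w ⟧ (Φ w) (arrangements k R w)) ⟩
      ∑ⱽ k R D ∎
    where
    open ≡-Reasoning
    factor : ∀ K a f N → K * (a * f) +q -q (a * (f * N)) ≡ a * (f * (K -q N))
    factor = solve 4 (λ K a f N → K :* (a :* f) :+ (:- (a :* (f :* N))) := a :* (f :* (K :- N))) refl
      where open ℚ-Solver

-- Few compositions have a repeated part

k*X+k*[k*X]≤[1+k]²*X : ∀ k X → k *ₙ X + k *ₙ (k *ₙ X) ≤ suc k *ₙ suc k *ₙ X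
k*X+k*[k*X]≤[1+k]²*X k X = ℕP.≤-trans (ℕP.m≤m+n _ (suc k *ₙ X)) (ℕP.≤-reflexive
  (solve 2 (λ k X → k :* X :+ k :* (k :* X) :+ (con 1 :+ k) :* X := (con 1 :+ k) :* (con 1 :+ k) :* X) refl k X))
  where open ℕ-Solver

⟦not-distinct-∷⟧≤ : ∀ a b → ⟦ not (not a ∧ b) ⟧ ≤q ⟦ a ⟧ +q ⟦ not b ⟧
⟦not-distinct-∷⟧≤ true  b = subst (_≤q 1ℚ +q ⟦ not b ⟧) (ℚP.+-identityʳ 1ℚ) (ℚP.+-monoʳ-≤ 1ℚ (⟦⟧-nonNeg (not b)))
⟦not-distinct-∷⟧≤ false b = ℚP.≤-reflexive (sym (ℚP.+-identityˡ _))

⟦+≡⟧≤⟦≡∸⟧ : ∀ x s m → ⟦ x + s ≡ᵇ m ⟧ ≤q ⟦ s ≡ᵇ m ∸ x ⟧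
⟦+≡⟧≤⟦≡∸⟧ x s m = ⟦⟧-mono (x + s ≡ᵇ m) (s ≡ᵇ m ∸ x) (λ e → ≡ᵇ-true (trans (sym (ℕP.m+n∸m≡n x s)) (cong (_∸ x) (≡ᵇ-sound e))))

module RepeatedEntries (R : ℕ) where

  ∑-shifted≤1 : ∀ s m → ∑ R (λ y → ⟦ y + s ≡ᵇ m ⟧) ≤q 1ℚ
  ∑-shifted≤1 s m = ℚP.≤-trans (∑-mono-≤ R (λ y _ → ⟦⟧-mono (y + s ≡ᵇ m) (y ≡ᵇ m ∸ s)
    (λ e → ≡ᵇ-true (trans (sym (ℕP.m+n∸n≡m y s)) (cong (_∸ s) (≡ᵇ-sound e)))))) (∑-indicator≤1 R (m ∸ s))

  ∑-first-sum≤ : ∀ k m (F : Vec ℕ k → ℚ) → (∀ v → 0ℚ ≤q F v) →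
                 ∑ R (λ y → ∑ⱽ k R (λ v → ⟦ y + sumV v ≡ᵇ m ⟧ * F v)) ≤q ∑ⱽ k R F
  ∑-first-sum≤ k m F F≥0 = begin
      ∑ R (λ y → ∑ⱽ k R (λ v → ⟦ y + sumV v ≡ᵇ m ⟧ * F v)) ≡⟨ sym (∑ⱽ-∑ k R R (λ y v → ⟦ y + sumV v ≡ᵇ m ⟧ * F v)) ⟩
      ∑ⱽ k R (λ v → ∑ R (λ y → ⟦ y + sumV v ≡ᵇ m ⟧ * F v)) ≡⟨ ∑ⱽ-cong′ k R (λ v → ∑-*ʳ R (F v) (λ y → ⟦ y + sumV v ≡ᵇ m ⟧)) ⟩
      ∑ⱽ k R (λ v → ∑ R (λ y → ⟦ y + sumV v ≡ᵇ m ⟧) * F v) ≤⟨ ∑ⱽ-mono-≤′ k R (λ v → subst (∑ R (λ y → ⟦ y + sumV v ≡ᵇ m ⟧) * F v ≤q_) (ℚP.*-identityˡ (F v))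
                                                                 (*-monoʳ-≤-nonNeg (F v) (F≥0 v) (∑-shifted≤1 (sumV v) m))) ⟩
      ∑ⱽ k R F                                            ∎
    where open ℚP.≤-Reasoning

  #sum≡ : ∀ k m → ∑ⱽ k R (λ v → ⟦ sumV v ≡ᵇ m ⟧) ≤q ℕtoℚ (R ^ (k ∸ 1))
  #sum≡ zero    m = subst (_≤q 1ℚ) (sym (ℚP.+-identityʳ ⟦ 0 ≡ᵇ m ⟧)) (⟦⟧≤1 (0 ≡ᵇ m))
  #sum≡ (suc k) m = begin
      ∑ⱽ (suc k) R (λ v → ⟦ sumV v ≡ᵇ m ⟧)                 ≡⟨ ∑ⱽ-suc k R _ ⟩
      ∑ R (λ y → ∑ⱽ k R (λ v → ⟦ y + sumV v ≡ᵇ m ⟧))       ≡⟨ ∑-cong′ R (λ y → ∑ⱽ-cong′ k R (λ v → sym (ℚP.*-identityʳ _))) ⟩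
      ∑ R (λ y → ∑ⱽ k R (λ v → ⟦ y + sumV v ≡ᵇ m ⟧ * 1ℚ)) ≤⟨ ∑-first-sum≤ k m (λ _ → 1ℚ) (λ _ → ⟦⟧-nonNeg true) ⟩
      ∑ⱽ k R (λ _ → 1ℚ)                                    ≡⟨ ∑ⱽ-1 k R ⟩
      ℕtoℚ (R ^ k)                                         ∎
    where open ℚP.≤-Reasoning

  R*[k*R^[k-1]] : ∀ k → R *ₙ (k *ₙ R ^ (k ∸ 1)) ≡ k *ₙ R ^ k
  R*[k*R^[k-1]] zero    = ℕP.*-zeroʳ R
  R*[k*R^[k-1]] (suc k) = trans (sym (ℕP.*-assoc R (suc k) (R ^ k)))
    (trans (cong (ℕ._* R ^ k) (ℕP.*-comm R (suc k))) (ℕP.*-assoc (suc k) R (R ^ k)))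

  ∑-first≡≤R^k : ∀ k x → ∑ R (λ y → ∑ⱽ k R (λ v → ⟦ x ≡ᵇ y ⟧)) ≤q ℕtoℚ (R ^ k)
  ∑-first≡≤R^k k x = begin
      ∑ R (λ y → ∑ⱽ k R (λ v → ⟦ x ≡ᵇ y ⟧))   ≡⟨ ∑-cong′ R (λ y → trans (∑ⱽ-cong′ k R (λ _ → sym (ℚP.*-identityʳ ⟦ x ≡ᵇ y ⟧)))
                                                  (trans (∑ⱽ-*ˡ k R ⟦ x ≡ᵇ y ⟧ (λ _ → 1ℚ)) (cong₂ (λ b z → ⟦ b ⟧ * z) (≡ᵇ-sym x y) (∑ⱽ-1 k R)))) ⟩
      ∑ R (λ y → ⟦ y ≡ᵇ x ⟧ * ℕtoℚ (R ^ k))   ≤⟨ ∑-indicator-≤ R x (λ _ → ℕtoℚ (R ^ k)) (λ _ → ℕtoℚ-nonNeg (R ^ k)) ⟩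
      ℕtoℚ (R ^ k)                          ∎
    where open ℚP.≤-Reasoning

  #elem : ∀ k x → ∑ⱽ k R (λ v → ⟦ elem x v ⟧) ≤q ℕtoℚ (k *ₙ R ^ (k ∸ 1))
  #elem zero    x = ℚP.≤-refl
  #elem (suc k) x = begin
      ∑ⱽ (suc k) R (λ v → ⟦ elem x v ⟧)                                       ≡⟨ ∑ⱽ-suc k R _ ⟩
      ∑ R (λ y → ∑ⱽ k R (λ v → ⟦ (x ≡ᵇ y) ∨ elem x v ⟧))                     ≤⟨ ∑-mono-≤ R (λ y _ → ∑ⱽ-+-≤ k R (λ v → ⟦∨⟧≤ (x ≡ᵇ y) (elem x v))) ⟩
      ∑ R (λ y → ∑ⱽ k R (λ v → ⟦ x ≡ᵇ y ⟧) +q ∑ⱽ k R (λ v → ⟦ elem x v ⟧))   ≡⟨ ∑-+ R _ _ ⟩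
      ∑ R (λ y → ∑ⱽ k R (λ v → ⟦ x ≡ᵇ y ⟧)) +q ∑ R (λ y → ∑ⱽ k R (λ v → ⟦ elem x v ⟧))
                                                                             ≤⟨ ℚP.+-mono-≤ (∑-first≡≤R^k k x) (∑-mono-≤ R (λ y _ → #elem k x)) ⟩
      ℕtoℚ (R ^ k) +q ∑ R (λ _ → ℕtoℚ (k *ₙ R ^ (k ∸ 1)))                    ≡⟨ cong (ℕtoℚ (R ^ k) +q_) (trans (∑-const R _)
                                                                                 (trans (sym (ℕtoℚ-* R _)) (cong ℕtoℚ (R*[k*R^[k-1]] k)))) ⟩
      ℕtoℚ (R ^ k) +q ℕtoℚ (k *ₙ R ^ k)                                      ≡⟨ sym (ℕtoℚ-+ (R ^ k) (k *ₙ R ^ k)) ⟩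
      ℕtoℚ (suc k *ₙ R ^ (suc k ∸ 1))                                        ∎
    where open ℚP.≤-Reasoning

  #sum≡∧elem : ∀ k m x → ∑ⱽ k R (λ v → ⟦ sumV v ≡ᵇ m ⟧ * ⟦ elem x v ⟧) ≤q ℕtoℚ (k *ₙ R ^ (k ∸ 2))
  #sum≡∧elem zero    m x = ℚP.≤-reflexive (trans (ℚP.+-identityʳ _) (ℚP.*-zeroʳ ⟦ 0 ≡ᵇ m ⟧))
  #sum≡∧elem (suc k) m x = begin
      ∑ⱽ (suc k) R (λ v → ⟦ sumV v ≡ᵇ m ⟧ * ⟦ elem x v ⟧)                     ≡⟨ ∑ⱽ-suc k R _ ⟩
      ∑ R (λ y → ∑ⱽ k R (λ v → ⟦ y + sumV v ≡ᵇ m ⟧ * ⟦ (x ≡ᵇ y) ∨ elem x v ⟧)) ≤⟨ ∑-mono-≤ R (λ y _ → ∑ⱽ-+-≤ k R (λ v →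
                                                                                 ⟦⟧*⟦∨⟧≤ (y + sumV v ≡ᵇ m) (x ≡ᵇ y) (elem x v))) ⟩
      ∑ R (λ y → ∑ⱽ k R (λ v → ⟦ y + sumV v ≡ᵇ m ⟧ * ⟦ x ≡ᵇ y ⟧) +q ∑ⱽ k R (λ v → ⟦ y + sumV v ≡ᵇ m ⟧ * ⟦ elem x v ⟧))
                                                                              ≡⟨ ∑-+ R _ _ ⟩
      ∑ R (λ y → ∑ⱽ k R (λ v → ⟦ y + sumV v ≡ᵇ m ⟧ * ⟦ x ≡ᵇ y ⟧)) +q ∑ R (λ y → ∑ⱽ k R (λ v → ⟦ y + sumV v ≡ᵇ m ⟧ * ⟦ elem x v ⟧))
                                                                              ≤⟨ ℚP.+-mono-≤ first≡x
                                                                                  (ℚP.≤-trans (∑-first-sum≤ k m _ (λ v → ⟦⟧-nonNeg (elem x v))) (#elem k x)) ⟩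
      ℕtoℚ (R ^ (k ∸ 1)) +q ℕtoℚ (k *ₙ R ^ (k ∸ 1))                           ≡⟨ sym (ℕtoℚ-+ (R ^ (k ∸ 1)) (k *ₙ R ^ (k ∸ 1))) ⟩
      ℕtoℚ (suc k *ₙ R ^ (suc k ∸ 2))                                         ∎
    where
    open ℚP.≤-Reasoning
    ⟦⟧*⟦∨⟧≤ : ∀ a c d → ⟦ a ⟧ * ⟦ c ∨ d ⟧ ≤q ⟦ a ⟧ * ⟦ c ⟧ +q ⟦ a ⟧ * ⟦ d ⟧
    ⟦⟧*⟦∨⟧≤ a c d = subst (⟦ a ⟧ * ⟦ c ∨ d ⟧ ≤q_) (ℚP.*-distribˡ-+ ⟦ a ⟧ ⟦ c ⟧ ⟦ d ⟧) (*-monoˡ-≤-nonNeg ⟦ a ⟧ (⟦⟧-nonNeg a) (⟦∨⟧≤ c d))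
    first≡x : ∑ R (λ y → ∑ⱽ k R (λ v → ⟦ y + sumV v ≡ᵇ m ⟧ * ⟦ x ≡ᵇ y ⟧)) ≤q ℕtoℚ (R ^ (k ∸ 1))
    first≡x = begin
        ∑ R (λ y → ∑ⱽ k R (λ v → ⟦ y + sumV v ≡ᵇ m ⟧ * ⟦ x ≡ᵇ y ⟧)) ≡⟨ ∑-cong′ R (λ y → trans (∑ⱽ-cong′ k R (λ v →
                                                                      trans (ℚP.*-comm ⟦ y + sumV v ≡ᵇ m ⟧ ⟦ x ≡ᵇ y ⟧)
                                                                            (cong (λ z → ⟦ z ⟧ * ⟦ y + sumV v ≡ᵇ m ⟧) (≡ᵇ-sym x y))))
                                                                      (∑ⱽ-*ˡ k R ⟦ y ≡ᵇ x ⟧ (λ v → ⟦ y + sumV v ≡ᵇ m ⟧))) ⟩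
        ∑ R (λ y → ⟦ y ≡ᵇ x ⟧ * ∑ⱽ k R (λ v → ⟦ y + sumV v ≡ᵇ m ⟧)) ≤⟨ ∑-indicator-≤ R x (λ y → ∑ⱽ k R (λ v → ⟦ y + sumV v ≡ᵇ m ⟧))
                                                                      (λ y → ∑ⱽ-nonNeg k R (λ v → ⟦⟧-nonNeg (y + sumV v ≡ᵇ m))) ⟩
        ∑ⱽ k R (λ v → ⟦ x + sumV v ≡ᵇ m ⟧)                          ≤⟨ ∑ⱽ-mono-≤′ k R (λ v → ⟦+≡⟧≤⟦≡∸⟧ x (sumV v) m) ⟩
        ∑ⱽ k R (λ v → ⟦ sumV v ≡ᵇ m ∸ x ⟧)                          ≤⟨ #sum≡ k (m ∸ x) ⟩
        ℕtoℚ (R ^ (k ∸ 1))                                          ∎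

  #notDistinct : ∀ k → ∑ⱽ k R (λ v → ⟦ not (distinct v) ⟧) ≤q ℕtoℚ (k *ₙ k *ₙ R ^ (k ∸ 1))
  #notDistinct zero    = ℚP.≤-refl
  #notDistinct (suc k) = begin
      ∑ⱽ (suc k) R (λ v → ⟦ not (distinct v) ⟧)                                   ≡⟨ ∑ⱽ-suc k R _ ⟩
      ∑ R (λ y → ∑ⱽ k R (λ v → ⟦ not (not (elem y v) ∧ distinct v) ⟧))           ≤⟨ ∑-mono-≤ R (λ y _ → ∑ⱽ-+-≤ k R (λ v →
                                                                                    ⟦not-distinct-∷⟧≤ (elem y v) (distinct v))) ⟩
      ∑ R (λ y → ∑ⱽ k R (λ v → ⟦ elem y v ⟧) +q ∑ⱽ k R (λ v → ⟦ not (distinct v) ⟧)) ≤⟨ ∑-mono-≤ R (λ y _ → ℚP.+-mono-≤ (#elem k y) (#notDistinct k)) ⟩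
      ∑ R (λ y → ℕtoℚ X₁ +q ℕtoℚ X₂)                                             ≡⟨ ∑-const R _ ⟩
      ℕtoℚ R * (ℕtoℚ X₁ +q ℕtoℚ X₂)                                              ≡⟨ trans (cong (ℕtoℚ R *_) (sym (ℕtoℚ-+ X₁ X₂))) (sym (ℕtoℚ-* R (X₁ + X₂))) ⟩
      ℕtoℚ (R *ₙ (X₁ + X₂))                                                      ≤⟨ ℕtoℚ-mono-≤ (ℕP.≤-trans (ℕP.≤-reflexive R*[X₁+X₂])
                                                                                      (k*X+k*[k*X]≤[1+k]²*X k (R ^ k))) ⟩
      ℕtoℚ (suc k *ₙ suc k *ₙ R ^ (suc k ∸ 1))                                   ∎
    where
    open ℚP.≤-Reasoning
    X₁ = k *ₙ R ^ (k ∸ 1)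
    X₂ = k *ₙ k *ₙ R ^ (k ∸ 1)
    R*[X₁+X₂] : R *ₙ (X₁ + X₂) ≡ k *ₙ R ^ k + k *ₙ (k *ₙ R ^ k)
    R*[X₁+X₂] = trans (ℕP.*-distribˡ-+ R X₁ X₂) (cong₂ _+_ (R*[k*R^[k-1]] k)
      (trans (cong (R *ₙ_) (ℕP.*-assoc k k _))
      (trans (solve 3 (λ R k X → R :* (k :* X) := k :* (R :* X)) refl R k X₁)
             (cong (k *ₙ_) (R*[k*R^[k-1]] k)))))
      where open ℕ-Solver

  #first-repeated≤ : ∀ j m → ∑ R (λ y → ∑ⱽ j R (λ v → ⟦ y + sumV v ≡ᵇ m ⟧ * ⟦ elem y v ⟧)) ≤q ℕtoℚ (R *ₙ (j *ₙ R ^ (j ∸ 2)))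
  #first-repeated≤ j m = begin
      ∑ R (λ y → ∑ⱽ j R (λ v → ⟦ y + sumV v ≡ᵇ m ⟧ * ⟦ elem y v ⟧)) ≤⟨ ∑-mono-≤ R (λ y _ → ℚP.≤-trans
                                                                       (∑ⱽ-mono-≤′ j R (λ v → *-monoʳ-≤-nonNeg ⟦ elem y v ⟧ (⟦⟧-nonNeg (elem y v))
                                                                         (⟦+≡⟧≤⟦≡∸⟧ y (sumV v) m)))
                                                                       (#sum≡∧elem j (m ∸ y) y)) ⟩
      ∑ R (λ y → ℕtoℚ (j *ₙ R ^ (j ∸ 2)))                           ≡⟨ ∑-const R _ ⟩
      ℕtoℚ R * ℕtoℚ (j *ₙ R ^ (j ∸ 2))                              ≡⟨ sym (ℕtoℚ-* R _) ⟩
      ℕtoℚ (R *ₙ (j *ₙ R ^ (j ∸ 2)))                                ∎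
    where open ℚP.≤-Reasoning

  #pair-repeated≤1 : ∀ m → ∑ R (λ y → ∑ⱽ 1 R (λ v → ⟦ y + sumV v ≡ᵇ m ⟧ * ⟦ elem y v ⟧)) ≤q 1ℚ
  #pair-repeated≤1 m = begin
      ∑ R (λ y → ∑ⱽ 1 R (λ v → ⟦ y + sumV v ≡ᵇ m ⟧ * ⟦ elem y v ⟧))            ≡⟨ ∑-cong′ R (λ y → ∑ⱽ-suc 0 R _) ⟩
      ∑ R (λ y → ∑ R (λ z → ⟦ y + (z + 0) ≡ᵇ m ⟧ * ⟦ (y ≡ᵇ z) ∨ false ⟧ +q 0ℚ)) ≤⟨ ∑-mono-≤ R (λ y _ → ℚP.≤-trans
                                                                                   (∑-mono-≤ R (λ z _ → subst (_≤q ⟦ z ≡ᵇ y ⟧ * ⟦ y + y ≡ᵇ m ⟧)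
                                                                                     (sym (ℚP.+-identityʳ _)) (diagonal y z)))
                                                                                   (∑-indicator-≤ R y (λ _ → ⟦ y + y ≡ᵇ m ⟧) (λ _ → ⟦⟧-nonNeg (y + y ≡ᵇ m)))) ⟩
      ∑ R (λ y → ⟦ y + y ≡ᵇ m ⟧)                                              ≤⟨ ∑-mono-≤ R (λ y _ → ⟦⟧-mono (y + y ≡ᵇ m) (y ≡ᵇ m ℕ./ 2) (half y)) ⟩
      ∑ R (λ y → ⟦ y ≡ᵇ m ℕ./ 2 ⟧)                                            ≤⟨ ∑-indicator≤1 R (m ℕ./ 2) ⟩
      1ℚ                                                                      ∎
    where
    open ℚP.≤-Reasoning
    half : ∀ y → (y + y ≡ᵇ m) ≡ true → (y ≡ᵇ m ℕ./ 2) ≡ true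
    half y e = ≡ᵇ-true (sym (trans (cong (ℕ._/ 2) (sym (≡ᵇ-sound {y + y} {m} e)))
      (trans (cong (ℕ._/ 2) (solve 1 (λ y → y :+ y := y :* con 2) refl y)) (ℕDM.m*n/n≡m y 2))))
      where open ℕ-Solver
    diagonal : ∀ y z → ⟦ y + (z + 0) ≡ᵇ m ⟧ * ⟦ (y ≡ᵇ z) ∨ false ⟧ ≤q ⟦ z ≡ᵇ y ⟧ * ⟦ y + y ≡ᵇ m ⟧
    diagonal y z = subst₂ _≤q_ (⟦∧⟧ (y + (z + 0) ≡ᵇ m) _) (⟦∧⟧ (z ≡ᵇ y) _) (⟦⟧-mono _ _ y≡z)
      where
      y≡z : ((y + (z + 0) ≡ᵇ m) ∧ ((y ≡ᵇ z) ∨ false)) ≡ true → ((z ≡ᵇ y) ∧ (y + y ≡ᵇ m)) ≡ true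
      y≡z e with ≡ᵇ-sound {y} {z} (subst (_≡ true) (BoolP.∨-identityʳ (y ≡ᵇ z)) (∧-true-r (y + (z + 0) ≡ᵇ m) e))
      ... | refl = cong₂ _∧_ (≡ᵇ-true {y} refl)
                     (trans (cong (λ w → y + w ≡ᵇ m) (sym (ℕP.+-identityʳ y))) (∧-true-l (y + (y + 0) ≡ᵇ m) e))

  #sum≡∧notDistinct-∷ : ∀ j m → ∑ⱽ (suc j) R (λ v → ⟦ sumV v ≡ᵇ m ⟧ * ⟦ not (distinct v) ⟧) ≤q
      ∑ R (λ y → ∑ⱽ j R (λ v → ⟦ y + sumV v ≡ᵇ m ⟧ * ⟦ elem y v ⟧)) +q ℕtoℚ (j *ₙ j *ₙ R ^ (j ∸ 1))
  #sum≡∧notDistinct-∷ j m = begin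
      ∑ⱽ (suc j) R (λ v → ⟦ sumV v ≡ᵇ m ⟧ * ⟦ not (distinct v) ⟧)                 ≡⟨ ∑ⱽ-suc j R _ ⟩
      ∑ R (λ y → ∑ⱽ j R (λ v → ⟦ y + sumV v ≡ᵇ m ⟧ * ⟦ not (not (elem y v) ∧ distinct v) ⟧))
                                                                                  ≤⟨ ∑-mono-≤ R (λ y _ → ∑ⱽ-+-≤ j R (λ v → split y v)) ⟩
      ∑ R (λ y → ∑ⱽ j R (λ v → ⟦ y + sumV v ≡ᵇ m ⟧ * ⟦ elem y v ⟧) +q ∑ⱽ j R (λ v → ⟦ y + sumV v ≡ᵇ m ⟧ * ⟦ not (distinct v) ⟧))
                                                                                  ≡⟨ ∑-+ R _ _ ⟩
      ∑ R (λ y → ∑ⱽ j R (λ v → ⟦ y + sumV v ≡ᵇ m ⟧ * ⟦ elem y v ⟧)) +q ∑ R (λ y → ∑ⱽ j R (λ v → ⟦ y + sumV v ≡ᵇ m ⟧ * ⟦ not (distinct v) ⟧))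
                                                                                  ≤⟨ ℚP.+-monoʳ-≤ first-repeated (ℚP.≤-trans
                                                                                      (∑-first-sum≤ j m _ (λ v → ⟦⟧-nonNeg (not (distinct v))))
                                                                                      (#notDistinct j)) ⟩
      ∑ R (λ y → ∑ⱽ j R (λ v → ⟦ y + sumV v ≡ᵇ m ⟧ * ⟦ elem y v ⟧)) +q ℕtoℚ (j *ₙ j *ₙ R ^ (j ∸ 1)) ∎
    where
    open ℚP.≤-Reasoning
    first-repeated = ∑ R (λ y → ∑ⱽ j R (λ v → ⟦ y + sumV v ≡ᵇ m ⟧ * ⟦ elem y v ⟧))
    split : ∀ y v → ⟦ y + sumV v ≡ᵇ m ⟧ * ⟦ not (not (elem y v) ∧ distinct v) ⟧ ≤q
                    ⟦ y + sumV v ≡ᵇ m ⟧ * ⟦ elem y v ⟧ +q ⟦ y + sumV v ≡ᵇ m ⟧ * ⟦ not (distinct v) ⟧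
    split y v = subst (⟦ y + sumV v ≡ᵇ m ⟧ * ⟦ not (not (elem y v) ∧ distinct v) ⟧ ≤q_)
      (ℚP.*-distribˡ-+ ⟦ y + sumV v ≡ᵇ m ⟧ ⟦ elem y v ⟧ ⟦ not (distinct v) ⟧)
      (*-monoˡ-≤-nonNeg ⟦ y + sumV v ≡ᵇ m ⟧ (⟦⟧-nonNeg (y + sumV v ≡ᵇ m)) (⟦not-distinct-∷⟧≤ (elem y v) (distinct v)))

  #sum≡∧notDistinct : ∀ k m → ∑ⱽ (2 + k) R (λ v → ⟦ sumV v ≡ᵇ m ⟧ * ⟦ not (distinct v) ⟧) ≤q ℕtoℚ ((2 + k) *ₙ (2 + k) *ₙ R ^ k)
  #sum≡∧notDistinct zero    m = ℚP.≤-trans (#sum≡∧notDistinct-∷ 1 m)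
    (ℚP.≤-trans (ℚP.+-monoˡ-≤ _ (#pair-repeated≤1 m)) (ℕtoℚ-mono-≤ {2} {4 *ₙ 1} (s≤s (s≤s z≤n))))
  #sum≡∧notDistinct (suc k) m = ℚP.≤-trans (#sum≡∧notDistinct-∷ j m)
    (ℚP.≤-trans (ℚP.+-monoˡ-≤ _ (#first-repeated≤ j m))
      (subst (_≤q ℕtoℚ (suc j *ₙ suc j *ₙ R ^ suc k)) (ℕtoℚ-+ (R *ₙ (j *ₙ R ^ k)) (j *ₙ j *ₙ R ^ suc k))
        (ℕtoℚ-mono-≤ (ℕP.≤-trans (ℕP.≤-reflexive rearrange) (k*X+k*[k*X]≤[1+k]²*X j (R ^ suc k))))))
    where
    j = 2 + k
    rearrange : R *ₙ (j *ₙ R ^ k) + j *ₙ j *ₙ R ^ suc k ≡ j *ₙ R ^ suc k + j *ₙ (j *ₙ R ^ suc k)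
    rearrange = cong₂ _+_ (trans (sym (ℕP.*-assoc R j (R ^ k))) (trans (cong (ℕ._* R ^ k) (ℕP.*-comm R j)) (ℕP.*-assoc j R (R ^ k))))
                          (ℕP.*-assoc j j (R ^ suc k))

≈-congˡ : ∀ {f f′ g : ℕ → ℚ} {e} → (∀ n → f n ≡ f′ n) → f′ ≈ g +O[n^ e ] → f ≈ g +O[n^ e ]
≈-congˡ {g = g} {e} f≡f′ (C , f′≈g) = C , λ n n≥1 → subst (λ z → ∣ z -q g n ∣q ≤q C * ℕtoℚ (n ^ e)) (sym (f≡f′ n)) (f′≈g n n≥1)

compositionCount≈ : ∀ m → (compositionCount (suc m)) ≈ (λ n → inv! m * ℕtoℚ (n ^ m)) +O[n^ m ∸ 1 ]
compositionCount≈ m = lowerOrderConstant m , compositionCount≈n^ m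

[1+n]^e≤2^e*n^e : ∀ n e → 1 ≤ n → suc n ^ e ≤ 2 ^ e *ₙ n ^ e
[1+n]^e≤2^e*n^e n zero    _   = s≤s z≤n
[1+n]^e≤2^e*n^e n (suc e) n≥1 = ℕP.≤-trans (ℕP.*-mono-≤ 1+n≤2n ([1+n]^e≤2^e*n^e n e n≥1))
  (ℕP.≤-reflexive (solve 3 (λ n a b → (n :+ (n :+ con 0)) :* (a :* b) := (a :+ (a :+ con 0)) :* (n :* b)) refl n (2 ^ e) (n ^ e)))
  where
  open ℕ-Solver
  1+n≤2n : suc n ≤ n + (n + 0)
  1+n≤2n = subst (_≤ n + (n + 0)) (ℕP.+-comm n 1) (ℕP.+-monoʳ-≤ n (subst (1 ≤_) (sym (ℕP.+-identityʳ n)) n≥1))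

repeatedCompositions≤ : ∀ k′ n → 1 ≤ n →
  repeatedCompositions (2 + k′) n ≤q ℕtoℚ ((2 + k′) *ₙ (2 + k′) *ₙ 2 ^ k′) * ℕtoℚ (n ^ k′)
repeatedCompositions≤ k′ n n≥1 = begin
    repeatedCompositions k n                                     ≤⟨ ∑ⱽ-mono-≤′ k (suc n) (λ w → *-monoʳ-≤-nonNeg ⟦ not (distinct w) ⟧
                                                                      (⟦⟧-nonNeg (not (distinct w)))
                                                                      (⟦⟧-mono (isComposition n w) (sumV w ≡ᵇ n) (∧-true-r (allPositive w)))) ⟩
    ∑ⱽ k (suc n) (λ w → ⟦ sumV w ≡ᵇ n ⟧ * ⟦ not (distinct w) ⟧) ≤⟨ RepeatedEntries.#sum≡∧notDistinct (suc n) k′ n ⟩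
    ℕtoℚ (k *ₙ k *ₙ suc n ^ k′)                                  ≤⟨ ℕtoℚ-mono-≤ (ℕP.*-monoʳ-≤ (k *ₙ k) ([1+n]^e≤2^e*n^e n k′ n≥1)) ⟩
    ℕtoℚ (k *ₙ k *ₙ (2 ^ k′ *ₙ n ^ k′))                          ≡⟨ cong ℕtoℚ (sym (ℕP.*-assoc (k *ₙ k) (2 ^ k′) (n ^ k′))) ⟩
    ℕtoℚ (k *ₙ k *ₙ 2 ^ k′ *ₙ n ^ k′)                            ≡⟨ ℕtoℚ-* (k *ₙ k *ₙ 2 ^ k′) (n ^ k′) ⟩
    ℕtoℚ (k *ₙ k *ₙ 2 ^ k′) * ℕtoℚ (n ^ k′)                      ∎
  where
  open ℚP.≤-Reasoning
  k = 2 + k′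

∣P-u*M∣≤ : ∀ P T M K u E₁ E₂ → u * K ≡ 1ℚ → 0ℚ ≤q u →
           ∣ K * P -q T ∣q ≤q K * E₁ → ∣ T -q M ∣q ≤q E₂ → ∣ P -q u * M ∣q ≤q E₁ +q u * E₂
∣P-u*M∣≤ P T M K u E₁ E₂ uK≡1 u≥0 KP≈T T≈M = begin
    ∣ P -q u * M ∣q                                 ≡⟨ cong ∣_∣q split ⟩
    ∣ u * (K * P -q T) +q u * (T -q M) ∣q            ≤⟨ ℚP.∣p+q∣≤∣p∣+∣q∣ (u * (K * P -q T)) (u * (T -q M)) ⟩
    ∣ u * (K * P -q T) ∣q +q ∣ u * (T -q M) ∣q       ≡⟨ cong₂ _+q_ (trans (ℚP.∣p*q∣≡∣p∣*∣q∣ u _) (cong (_* ∣ K * P -q T ∣q) ∣u∣≡u))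
                                                                  (trans (ℚP.∣p*q∣≡∣p∣*∣q∣ u _) (cong (_* ∣ T -q M ∣q) ∣u∣≡u)) ⟩
    u * ∣ K * P -q T ∣q +q u * ∣ T -q M ∣q           ≤⟨ ℚP.+-mono-≤ (*-monoˡ-≤-nonNeg u u≥0 KP≈T) (*-monoˡ-≤-nonNeg u u≥0 T≈M) ⟩
    u * (K * E₁) +q u * E₂                          ≡⟨ cong (_+q u * E₂) (trans (sym (ℚP.*-assoc u K E₁))
                                                         (trans (cong (_* E₁) uK≡1) (ℚP.*-identityˡ E₁))) ⟩
    E₁ +q u * E₂                                    ∎
  where
  open ℚP.≤-Reasoning
  ∣u∣≡u : ∣ u ∣q ≡ u
  ∣u∣≡u = ℚP.0≤p⇒∣p∣≡p u≥0
  split : P -q u * M ≡ u * (K * P -q T) +q u * (T -q M)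
  split = trans (cong (λ z → z -q u * M) (sym (trans (cong (_* P) uK≡1) (ℚP.*-identityˡ P))))
    (solve 5 (λ P T M K u → (u :* K) :* P :- u :* M := u :* (K :* P :- T) :+ u :* (T :- M)) refl P T M K u)
    where open ℚ-Solver

sortedSum≈ : ∀ k′ (Φ : ℕ → Vec ℕ (2 + k′) → ℚ) (M : ℕ → ℚ) →
  (∀ n v → Φ n (sortV v) ≡ Φ n v) → (∀ n v → 0ℚ ≤q Φ n v) → (∀ n v → Φ n v ≤q ⟦ isComposition n v ⟧) →
  (λ n → ∑ⱽ (2 + k′) (suc n) (Φ n)) ≈ (λ n → inv! (suc k′) * M n) +O[n^ k′ ] →
  (λ n → ∑ⱽ (2 + k′) (suc n) (λ w → ⟦ sorted w ⟧ * Φ n w)) ≈ (λ n → (inv! (2 + k′) * inv! (suc k′)) * M n) +O[n^ k′ ]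
sortedSum≈ k′ Φ M Φ-sym Φ≥0 Φ≤ (C , T≈M) = c₁ +q inv! k * C , λ n n≥1 →
  subst₂ (λ x y → ∣ P n -q x ∣q ≤q y) (sym (ℚP.*-assoc (inv! k) (inv! (suc k′)) (M n))) (factor c₁ (inv! k) C (N n))
    (∣P-u*M∣≤ (P n) (∑ⱽ k (suc n) (Φ n)) (inv! (suc k′) * M n) (ℕtoℚ (k !)) (inv! k) (c₁ * N n) (C * N n)
      (inv!*! k) (inv!-nonNeg k) (k!P≈T n n≥1) (T≈M n n≥1))
  where
  k = 2 + k′
  c₁ = ℕtoℚ (k *ₙ k *ₙ 2 ^ k′)
  N : ℕ → ℚ
  N n = ℕtoℚ (n ^ k′)
  P : ℕ → ℚ
  P n = ∑ⱽ k (suc n) (λ w → ⟦ sorted w ⟧ * Φ n w)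
  factor : ∀ c₁ u C N → c₁ * N +q u * (C * N) ≡ (c₁ +q u * C) * N
  factor = solve 4 (λ c₁ u C N → c₁ :* N :+ u :* (C :* N) := (c₁ :+ u :* C) :* N) refl
    where open ℚ-Solver
  k!P≈T : ∀ n → 1 ≤ n → ∣ ℕtoℚ (k !) * P n -q ∑ⱽ k (suc n) (Φ n) ∣q ≤q ℕtoℚ (k !) * (c₁ * N n)
  k!P≈T n n≥1 = ℚP.≤-trans (k!*∑sorted≈∑ k n (Φ n) (Φ-sym n) (Φ≥0 n) (Φ≤ n))
    (*-monoˡ-≤-nonNeg (ℕtoℚ (k !)) (ℕtoℚ-nonNeg (k !)) (repeatedCompositions≤ k′ n n≥1))

p-as-∑ⱽ : ∀ k n → ℕtoℚ (p k n) ≡ ∑ⱽ k (suc n) (λ w → ⟦ sorted w ⟧ * ⟦ isComposition n w ⟧)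
p-as-∑ⱽ k n = trans (length-filter sorted (compositions k n)) (trans (∑ᴸ-filter (isComposition n) (tuplesBelow k (suc n)) (λ v → ⟦ sorted v ⟧))
  (∑ⱽ-cong′ k (suc n) (λ w → ℚP.*-comm ⟦ isComposition n w ⟧ ⟦ sorted w ⟧)))

p′-as-∑ⱽ : ∀ k n → ℕtoℚ (p′ k n) ≡ ∑ⱽ k (suc n) (λ w → ⟦ sorted w ⟧ * (⟦ isComposition n w ⟧ * ⟦ isCoprime w ⟧))
p′-as-∑ⱽ k n = trans (length-filter isCoprime (partitions k n)) (trans (∑ᴸ-filter sorted (compositions k n) (λ v → ⟦ isCoprime v ⟧))
  (trans (∑ᴸ-filter (isComposition n) (tuplesBelow k (suc n)) (λ v → ⟦ sorted v ⟧ * ⟦ isCoprime v ⟧))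
    (∑ⱽ-cong′ k (suc n) (λ w → *-leftComm ⟦ isComposition n w ⟧ ⟦ sorted w ⟧ ⟦ isCoprime w ⟧))))

p≈n^ : ∀ k → 2 ≤ k → (λ n → ℕtoℚ (p k n)) ≈ (λ n → (inv! k * inv! (k ∸ 1)) * ℕtoℚ (n ^ (k ∸ 1))) +O[n^ k ∸ 2 ]
p≈n^ (suc zero) (s≤s ())
p≈n^ (suc (suc k′)) _ = ≈-congˡ {e = k′} (p-as-∑ⱽ (2 + k′)) (sortedSum≈ k′ (λ n v → ⟦ isComposition n v ⟧) (λ n → ℕtoℚ (n ^ suc k′))
  (λ n v → cong ⟦_⟧ (isComposition-sortV n v)) (λ n v → ⟦⟧-nonNeg (isComposition n v)) (λ n v → ℚP.≤-refl)
  (compositionCount≈ (suc k′)))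

p′≈J : ∀ k → 2 ≤ k → (λ n → ℕtoℚ (p′ k n)) ≈ (λ n → (inv! k * inv! (k ∸ 1)) * ℤtoℚ (J (k ∸ 1) n)) +O[n^ k ∸ 2 ]
p′≈J (suc zero) (s≤s ())
p′≈J (suc (suc k′)) k≥2 = ≈-congˡ {e = k′} (p′-as-∑ⱽ (2 + k′)) (sortedSum≈ k′ Φ (λ n → ℤtoℚ (J (suc k′) n))
  (λ n v → cong₂ (λ x y → ⟦ x ⟧ * ⟦ y ⟧) (isComposition-sortV n v) (isCoprime-sortV v))
  (λ n v → *-nonNeg (⟦⟧-nonNeg (isComposition n v)) (⟦⟧-nonNeg (isCoprime v)))
  (λ n v → subst (Φ n v ≤q_) (ℚP.*-identityʳ _) (*-monoˡ-≤-nonNeg ⟦ isComposition n v ⟧ (⟦⟧-nonNeg (isComposition n v)) (⟦⟧≤1 (isCoprime v))))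
  (≈-congˡ {e = k′} (λ n → sym (c′-as-∑ⱽ (2 + k′) n)) (c′≈J (2 + k′) k≥2)))
  where
  Φ : ℕ → Vec ℕ (2 + k′) → ℚ
  Φ n v = ⟦ isComposition n v ⟧ * ⟦ isCoprime v ⟧

proposition3p1 : (k : ℕ) → 1 ≤ k →
    ((n : ℕ) → 1 ≤ n → ℕtoℚ (c′ k n) ≡ Σ< k (λ i → a k i * ℤtoℚ (J i n)))
    × (2 ≤ k →
        ((λ n → ℕtoℚ (c′ k n)) ≈ (λ n → inv! (k ∸ 1) * ℤtoℚ (J (k ∸ 1) n)) +O[n^ k ∸ 2 ])
        × ((λ n → ℕtoℚ (p k n)) ≈ (λ n → (inv! k * inv! (k ∸ 1)) * ℕtoℚ (n ^ (k ∸ 1))) +O[n^ k ∸ 2 ])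
        × ((λ n → ℕtoℚ (p′ k n)) ≈ (λ n → (inv! k * inv! (k ∸ 1)) * ℤtoℚ (J (k ∸ 1) n)) +O[n^ k ∸ 2 ]))
proposition3p1 k k≥1 = c′≡∑aJ k k≥1 , λ k≥2 → c′≈J k k≥2 , p≈n^ k k≥2 , p′≈J k k≥2
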